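{- Let $A_n(x,y,s,t)=\sum_{\pi\in\mathfrak{S}_n}x^{{\rm basc}(\pi)}y^{{\rm des}(\pi)-{\rm plrmin}(\pi)}s^{{\rm suc}(\pi)}t^{{\rm plrmin}(\pi)}$. Then for $n\geqslant1$, $$A_{n+1}(x,y,s,t)=(s+t)A_{n}(x,y,s,t)+xy\left(\frac{\partial}{\partial x}+\frac{\partial}{\partial y}+\frac{\partial}{\partial s}+\frac{\partial}{\partial t}\right)A_{n}(x,y,s,t),$$ and for $n\geqslant 0$, $$A_{n+1}(x,y,s,t)=\sum_{i=0}^n(s+t)^i\sum_{j=0}^{\lfloor (n-i)/2\rfloor}\gamma_{n,i,j}(2xy)^j(x+y)^{n-i-2j}.$$ In particular $A_{n+1}(x,y,s,t)$ is symmetric in the variables $s$ and $t$, and symmetric in the variables $x$ and $y$.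
   Context: For $\pi\in\mathfrak{S}_n$: ${\rm des}(\pi)=\#\{i\in[n-1]:\pi(i)>\pi(i+1)\}$, ${\rm suc}(\pi)=\#\{i\in[n-1]:\pi(i+1)=\pi(i)+1\}$, ${\rm basc}(\pi)=\#\{i\in[n-1]:\pi(i+1)\geqslant\pi(i)+2\}$. Set $\pi(n+1)=0$. A value $\pi(i)$ ($i\in[n]$) is a left-to-right minimum if $i=1$ or $\pi(i)<\pi(j)$ for all $j<i$. It is a proper left-to-right minimum if it is a left-to-right minimum, $\pi(i)\neq1$, and there is $k>i$ with $\pi(k)=\pi(i)-1$ and $\pi(k)>\pi(k+1)$. ${\rm plrmin}(\pi)$ is the number of proper left-to-right minima. The integers $\gamma_{n,i,j}$ are defined by $\gamma_{0,0,0}=1$, $\gamma_{0,i,j}=0$ for $(i,j)\neq(0,0)$, $\gamma_{n,i,j}=0$ if an index is negative, and $\gamma_{n+1,i,j}=\gamma_{n,i-1,j}+(1+i)\gamma_{n,i+1,j-1}+j\gamma_{n,i,j}+(n-i-2j+2)\gamma_{n,i,j-1}$. -}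

module Defs where

open import Data.Nat as ℕ using (ℕ; zero; suc; _<_; _≤_; _∸_; _≟_; _<?_; _≤?_)
open import Data.Integer as ℤ using (ℤ; +_; _+_; _*_; _-_)
open import Data.List using (List; []; _∷_; _++_; [_]; length; filter; concatMap; map; foldr; upTo)
open import Data.List.Relation.Unary.All using (All; all?)
open import Data.List.Relation.Unary.Any using (Any; any?)
open import Data.List.Relation.Unary.Unique.DecPropositional _≟_ using (Unique; unique?)
open import Data.Product using (_×_; _,_; proj₁; proj₂)
open import Data.Product.Properties using (≡-dec)
open import Relation.Nullary using (¬_; Dec; yes; no; ¬?)
open import Relation.Nullary.Decidable using (_×-dec_)
open import Relation.Binary.PropositionalEquality using (_≡_)

-- Permutations of [n] in one-line notation: the words π(1)…π(n) of
-- length n over the alphabet {1,…,n} with pairwise distinct letters.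

words : ℕ → ℕ → List (List ℕ)
words n zero    = [] ∷ []
words n (suc k) = concatMap (λ w → map (λ a → suc a ∷ w) (upTo n)) (words n k)

perms : ℕ → List (List ℕ)
perms n = filter unique? (words n n)

pairs : List ℕ → List (ℕ × ℕ)
pairs []             = []
pairs (u ∷ [])       = []
pairs (u ∷ v ∷ rest) = (u , v) ∷ pairs (v ∷ rest)

des : List ℕ → ℕ
des π = length (filter (λ p → proj₂ p <? proj₁ p) (pairs π))

sucs : List ℕ → ℕ
sucs π = length (filter (λ p → proj₂ p ≟ suc (proj₁ p)) (pairs π))

basc : List ℕ → ℕ
basc π = length (filter (λ p → suc (suc (proj₁ p)) ≤? proj₂ p) (pairs π))

splitsAux : List ℕ → List ℕ → List (List ℕ × ℕ × List ℕ)
splitsAux pre []         = []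
splitsAux pre (v ∷ post) = (pre , v , post) ∷ splitsAux (pre ++ [ v ]) post

splits : List ℕ → List (List ℕ × ℕ × List ℕ)
splits π = splitsAux [] π

-- position i (given as (pre , v , post)) carries a proper left-to-right
-- minimum: v is a left-to-right minimum (v < every earlier letter; vacuous
-- for i = 1), v ≠ 1, and there is k > i with π(k) = v - 1 and
-- π(k) > π(k+1), where π(n+1) = 0 (hence the appended 0).
Proper : List ℕ × ℕ × List ℕ → Set
Proper (pre , v , post) =
  All (v <_) pre × (¬ (v ≡ 1)) ×
  Any (λ p → (proj₁ p ≡ v ∸ 1) × (proj₂ p < proj₁ p)) (pairs (post ++ [ 0 ]))

proper? : (x : List ℕ × ℕ × List ℕ) → Dec (Proper x)
proper? (pre , v , post) =
  all? (v <?_) pre ×-dec ¬? (v ≟ 1) ×-dec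
  any? (λ p → (proj₁ p ≟ v ∸ 1) ×-dec (proj₂ p <? proj₁ p)) (pairs (post ++ [ 0 ]))

plrmin : List ℕ → ℕ
plrmin π = length (filter proper? (splits π))

-- Formal polynomials in x, y, s, t with integer coefficients, given by
-- their coefficient function: P a b c d = coefficient of x^a y^b s^c t^d.

Poly : Set
Poly = ℕ → ℕ → ℕ → ℕ → ℤ

_≈_ : Poly → Poly → Set
P ≈ Q = ∀ a b c d → P a b c d ≡ Q a b c d

infix 4 _≈_
infixl 6 _⊕_
infixl 7 _⊛_

sumTo : ℕ → (ℕ → ℤ) → ℤ
sumTo zero    f = f 0
sumTo (suc n) f = sumTo n f + f (suc n)

0ₚ : Poly
0ₚ a b c d = + 0

_⊕_ : Poly → Poly → Poly
(P ⊕ Q) a b c d = P a b c d + Q a b c d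

_⊛_ : Poly → Poly → Poly
(P ⊛ Q) a b c d =
  sumTo a λ a₁ → sumTo b λ b₁ → sumTo c λ c₁ → sumTo d λ d₁ →
    P a₁ b₁ c₁ d₁ * Q (a ∸ a₁) (b ∸ b₁) (c ∸ c₁) (d ∸ d₁)

mono : ℕ → ℕ → ℕ → ℕ → Poly
mono a b c d a' b' c' d' with a ≟ a' | b ≟ b' | c ≟ c' | d ≟ d'
... | yes _ | yes _ | yes _ | yes _ = + 1
... | _ | _ | _ | _ = + 0

cst : ℤ → Poly
cst k a b c d = k * mono 0 0 0 0 a b c d

X Y S T : Poly
X = mono 1 0 0 0
Y = mono 0 1 0 0
S = mono 0 0 1 0
T = mono 0 0 0 1

_^ₚ_ : Poly → ℕ → Poly
P ^ₚ zero  = mono 0 0 0 0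
P ^ₚ suc k = P ⊛ (P ^ₚ k)

ΣP : ℕ → (ℕ → Poly) → Poly
ΣP n F a b c d = sumTo n (λ i → F i a b c d)

ΣL : {A : Set} → List A → (A → Poly) → Poly
ΣL xs F = foldr (λ x acc → F x ⊕ acc) 0ₚ xs

∂x ∂y ∂s ∂t : Poly → Poly
∂x P a b c d = + suc a * P (suc a) b c d
∂y P a b c d = + suc b * P a (suc b) c d
∂s P a b c d = + suc c * P a b (suc c) d
∂t P a b c d = + suc d * P a b c (suc d)

swapxy swapst : Poly → Poly
swapxy P a b c d = P b a c d
swapst P a b c d = P a b d c

A : ℕ → Poly
A n = ΣL (perms n) λ π →
  mono (basc π) (des π ∸ plrmin π) (sucs π) (plrmin π)

-- γ_{n,i,j}  (any term with a negative index is 0)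

γ : ℕ → ℕ → ℕ → ℤ
γ zero    zero    zero    = + 1
γ zero    _       _       = + 0
γ (suc n) zero    zero    = + 0 * γ n zero zero
γ (suc n) zero    (suc j) =
  + 1 * γ n 1 j + + suc j * γ n zero (suc j)
  + ((+ n - + 0 - + (2 ℕ.* suc j)) + + 2) * γ n zero j
γ (suc n) (suc i) zero    = γ n i zero + + 0 * γ n (suc i) zero
γ (suc n) (suc i) (suc j) =
  γ n i (suc j) + + suc (suc i) * γ n (suc (suc i)) j
  + + suc j * γ n (suc i) (suc j)
  + ((+ n - + suc i - + (2 ℕ.* suc j)) + + 2) * γ n (suc i) j

module Submission where

-- Every permutation of [n + 1] arises exactly once by inserting n + 1 into a permutation π of [n],
-- either in front or right after a letter u of π. Each insertion changes the exponents of the term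
-- of π in a way determined by what follows u: in front a proper left-to-right minimum appears
-- (t); after n a succession appears (s); a succession u, u + 1 is broken (xy ∂s); a big ascent
-- gains a descent (xy ∂x); a descent whose top u witnesses the proper minimum u + 1 destroys it
-- (xy ∂t); any other descent gains a big ascent (xy ∂y). There are 1, suc π, basc π, plrmin π and
-- des π - plrmin π slots of these kinds, which is the recurrence A_{n+1} = (s + t) A_n + xy ∇ A_n.
--
-- For any derivation δ with δu = δq = 2 and δw = q, the map F ↦ u F + w δF sends
-- Σ γ_{n,i,j} u^i (2w)^j q^{n-i-2j} to the same sum for n + 1, precisely because of the recurrence
-- for γ. With u = s + t, q = x + y, w = xy and δ = ∇ this is the γ-expansion, and since swapping
-- s, t or x, y is a ring automorphism fixing u, q and w, A_{n+1} is symmetric.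
--
-- The polynomials are handled in the ring of formal power series ℤ⟦t⟧⟦s⟧⟦y⟧⟦x⟧, where the four
-- partial derivatives are derivations.

module ℤAlgebras where

  open import Level using (0ℓ)
  open import Algebra.Bundles using (CommutativeSemiring; CommutativeMonoid)
  open import Algebra.Structures using (IsCommutativeSemiring)
  import Algebra.Properties.CommutativeSemigroup as CommutativeSemigroupProperties
  open import Data.Nat as ℕ using (ℕ; zero; suc; _∸_; z≤n; s≤s)
  import Data.Nat.Properties as ℕ
  open import Data.Integer as ℤ using (ℤ; +_)
  import Data.Integer.Properties as ℤ
  open import Data.List using (List; []; _∷_; _++_; map; concatMap; foldr)
  open import Data.List.Membership.Propositional using (_∈_)
  open import Data.List.Relation.Unary.Any using (here; there)
  open import Data.List.Relation.Binary.Permutation.Propositional as ↭ using (_↭_)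
  open import Relation.Binary.PropositionalEquality as ≡ using (_≡_; _≢_)
  open import Relation.Nullary using (yes; no)
  import Relation.Binary.Reasoning.Setoid as ≈-Reasoning

  record ℤAlgebra : Set₁ where
    infix  4 _≈_
    infixl 6 _+_
    infixl 7 _*_
    infixr 8 _·_
    field
      Carrier               : Set
      _≈_                   : Carrier → Carrier → Set
      _+_ _*_               : Carrier → Carrier → Carrier
      0# 1#                 : Carrier
      isCommutativeSemiring : IsCommutativeSemiring _≈_ _+_ _*_ 0# 1#
      _·_                   : ℤ → Carrier → Carrier
      ·-congˡ               : ∀ {k x y} → x ≈ y → k · x ≈ k · y
      ·-distribˡ            : ∀ k x y → k · (x + y) ≈ k · x + k · y
      ·-distribʳ            : ∀ k l x → (k ℤ.+ l) · x ≈ k · x + l · x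
      ·-assoc               : ∀ k l x → (k ℤ.* l) · x ≈ k · (l · x)
      ·-identity            : ∀ x → (+ 1) · x ≈ x
      ·-zero                : ∀ x → (+ 0) · x ≈ 0#
      ·-*-assoc             : ∀ k x y → (k · x) * y ≈ k · (x * y)

    open IsCommutativeSemiring isCommutativeSemiring public hiding (zero)

    commutativeSemiring : CommutativeSemiring 0ℓ 0ℓ
    commutativeSemiring = record { isCommutativeSemiring = isCommutativeSemiring }

    open CommutativeSemiring commutativeSemiring public
      using (+-commutativeMonoid; *-commutativeMonoid)

    +-interchange : ∀ a b c d → (a + b) + (c + d) ≈ (a + c) + (b + d)
    +-interchange = CommutativeSemigroupProperties.interchange
      (CommutativeMonoid.commutativeSemigroup +-commutativeMonoid)

    *-·-assoc : ∀ k x y → x * (k · y) ≈ k · (x * y)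
    *-·-assoc k x y = trans (*-comm x (k · y)) (trans (·-*-assoc k y x) (·-congˡ (*-comm y x)))

    ·-zeroʳ : ∀ k → k · 0# ≈ 0#
    ·-zeroʳ k = trans (·-congˡ (sym (zeroˡ 0#))) (trans (sym (·-*-assoc k 0# 0#)) (zeroʳ _))

    ·-comm : ∀ k l x → (k ℤ.* l) · x ≈ l · (k · x)
    ·-comm k l x = trans (reflexive (≡.cong (_· x) (ℤ.*-comm k l))) (·-assoc l k x)

    ·-≡0 : ∀ {k} x → k ≡ + 0 → k · x ≈ 0#
    ·-≡0 x ≡.refl = ·-zero x

    x+x≈2·x : ∀ x → x + x ≈ (+ 2) · x
    x+x≈2·x x = sym (trans (·-distribʳ (+ 1) (+ 1) x) (+-cong (·-identity x) (·-identity x)))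

    ·≈·1#* : ∀ k x → k · x ≈ (k · 1#) * x
    ·≈·1#* k x = trans (·-congˡ (sym (*-identityˡ x))) (sym (·-*-assoc k 1# x))

    -- (m ∸ 1) + 1 differs from m only for m = 0, where the weight vanishes
    ·-suc∸1 : ∀ m (f : ℕ → Carrier) → (+ m) · f (suc (m ∸ 1)) ≈ (+ m) · f m
    ·-suc∸1 zero    f = trans (·-zero _) (sym (·-zero _))
    ·-suc∸1 (suc m) f = refl

    +-·-cancel : ∀ x → x + ℤ.-[1+ 0 ] · x ≈ 0#
    +-·-cancel x = trans (+-congʳ (sym (·-identity x))) (trans (sym (·-distribʳ (+ 1) ℤ.-[1+ 0 ] x)) (·-zero x))

    infixr 8 _^_
    _^_ : Carrier → ℕ → Carrier
    x ^ zero  = 1#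
    x ^ suc k = x * x ^ k

    ^-cong : ∀ {x y} k → x ≈ y → x ^ k ≈ y ^ k
    ^-cong zero    x≈y = refl
    ^-cong (suc k) x≈y = *-cong x≈y (^-cong k x≈y)

    sumTo : ℕ → (ℕ → Carrier) → Carrier
    sumTo zero    f = f 0
    sumTo (suc n) f = sumTo n f + f (suc n)

    sumTo-cong : ∀ n {f g} → (∀ i → f i ≈ g i) → sumTo n f ≈ sumTo n g
    sumTo-cong zero    f≈g = f≈g 0
    sumTo-cong (suc n) f≈g = +-cong (sumTo-cong n f≈g) (f≈g (suc n))

    sumTo-cong≤ : ∀ n {f g} → (∀ i → i ℕ.≤ n → f i ≈ g i) → sumTo n f ≈ sumTo n g
    sumTo-cong≤ zero    f≈g = f≈g 0 z≤n
    sumTo-cong≤ (suc n) f≈g =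
      +-cong (sumTo-cong≤ n (λ i i≤n → f≈g i (ℕ.m≤n⇒m≤1+n i≤n))) (f≈g (suc n) ℕ.≤-refl)

    sumTo-+ : ∀ n f g → sumTo n (λ i → f i + g i) ≈ sumTo n f + sumTo n g
    sumTo-+ zero    f g = refl
    sumTo-+ (suc n) f g = trans (+-congʳ (sumTo-+ n f g)) (+-interchange _ _ _ _)

    sumTo-· : ∀ n k f → sumTo n (λ i → k · f i) ≈ k · sumTo n f
    sumTo-· zero    k f = refl
    sumTo-· (suc n) k f = trans (+-congʳ (sumTo-· n k f)) (sym (·-distribˡ k _ _))

    sumTo-*ˡ : ∀ n x f → sumTo n (λ i → x * f i) ≈ x * sumTo n f
    sumTo-*ˡ zero    x f = refl
    sumTo-*ˡ (suc n) x f = trans (+-congʳ (sumTo-*ˡ n x f)) (sym (distribˡ x _ _))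

    sumTo-*ʳ : ∀ n f y → sumTo n (λ i → f i * y) ≈ sumTo n f * y
    sumTo-*ʳ zero    f y = refl
    sumTo-*ʳ (suc n) f y = trans (+-congʳ (sumTo-*ʳ n f y)) (sym (distribʳ y _ _))

    *-sumTo-· : ∀ n x (k : ℕ → ℤ) (f : ℕ → Carrier) → x * sumTo n (λ i → k i · f i) ≈ sumTo n (λ i → k i · (x * f i))
    *-sumTo-· n x k f = trans (sym (sumTo-*ˡ n x (λ i → k i · f i))) (sumTo-cong n (λ i → *-·-assoc (k i) x (f i)))

    sumTo-zero : ∀ n {f} → (∀ i → f i ≈ 0#) → sumTo n f ≈ 0#
    sumTo-zero zero    f≈0 = f≈0 0
    sumTo-zero (suc n) f≈0 = trans (+-cong (sumTo-zero n f≈0) (f≈0 (suc n))) (+-identityˡ 0#)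

    sumTo-zero≤ : ∀ n {f} → (∀ i → i ℕ.≤ n → f i ≈ 0#) → sumTo n f ≈ 0#
    sumTo-zero≤ n f≈0 = trans (sumTo-cong≤ n f≈0) (sumTo-zero n (λ _ → refl))

    sumTo-suc : ∀ n f → sumTo (suc n) f ≈ f 0 + sumTo n (λ i → f (suc i))
    sumTo-suc zero    f = refl
    sumTo-suc (suc n) f = trans (+-congʳ (sumTo-suc n f)) (+-assoc _ _ _)

    sumTo-suc₀ : ∀ n {f} → f 0 ≈ 0# → sumTo (suc n) f ≈ sumTo n (λ i → f (suc i))
    sumTo-suc₀ n {f} f0≈0 = trans (sumTo-suc n f) (trans (+-congʳ f0≈0) (+-identityˡ _))

    sumTo-reverse : ∀ n f → sumTo n f ≈ sumTo n (λ i → f (n ∸ i))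
    sumTo-reverse zero    f = refl
    sumTo-reverse (suc n) f = trans (sumTo-suc n f) (trans (+-comm _ _)
      (+-cong (trans (sumTo-reverse n (λ i → f (suc i)))
                     (sumTo-cong≤ n (λ i i≤n → reflexive (≡.cong f (≡.sym (ℕ.+-∸-assoc 1 i≤n))))))
              (reflexive (≡.cong f (≡.sym (ℕ.n∸n≡0 n))))))

    sumTo-triangle : ∀ n (F : ℕ → ℕ → Carrier) →
      sumTo n (λ i → sumTo i (F i)) ≈ sumTo n (λ j → sumTo (n ∸ j) (λ k → F (j ℕ.+ k) j))
    sumTo-triangle zero    F = refl
    sumTo-triangle (suc n) F = trans (+-congʳ (sumTo-triangle n F)) (trans (sym (+-assoc _ _ _))
      (+-cong (trans (sym (sumTo-+ n _ _)) (sumTo-cong≤ n column)) diagonal))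
      where
      column : ∀ j → j ℕ.≤ n → sumTo (n ∸ j) (λ k → F (j ℕ.+ k) j) + F (suc n) j ≈
                                sumTo (suc n ∸ j) (λ k → F (j ℕ.+ k) j)
      column j j≤n rewrite ℕ.+-∸-assoc 1 j≤n = +-congˡ (reflexive (≡.cong (λ m → F m j)
        (≡.sym (≡.trans (ℕ.+-suc j (n ∸ j)) (≡.cong suc (ℕ.m+[n∸m]≡n j≤n))))))
      diagonal : F (suc n) (suc n) ≈ sumTo (n ∸ n) (λ k → F (suc n ℕ.+ k) (suc n))
      diagonal rewrite ℕ.n∸n≡0 n =
        reflexive (≡.cong (λ m → F m (suc n)) (≡.sym (ℕ.+-identityʳ (suc n))))

    sumTo-comm : ∀ m n (F : ℕ → ℕ → Carrier) → sumTo m (λ i → sumTo n (F i)) ≈ sumTo n (λ j → sumTo m (λ i → F i j))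
    sumTo-comm zero    n F = refl
    sumTo-comm (suc m) n F = trans (+-congʳ (sumTo-comm m n F)) (sym (sumTo-+ n _ _))

    sumTo-single : ∀ n k {f} → (∀ i → i ≢ k → f i ≈ 0#) → k ℕ.≤ n → sumTo n f ≈ f k
    sumTo-single zero    .zero f≈0 z≤n = refl
    sumTo-single (suc n) k    f≈0 k≤1+n with k ℕ.≟ suc n
    ... | yes ≡.refl = trans (+-congʳ (sumTo-zero≤ n (λ i i≤n → f≈0 i (λ i≡ → ℕ.<-irrefl i≡ (s≤s i≤n)))))
                             (+-identityˡ _)
    ... | no  k≢1+n  = trans (+-cong (sumTo-single n k f≈0 (ℕ.≤-pred (ℕ.≤∧≢⇒< k≤1+n k≢1+n)))
                                     (f≈0 (suc n) (λ e → k≢1+n (≡.sym e))))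
                             (+-identityʳ _)

    sumTo-padʳ : ∀ n k {f} → (∀ i → n ℕ.< i → f i ≈ 0#) → sumTo (k ℕ.+ n) f ≈ sumTo n f
    sumTo-padʳ n zero    f≈0 = refl
    sumTo-padʳ n (suc k) f≈0 =
      trans (+-cong (sumTo-padʳ n k f≈0) (f≈0 _ (s≤s (ℕ.m≤n+m n k)))) (+-identityʳ _)

    sumTo-truncate : ∀ n {f} → (∀ i → n ℕ.< i → f i ≈ 0#) → ∀ m → n ℕ.≤ m → sumTo m f ≈ sumTo n f
    sumTo-truncate n {f} f≈0 m n≤m =
      trans (reflexive (≡.cong (λ l → sumTo l f) (≡.sym (ℕ.m∸n+n≡m n≤m)))) (sumTo-padʳ n (m ∸ n) f≈0)

    sumList : {A : Set} → List A → (A → Carrier) → Carrier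
    sumList xs F = foldr (λ x acc → F x + acc) 0# xs

    sumList-cong : {A : Set} {F G : A → Carrier} → ∀ xs → (∀ x → x ∈ xs → F x ≈ G x) →
      sumList xs F ≈ sumList xs G
    sumList-cong []       F≈G = refl
    sumList-cong (x ∷ xs) F≈G = +-cong (F≈G x (here ≡.refl)) (sumList-cong xs (λ y y∈ → F≈G y (there y∈)))

    sumList-++ : {A : Set} (F : A → Carrier) → ∀ xs ys →
      sumList (xs ++ ys) F ≈ sumList xs F + sumList ys F
    sumList-++ F []       ys = sym (+-identityˡ _)
    sumList-++ F (x ∷ xs) ys = trans (+-congˡ (sumList-++ F xs ys)) (sym (+-assoc _ _ _))

    sumList-map : {A B : Set} (F : B → Carrier) (g : A → B) → ∀ xs →
      sumList (map g xs) F ≈ sumList xs (λ x → F (g x))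
    sumList-map F g []       = refl
    sumList-map F g (x ∷ xs) = +-congˡ (sumList-map F g xs)

    sumList-concatMap : {A B : Set} (F : B → Carrier) (f : A → List B) → ∀ xs →
      sumList (concatMap f xs) F ≈ sumList xs (λ x → sumList (f x) F)
    sumList-concatMap F f []       = refl
    sumList-concatMap F f (x ∷ xs) =
      trans (sumList-++ F (f x) (concatMap f xs)) (+-congˡ (sumList-concatMap F f xs))

    sumList-↭ : {A : Set} (F : A → Carrier) {xs ys : List A} → xs ↭ ys → sumList xs F ≈ sumList ys F
    sumList-↭ F ↭.refl            = refl
    sumList-↭ F (↭.prep x p)      = +-congˡ (sumList-↭ F p)
    sumList-↭ F (↭.swap x y p)    = trans (sym (+-assoc _ _ _))
      (trans (+-cong (+-comm (F x) (F y)) (sumList-↭ F p)) (+-assoc _ _ _))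
    sumList-↭ F (↭.trans p q)     = trans (sumList-↭ F p) (sumList-↭ F q)



  record IsEndomorphism (R : ℤAlgebra) (φ : ℤAlgebra.Carrier R → ℤAlgebra.Carrier R) : Set where
    open ℤAlgebra R
    field
      φ-cong  : ∀ {x y} → x ≈ y → φ x ≈ φ y
      φ-+     : ∀ x y → φ (x + y) ≈ φ x + φ y
      φ-*     : ∀ x y → φ (x * y) ≈ φ x * φ y
      φ-·     : ∀ k x → φ (k · x) ≈ k · φ x
      φ-1#    : φ 1# ≈ 1#

    φ-^ : ∀ x k → φ (x ^ k) ≈ φ x ^ k
    φ-^ x zero    = φ-1#
    φ-^ x (suc k) = trans (φ-* x (x ^ k)) (*-congˡ (φ-^ x k))

    φ-sumTo : ∀ n f → φ (sumTo n f) ≈ sumTo n (λ i → φ (f i))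
    φ-sumTo zero    f = refl
    φ-sumTo (suc n) f = trans (φ-+ _ _) (+-congʳ (φ-sumTo n f))

  record Derivation (R : ℤAlgebra) : Set where
    open ℤAlgebra R
    field
      δ      : Carrier → Carrier
      δ-cong : ∀ {x y} → x ≈ y → δ x ≈ δ y
      δ-+    : ∀ x y → δ (x + y) ≈ δ x + δ y
      δ-*    : ∀ x y → δ (x * y) ≈ δ x * y + x * δ y
      δ-·    : ∀ k x → δ (k · x) ≈ k · δ x

    δ-0# : δ 0# ≈ 0#
    δ-0# = trans (δ-cong (sym (·-zero 0#))) (trans (δ-· (+ 0) 0#) (·-zero _))

    -- δ 1 = δ (1 * 1) = δ 1 + δ 1, and the ℤ-action provides the cancellation.
    δ-1# : δ 1# ≈ 0#
    δ-1# = begin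
      δ 1#                                  ≈⟨ sym (+-identityʳ _) ⟩
      δ 1# + 0#                             ≈⟨ +-congˡ (sym (+-·-cancel (δ 1#))) ⟩
      δ 1# + (δ 1# + ℤ.-[1+ 0 ] · δ 1#)     ≈⟨ sym (+-assoc _ _ _) ⟩
      (δ 1# + δ 1#) + ℤ.-[1+ 0 ] · δ 1#     ≈⟨ +-congʳ (sym δ1≈δ1+δ1) ⟩
      δ 1# + ℤ.-[1+ 0 ] · δ 1#              ≈⟨ +-·-cancel (δ 1#) ⟩
      0#                                    ∎
      where
      open ≈-Reasoning setoid
      δ1≈δ1+δ1 : δ 1# ≈ δ 1# + δ 1#
      δ1≈δ1+δ1 = trans (δ-cong (sym (*-identityˡ 1#)))
        (trans (δ-* 1# 1#) (+-cong (*-identityʳ _) (*-identityˡ _)))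

    δ-^ : ∀ x m → δ (x ^ m) ≈ (+ m) · (x ^ (m ∸ 1) * δ x)
    δ-^ x zero          = trans δ-1# (sym (·-zero _))
    δ-^ x (suc zero)    = trans (δ-* x 1#)
      (trans (+-cong (*-identityʳ (δ x)) (trans (*-congˡ δ-1#) (zeroʳ x)))
      (trans (+-identityʳ _) (trans (sym (*-identityˡ _)) (sym (·-identity _)))))
    δ-^ x (suc (suc m)) = trans (δ-* x (x ^ suc m))
      (trans (+-cong (*-comm (δ x) _) (trans (*-congˡ (δ-^ x (suc m)))
                                        (trans (*-·-assoc (+ suc m) x _) (·-congˡ (sym (*-assoc x _ _))))))
      (trans (+-congʳ (sym (·-identity _))) (sym (·-distribʳ (+ 1) (+ suc m) _))))

    δ-sumTo : ∀ n f → δ (sumTo n f) ≈ sumTo n (λ i → δ (f i))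
    δ-sumTo zero    f = refl
    δ-sumTo (suc n) f = trans (δ-+ _ _) (+-congʳ (δ-sumTo n f))

  infixl 6 _+ᴰ_
  _+ᴰ_ : {R : ℤAlgebra} → Derivation R → Derivation R → Derivation R
  _+ᴰ_ {R} D E = record
    { δ      = λ x → D.δ x + E.δ x
    ; δ-cong = λ x≈y → +-cong (D.δ-cong x≈y) (E.δ-cong x≈y)
    ; δ-+    = λ x y → trans (+-cong (D.δ-+ x y) (E.δ-+ x y)) (+-interchange _ _ _ _)
    ; δ-*    = λ x y → trans (+-cong (D.δ-* x y) (E.δ-* x y))
        (trans (+-interchange _ _ _ _) (sym (+-cong (distribʳ y _ _) (distribˡ x _ _))))
    ; δ-·    = λ k x → trans (+-cong (D.δ-· k x) (E.δ-· k x)) (sym (·-distribˡ k _ _))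
    }
    where
    open ℤAlgebra R
    module D = Derivation D
    module E = Derivation E

  -- With u = s + t, w = xy and δ = ∂x + ∂y + ∂s + ∂t, step is the right-hand side of the recurrence for A_n.
  module StepOperator {R : ℤAlgebra} (D : Derivation R) (u w : ℤAlgebra.Carrier R) where
    open ℤAlgebra R
    open Derivation D

    step : Carrier → Carrier
    step F = u * F + w * δ F

    -- unfolding step by conversion is expensive when the carrier is a power series ring
    step-unfold : ∀ F → step F ≈ u * F + w * δ F
    step-unfold F = refl

    step-cong : ∀ {x y} → x ≈ y → step x ≈ step y
    step-cong x≈y = +-cong (*-congˡ x≈y) (*-congˡ (δ-cong x≈y))

    step-+ : ∀ x y → step (x + y) ≈ step x + step y
    step-+ x y = trans (+-cong (distribˡ u x y) (trans (*-congˡ (δ-+ x y)) (distribˡ w _ _)))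
      (+-interchange _ _ _ _)

    step-· : ∀ k x → step (k · x) ≈ k · step x
    step-· k x = trans (+-cong (*-·-assoc k u x) (trans (*-congˡ (δ-· k x)) (*-·-assoc k w _)))
      (sym (·-distribˡ k _ _))

    step-0# : step 0# ≈ 0#
    step-0# = trans (+-cong (zeroʳ u) (trans (*-congˡ δ-0#) (zeroʳ w))) (+-identityˡ 0#)

    step-sumTo : ∀ n f → step (sumTo n f) ≈ sumTo n (λ i → step (f i))
    step-sumTo zero    f = refl
    step-sumTo (suc n) f = trans (step-+ _ _) (+-congʳ (step-sumTo n f))

    step-sumList : {A : Set} (F : A → Carrier) → ∀ xs → step (sumList xs F) ≈ sumList xs (λ x → step (F x))
    step-sumList F []       = step-0#
    step-sumList F (x ∷ xs) = trans (step-+ _ _) (+-congˡ (step-sumList F xs))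

module PowerSeriesAlgebra where

  open import Algebra.Structures.Biased using (isCommutativeMonoidˡ; isCommutativeSemiringˡ)
  import Algebra.Construct.Pointwise as Pointwise
  open import Data.Nat as ℕ using (ℕ; zero; suc; _∸_; z≤n)
  import Data.Nat.Properties as ℕ
  open import Data.Integer using (ℤ; +_)
  open import Relation.Binary.PropositionalEquality as ≡ using (_≡_; _≢_)
  open import Relation.Nullary using (yes; no; contradiction)
  open ℤAlgebras

  module PowerSeries (R : ℤAlgebra) where
    open ℤAlgebra R

    Series : Set
    Series = ℕ → Carrier

    infix 4 _≋_
    _≋_ : Series → Series → Set
    f ≋ g = ∀ a → f a ≈ g a

    infixl 6 _⊞_
    _⊞_ : Series → Series → Series
    (f ⊞ g) a = f a + g a

    𝟘 : Series
    𝟘 a = 0#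

    infixr 8 _⊙_
    _⊙_ : ℤ → Series → Series
    (k ⊙ f) a = k · f a

    infixl 7 _⋆_
    _⋆_ : Series → Series → Series
    (f ⋆ g) a = sumTo a (λ i → f i * g (a ∸ i))

    monomial : ℕ → Carrier → Series
    monomial zero    c zero    = c
    monomial zero    c (suc a) = 0#
    monomial (suc k) c zero    = 0#
    monomial (suc k) c (suc a) = monomial k c a

    monomial-≢ : ∀ k c a → a ≢ k → monomial k c a ≡ 0#
    monomial-≢ zero    c zero    a≢k = contradiction ≡.refl a≢k
    monomial-≢ zero    c (suc a) a≢k = ≡.refl
    monomial-≢ (suc k) c zero    a≢k = ≡.refl
    monomial-≢ (suc k) c (suc a) a≢k = monomial-≢ k c a (λ a≡k → a≢k (≡.cong suc a≡k))

    monomial-diag : ∀ k c → monomial k c k ≡ c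
    monomial-diag zero    c = ≡.refl
    monomial-diag (suc k) c = monomial-diag k c

    monomial-elim : ∀ {B : Set} (φ : Carrier → B) {c b} → φ c ≡ b → φ 0# ≡ b → ∀ k a → φ (monomial k c a) ≡ b
    monomial-elim φ φc φ0 zero    zero    = φc
    monomial-elim φ φc φ0 zero    (suc a) = φ0
    monomial-elim φ φc φ0 (suc k) zero    = φ0
    monomial-elim φ φc φ0 (suc k) (suc a) = monomial-elim φ φc φ0 k a

    monomial-map : (φ : Carrier → Carrier) → φ 0# ≈ 0# → ∀ k c → (λ a → φ (monomial k c a)) ≋ monomial k (φ c)
    monomial-map φ φ0 zero    c zero    = refl
    monomial-map φ φ0 zero    c (suc a) = φ0
    monomial-map φ φ0 (suc k) c zero    = φ0
    monomial-map φ φ0 (suc k) c (suc a) = monomial-map φ φ0 k c a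

    monomial-cong : ∀ k {c d} → c ≈ d → monomial k c ≋ monomial k d
    monomial-cong zero    c≈d zero    = c≈d
    monomial-cong zero    c≈d (suc a) = refl
    monomial-cong (suc k) c≈d zero    = refl
    monomial-cong (suc k) c≈d (suc a) = monomial-cong k c≈d a

    ⋆-cong : ∀ {f f′ g g′} → f ≋ f′ → g ≋ g′ → f ⋆ g ≋ f′ ⋆ g′
    ⋆-cong f≋f′ g≋g′ a = sumTo-cong a (λ i → *-cong (f≋f′ i) (g≋g′ (a ∸ i)))

    ⋆-comm : ∀ f g → f ⋆ g ≋ g ⋆ f
    ⋆-comm f g a = trans (sumTo-reverse a _) (sumTo-cong≤ a (λ i i≤a →
      trans (*-congˡ (reflexive (≡.cong g (ℕ.m∸[m∸n]≡n i≤a)))) (*-comm _ _)))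

    ⋆-assoc : ∀ f g h → (f ⋆ g) ⋆ h ≋ f ⋆ (g ⋆ h)
    ⋆-assoc f g h a =
      trans (sumTo-cong a (λ i → sym (sumTo-*ʳ i _ (h (a ∸ i)))))
      (trans (sumTo-triangle a (λ i j → (f j * g (i ∸ j)) * h (a ∸ i)))
      (sumTo-cong a (λ j → trans (sumTo-cong (a ∸ j) (λ k →
          trans (*-assoc _ _ _) (*-congˡ (*-cong
            (reflexive (≡.cong g (ℕ.m+n∸m≡n j k)))
            (reflexive (≡.cong h (≡.sym (ℕ.∸-+-assoc a j k))))))))
        (sumTo-*ˡ (a ∸ j) (f j) _))))

    ⋆-distribʳ : ∀ h f g → (f ⊞ g) ⋆ h ≋ f ⋆ h ⊞ g ⋆ h
    ⋆-distribʳ h f g a = trans (sumTo-cong a (λ i → distribʳ (h (a ∸ i)) (f i) (g i))) (sumTo-+ a _ _)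

    ⋆-zeroˡ : ∀ f → 𝟘 ⋆ f ≋ 𝟘
    ⋆-zeroˡ f a = sumTo-zero a (λ i → zeroˡ _)

    monomial₀-⋆ : ∀ c f → monomial 0 c ⋆ f ≋ (λ a → c * f a)
    monomial₀-⋆ c f a = sumTo-single a 0 nonzero z≤n
      where
      nonzero : ∀ i → i ≢ 0 → monomial 0 c i * f (a ∸ i) ≈ 0#
      nonzero zero    i≢0 = contradiction ≡.refl i≢0
      nonzero (suc i) i≢0 = zeroˡ _

    ⋆-identityˡ : ∀ f → monomial 0 1# ⋆ f ≋ f
    ⋆-identityˡ f a = trans (monomial₀-⋆ 1# f a) (*-identityˡ (f a))

    monomial-⋆ : ∀ k l c d → monomial k c ⋆ monomial l d ≋ monomial (k ℕ.+ l) (c * d)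
    monomial-⋆ zero    l c d a       = trans (monomial₀-⋆ c (monomial l d) a) (monomial-map (c *_) (zeroʳ c) l d a)
    monomial-⋆ (suc k) l c d zero    = zeroˡ _
    monomial-⋆ (suc k) l c d (suc a) = trans (sumTo-suc₀ a (zeroˡ _)) (monomial-⋆ k l c d a)

    seriesAlgebra : ℤAlgebra
    seriesAlgebra = record
      { Carrier               = Series
      ; _≈_                   = _≋_
      ; _+_                   = _⊞_
      ; _*_                   = _⋆_
      ; 0#                    = 𝟘
      ; 1#                    = monomial 0 1#
      ; isCommutativeSemiring = isCommutativeSemiringˡ record
        { +-isCommutativeMonoid = Pointwise.isCommutativeMonoid ℕ +-isCommutativeMonoid
        ; *-isCommutativeMonoid = isCommutativeMonoidˡ record
          { isSemigroup = record
            { isMagma = record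
              { isEquivalence = Pointwise.isEquivalence ℕ isEquivalence
              ; ∙-cong        = ⋆-cong
              }
            ; assoc = ⋆-assoc
            }
          ; identityˡ = ⋆-identityˡ
          ; comm      = ⋆-comm
          }
        ; distribʳ = ⋆-distribʳ
        ; zeroˡ    = ⋆-zeroˡ
        }
      ; _·_        = _⊙_
      ; ·-congˡ    = λ f≋g a → ·-congˡ (f≋g a)
      ; ·-distribˡ = λ k f g a → ·-distribˡ k (f a) (g a)
      ; ·-distribʳ = λ k l f a → ·-distribʳ k l (f a)
      ; ·-assoc    = λ k l f a → ·-assoc k l (f a)
      ; ·-identity = λ f a → ·-identity (f a)
      ; ·-zero     = λ f a → ·-zero (f a)
      ; ·-*-assoc  = λ k f g a → trans (sumTo-cong a (λ i → ·-*-assoc k (f i) (g (a ∸ i)))) (sumTo-· a k _)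
      }

    module Alg = ℤAlgebra seriesAlgebra

    sumTo-pointwise : ∀ n (F : ℕ → Series) a → Alg.sumTo n F a ≡ sumTo n (λ i → F i a)
    sumTo-pointwise zero    F a = ≡.refl
    sumTo-pointwise (suc n) F a = ≡.cong (_+ F (suc n) a) (sumTo-pointwise n F a)

    monomial-· : ∀ k l c → monomial k (l · c) ≋ l Alg.· monomial k c
    monomial-· k l c a = sym (monomial-map (l ·_) (·-zeroʳ l) k c a)

    ∂ : Derivation seriesAlgebra
    ∂ = record
      { δ      = λ f a → (+ suc a) · f (suc a)
      ; δ-cong = λ f≋g a → ·-congˡ (f≋g (suc a))
      ; δ-+    = λ f g a → ·-distribˡ _ _ _
      ; δ-*    = leibniz
      ; δ-·    = λ k f a → trans (sym (·-assoc _ _ _)) (·-comm (+ suc a) k (f (suc a)))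
      }
      where
      -- (a+1) = i + (a+1-i) splits the i-th term of the product between the two factors
      leibniz : ∀ f g a → (+ suc a) · (f ⋆ g) (suc a) ≈
        ((λ b → (+ suc b) · f (suc b)) ⋆ g) a + (f ⋆ (λ b → (+ suc b) · g (suc b))) a
      leibniz f g a = trans (sym (sumTo-· (suc a) _ _))
        (trans (sumTo-cong≤ (suc a) split) (trans (sumTo-+ (suc a) _ _) (+-cong first second)))
        where
        term : ℕ → Carrier
        term i = f i * g (suc a ∸ i)
        split : ∀ i → i ℕ.≤ suc a → (+ suc a) · term i ≈ (+ i) · term i + (+ (suc a ∸ i)) · term i
        split i i≤ = trans (reflexive (≡.cong (λ m → (+ m) · term i) (≡.sym (ℕ.m+[n∸m]≡n i≤))))
          (·-distribʳ (+ i) (+ (suc a ∸ i)) (term i))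
        first : sumTo (suc a) (λ i → (+ i) · term i) ≈ sumTo a (λ i → ((+ suc i) · f (suc i)) * g (a ∸ i))
        first = trans (sumTo-suc₀ a (·-zero _)) (sumTo-cong a (λ i → sym (·-*-assoc _ _ _)))
        second : sumTo (suc a) (λ i → (+ (suc a ∸ i)) · term i) ≈
                 sumTo a (λ i → f i * ((+ suc (a ∸ i)) · g (suc (a ∸ i))))
        second = trans (+-congˡ lastTerm) (trans (+-identityʳ _) (sumTo-cong≤ a (λ i i≤a →
          trans (reflexive (≡.cong (λ m → (+ m) · (f i * g m)) (ℕ.+-∸-assoc 1 i≤a)))
                (sym (*-·-assoc _ _ _)))))
          where
          lastTerm : (+ (suc a ∸ suc a)) · term (suc a) ≈ 0#
          lastTerm = ·-≡0 _ (≡.cong +_ (ℕ.n∸n≡0 a))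

    ∂-monomial : ∀ k c → Derivation.δ ∂ (monomial k c) ≋ (+ k) Alg.· monomial (k ∸ 1) c
    ∂-monomial zero    c a = trans (·-zeroʳ _) (sym (·-zero _))
    ∂-monomial (suc k) c a with a ℕ.≟ k
    ... | yes ≡.refl = refl
    ... | no  a≢k    = trans (·-≡0′ (monomial-≢ k c a a≢k)) (sym (·-≡0′ (monomial-≢ k c a a≢k)))
      where
      ·-≡0′ : ∀ {l x} → x ≡ 0# → l · x ≈ 0#
      ·-≡0′ {l} ≡.refl = ·-zeroʳ l

    lift : Derivation R → Derivation seriesAlgebra
    lift D = record
      { δ      = λ f a → δ (f a)
      ; δ-cong = λ f≋g a → δ-cong (f≋g a)
      ; δ-+    = λ f g a → δ-+ (f a) (g a)
      ; δ-*    = λ f g a → trans (δ-sumTo a _) (trans (sumTo-cong a (λ i → δ-* _ _)) (sumTo-+ a _ _))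
      ; δ-·    = λ k f a → δ-· k (f a)
      }
      where open Derivation D

    lift-monomial : ∀ D k c → Derivation.δ (lift D) (monomial k c) ≋ monomial k (Derivation.δ D c)
    lift-monomial D = monomial-map (Derivation.δ D) (Derivation.δ-0# D)

    lift-monomial-· : ∀ D k l c c′ → Derivation.δ D c ≈ l · c′ →
      Derivation.δ (lift D) (monomial k c) ≋ l Alg.· monomial k c′
    lift-monomial-· D k l c c′ δc≈ a =
      trans (lift-monomial D k _ a) (trans (monomial-cong k δc≈ a) (monomial-· k l _ a))

module FourVariableSeries where

  open import Data.Nat as ℕ using (ℕ; zero; suc; _∸_)
  open import Data.Integer as ℤ using (ℤ; +_)
  import Data.Integer.Properties as ℤ
  open import Relation.Binary.PropositionalEquality as ≡ using (_≡_; _≢_)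
  open import Relation.Nullary using (yes; no)
  open import Data.Sum using (_⊎_; inj₁; inj₂)
  open ℤAlgebras
  open PowerSeriesAlgebra
  open import Defs using (Poly; sumTo; _⊛_; mono; cst; _^ₚ_; ΣP; ∂x; ∂y; ∂s; ∂t; X; Y; S; T)
    renaming (_⊕_ to _⊕ₚ_)

  ℤ-algebra : ℤAlgebra
  ℤ-algebra = record
    { Carrier               = ℤ
    ; _≈_                   = _≡_
    ; _+_                   = ℤ._+_
    ; _*_                   = ℤ._*_
    ; 0#                    = + 0
    ; 1#                    = + 1
    ; isCommutativeSemiring = ℤ.+-*-isCommutativeSemiring
    ; _·_                   = ℤ._*_
    ; ·-congˡ               = λ {k} → ≡.cong (k ℤ.*_)
    ; ·-distribˡ            = ℤ.*-distribˡ-+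
    ; ·-distribʳ            = λ k l x → ℤ.*-distribʳ-+ x k l
    ; ·-assoc               = ℤ.*-assoc
    ; ·-identity            = ℤ.*-identityˡ
    ; ·-zero                = ℤ.*-zeroˡ
    ; ·-*-assoc             = ℤ.*-assoc
    }

  module PS₀ = PowerSeries ℤ-algebra
  ℤ⟦t⟧ = PS₀.seriesAlgebra
  module PS₁ = PowerSeries ℤ⟦t⟧
  ℤ⟦s,t⟧ = PS₁.seriesAlgebra
  module PS₂ = PowerSeries ℤ⟦s,t⟧
  ℤ⟦y,s,t⟧ = PS₂.seriesAlgebra
  module PS₃ = PowerSeries ℤ⟦y,s,t⟧

  ℤ⟦x,y,s,t⟧ : ℤAlgebra
  ℤ⟦x,y,s,t⟧ = PS₃.seriesAlgebra
  module ℤ⟦x,y,s,t⟧ = ℤAlgebra ℤ⟦x,y,s,t⟧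

  open ℤ⟦x,y,s,t⟧ using (_≈_; _+_; _*_; _·_; 1#; _^_)

  sumTo-cong≡ : ∀ n {f g : ℕ → ℤ} → (∀ i → f i ≡ g i) → sumTo n f ≡ sumTo n g
  sumTo-cong≡ zero    f≡g = f≡g 0
  sumTo-cong≡ (suc n) f≡g = ≡.cong₂ ℤ._+_ (sumTo-cong≡ n f≡g) (f≡g (suc n))

  sumTo-ℤ : ∀ n f → ℤAlgebra.sumTo ℤ-algebra n f ≡ sumTo n f
  sumTo-ℤ zero    f = ≡.refl
  sumTo-ℤ (suc n) f = ≡.cong (ℤ._+ f (suc n)) (sumTo-ℤ n f)

  sumTo-eval₁ : ∀ n F d → ℤAlgebra.sumTo ℤ⟦t⟧ n F d ≡ sumTo n (λ i → F i d)
  sumTo-eval₁ n F d = ≡.trans (PS₀.sumTo-pointwise n F d) (sumTo-ℤ n _)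

  sumTo-eval₂ : ∀ n F c d → ℤAlgebra.sumTo ℤ⟦s,t⟧ n F c d ≡ sumTo n (λ i → F i c d)
  sumTo-eval₂ n F c d = ≡.trans (≡.cong-app (PS₁.sumTo-pointwise n F c) d) (sumTo-eval₁ n (λ i → F i c) d)

  sumTo-eval₃ : ∀ n F b c d → ℤAlgebra.sumTo ℤ⟦y,s,t⟧ n F b c d ≡ sumTo n (λ i → F i b c d)
  sumTo-eval₃ n F b c d =
    ≡.trans (≡.cong (λ f → f c d) (PS₂.sumTo-pointwise n F b)) (sumTo-eval₂ n (λ i → F i b) c d)

  ΣP≈sumTo : ∀ n F → ΣP n F ≈ ℤ⟦x,y,s,t⟧.sumTo n F
  ΣP≈sumTo n F a b c d =
    ≡.sym (≡.trans (≡.cong (λ f → f b c d) (PS₃.sumTo-pointwise n F a)) (sumTo-eval₃ n (λ i → F i a) b c d))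

  ⊛≈* : ∀ P Q → P ⊛ Q ≈ P * Q
  ⊛≈* P Q a b c d = ≡.sym (≡.trans (sumTo-eval₃ a _ b c d) (sumTo-cong≡ a λ a₁ →
    ≡.trans (sumTo-eval₂ b _ c d) (sumTo-cong≡ b λ b₁ →
    ≡.trans (sumTo-eval₁ c _ d) (sumTo-cong≡ c λ c₁ →
    sumTo-ℤ d _))))

  monomial¹ : ℕ → ℤAlgebra.Carrier ℤ⟦t⟧
  monomial¹ d = PS₀.monomial d (+ 1)

  monomial² : ℕ → ℕ → ℤAlgebra.Carrier ℤ⟦s,t⟧
  monomial² c d = PS₁.monomial c (monomial¹ d)

  monomial³ : ℕ → ℕ → ℕ → ℤAlgebra.Carrier ℤ⟦y,s,t⟧
  monomial³ b c d = PS₂.monomial b (monomial² c d)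

  monomial⁴ : ℕ → ℕ → ℕ → ℕ → Poly
  monomial⁴ a b c d = PS₃.monomial a (monomial³ b c d)

  mono-unique : ∀ a b c d (M : Poly) → M a b c d ≡ + 1 →
    (∀ p q r u → a ≢ p ⊎ b ≢ q ⊎ c ≢ r ⊎ d ≢ u → M p q r u ≡ + 0) → mono a b c d ≈ M
  mono-unique a b c d M diag off p q r u with a ℕ.≟ p | b ℕ.≟ q | c ℕ.≟ r | d ℕ.≟ u
  ... | yes ≡.refl | yes ≡.refl | yes ≡.refl | yes ≡.refl = ≡.sym diag
  ... | no a≢p  | _      | _      | _      = ≡.sym (off p q r u (inj₁ a≢p))
  ... | yes _   | no b≢q | _      | _      = ≡.sym (off p q r u (inj₂ (inj₁ b≢q)))
  ... | yes _   | yes _  | no c≢r | _      = ≡.sym (off p q r u (inj₂ (inj₂ (inj₁ c≢r))))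
  ... | yes _   | yes _  | yes _  | no d≢u = ≡.sym (off p q r u (inj₂ (inj₂ (inj₂ d≢u))))

  mono≈monomial⁴ : ∀ a b c d → mono a b c d ≈ monomial⁴ a b c d
  mono≈monomial⁴ a b c d = mono-unique a b c d (monomial⁴ a b c d) diag off
    where
    diag : monomial⁴ a b c d a b c d ≡ + 1
    diag = ≡.trans (≡.cong (λ f → f b c d) (PS₃.monomial-diag a _))
          (≡.trans (≡.cong (λ f → f c d) (PS₂.monomial-diag b _))
          (≡.trans (≡.cong (λ f → f d) (PS₁.monomial-diag c _)) (PS₀.monomial-diag d _)))
    off : ∀ p q r u → a ≢ p ⊎ b ≢ q ⊎ c ≢ r ⊎ d ≢ u → monomial⁴ a b c d p q r u ≡ + 0
    off p q r u (inj₁ a≢p) =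
      ≡.cong (λ f → f q r u) (PS₃.monomial-≢ a _ p (≡.≢-sym a≢p))
    off p q r u (inj₂ (inj₁ b≢q)) = PS₃.monomial-elim (λ f → f q r u)
      (≡.cong (λ f → f r u) (PS₂.monomial-≢ b _ q (≡.≢-sym b≢q))) ≡.refl a p
    off p q r u (inj₂ (inj₂ (inj₁ c≢r))) = PS₃.monomial-elim (λ f → f q r u)
      (PS₂.monomial-elim (λ f → f r u)
        (≡.cong (λ f → f u) (PS₁.monomial-≢ c _ r (≡.≢-sym c≢r))) ≡.refl b q) ≡.refl a p
    off p q r u (inj₂ (inj₂ (inj₂ d≢u))) = PS₃.monomial-elim (λ f → f q r u)
      (PS₂.monomial-elim (λ f → f r u)
        (PS₁.monomial-elim (λ f → f u) (PS₀.monomial-≢ d _ u (≡.≢-sym d≢u)) ≡.refl c r) ≡.refl b q) ≡.refl a p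

  open ℤ⟦x,y,s,t⟧ using (refl; sym; trans; +-cong; +-congʳ; *-cong; *-congʳ; *-congˡ; ·-congˡ;
    distribˡ; distribʳ; *-·-assoc; ·-*-assoc; *-identityˡ; setoid)
  import Relation.Binary.Reasoning.Setoid as ≈-Reasoning

  ∂ₓ ∂ᵧ ∂ₛ ∂ₜ ∇ : Derivation ℤ⟦x,y,s,t⟧
  ∂ₓ = PS₃.∂
  ∂ᵧ = PS₃.lift PS₂.∂
  ∂ₛ = PS₃.lift (PS₂.lift PS₁.∂)
  ∂ₜ = PS₃.lift (PS₂.lift (PS₁.lift PS₀.∂))
  ∇  = ∂ₓ +ᴰ ∂ᵧ +ᴰ ∂ₛ +ᴰ ∂ₜ

  ∂ₓ-monomial⁴ : ∀ a b c d → Derivation.δ ∂ₓ (monomial⁴ a b c d) ≈ (+ a) · monomial⁴ (a ∸ 1) b c d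
  ∂ₓ-monomial⁴ a b c d = PS₃.∂-monomial a (monomial³ b c d)

  ∂ᵧ-monomial⁴ : ∀ a b c d → Derivation.δ ∂ᵧ (monomial⁴ a b c d) ≈ (+ b) · monomial⁴ a (b ∸ 1) c d
  ∂ᵧ-monomial⁴ a b c d =
    PS₃.lift-monomial-· PS₂.∂ a (+ b) _ _ (PS₂.∂-monomial b (monomial² c d))

  ∂ₛ-monomial⁴ : ∀ a b c d → Derivation.δ ∂ₛ (monomial⁴ a b c d) ≈ (+ c) · monomial⁴ a b (c ∸ 1) d
  ∂ₛ-monomial⁴ a b c d = PS₃.lift-monomial-· (PS₂.lift PS₁.∂) a (+ c) _ _
    (PS₂.lift-monomial-· PS₁.∂ b (+ c) _ _ (PS₁.∂-monomial c (monomial¹ d)))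

  ∂ₜ-monomial⁴ : ∀ a b c d → Derivation.δ ∂ₜ (monomial⁴ a b c d) ≈ (+ d) · monomial⁴ a b c (d ∸ 1)
  ∂ₜ-monomial⁴ a b c d = PS₃.lift-monomial-· (PS₂.lift (PS₁.lift PS₀.∂)) a (+ d) _ _
    (PS₂.lift-monomial-· (PS₁.lift PS₀.∂) b (+ d) _ _
    (PS₁.lift-monomial-· PS₀.∂ c (+ d) _ _ (PS₀.∂-monomial d (+ 1))))

  monomial⁴-* : ∀ a b c d a′ b′ c′ d′ →
    monomial⁴ a b c d * monomial⁴ a′ b′ c′ d′ ≈ monomial⁴ (a ℕ.+ a′) (b ℕ.+ b′) (c ℕ.+ c′) (d ℕ.+ d′)
  monomial⁴-* a b c d a′ b′ c′ d′ = trans (PS₃.monomial-⋆ a a′ _ _) (PS₃.monomial-cong (a ℕ.+ a′)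
    (PS₂.Alg.trans (PS₂.monomial-⋆ b b′ _ _) (PS₂.monomial-cong (b ℕ.+ b′)
    (PS₁.Alg.trans (PS₁.monomial-⋆ c c′ _ _) (PS₁.monomial-cong (c ℕ.+ c′)
    (PS₀.monomial-⋆ d d′ _ _))))))

  x*y≈monomial⁴ : X * Y ≈ monomial⁴ 1 1 0 0
  x*y≈monomial⁴ = trans (*-cong (mono≈monomial⁴ 1 0 0 0) (mono≈monomial⁴ 0 1 0 0)) (monomial⁴-* 1 0 0 0 0 1 0 0)

  xy*-monomial⁴ : ∀ k a b c d → X * Y * (k · monomial⁴ a b c d) ≈ k · monomial⁴ (suc a) (suc b) c d
  xy*-monomial⁴ k a b c d = trans (*-·-assoc k (X * Y) m)
    (·-congˡ {k} (trans (*-congʳ {m} x*y≈monomial⁴) (monomial⁴-* 1 1 0 0 a b c d)))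
    where m = monomial⁴ a b c d

  open StepOperator ∇ (S + T) (X * Y) public

  step-monomial⁴ : ∀ a b c d → step (monomial⁴ a b c d) ≈
    (monomial⁴ a b (suc c) d + monomial⁴ a b c (suc d)) +
    ((((+ a) · monomial⁴ a (suc b) c d + (+ b) · monomial⁴ (suc a) b c d) +
      (+ c) · monomial⁴ (suc a) (suc b) (c ∸ 1) d) + (+ d) · monomial⁴ (suc a) (suc b) c (d ∸ 1))
  step-monomial⁴ a b c d = begin
    step m
      ≈⟨ step-unfold m ⟩
    (S + T) * m + X * Y * (((δₓ m + δᵧ m) + δₛ m) + δₜ m)
      ≈⟨ +-cong (distribʳ m S T) (trans (distribˡ (X * Y) ((δₓ m + δᵧ m) + δₛ m) (δₜ m))
                                  (+-congʳ {X * Y * δₜ m} (trans (distribˡ (X * Y) (δₓ m + δᵧ m) (δₛ m))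
                                  (+-congʳ {X * Y * δₛ m} (distribˡ (X * Y) (δₓ m) (δᵧ m)))))) ⟩
    (S * m + T * m) + (((X * Y * δₓ m + X * Y * δᵧ m) + X * Y * δₛ m) + X * Y * δₜ m)
      ≈⟨ +-cong (+-cong sTerm tTerm) (+-cong (+-cong (+-cong xTerm yTerm) ∂ₛTerm) ∂ₜTerm) ⟩
    (monomial⁴ a b (suc c) d + monomial⁴ a b c (suc d)) +
    ((((+ a) · monomial⁴ a (suc b) c d + (+ b) · monomial⁴ (suc a) b c d) +
      (+ c) · monomial⁴ (suc a) (suc b) (c ∸ 1) d) + (+ d) · monomial⁴ (suc a) (suc b) c (d ∸ 1)) ∎
    where
    open ≈-Reasoning setoid
    m = monomial⁴ a b c d
    δₓ = Derivation.δ ∂ₓ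
    δᵧ = Derivation.δ ∂ᵧ
    δₛ = Derivation.δ ∂ₛ
    δₜ = Derivation.δ ∂ₜ
    sTerm : S * m ≈ monomial⁴ a b (suc c) d
    sTerm = trans (*-congʳ {m} (mono≈monomial⁴ 0 0 1 0)) (monomial⁴-* 0 0 1 0 a b c d)
    tTerm : T * m ≈ monomial⁴ a b c (suc d)
    tTerm = trans (*-congʳ {m} (mono≈monomial⁴ 0 0 0 1)) (monomial⁴-* 0 0 0 1 a b c d)
    xTerm : X * Y * δₓ m ≈ (+ a) · monomial⁴ a (suc b) c d
    xTerm = trans (*-congˡ {X * Y} (∂ₓ-monomial⁴ a b c d))
      (trans (xy*-monomial⁴ (+ a) (a ∸ 1) b c d) (ℤ⟦x,y,s,t⟧.·-suc∸1 a (λ k → PS₃.monomial k (monomial³ (suc b) c d))))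
    yTerm : X * Y * δᵧ m ≈ (+ b) · monomial⁴ (suc a) b c d
    yTerm = trans (*-congˡ {X * Y} (∂ᵧ-monomial⁴ a b c d)) (trans (xy*-monomial⁴ (+ b) a (b ∸ 1) c d)
      (trans (sym (PS₃.monomial-· (suc a) (+ b) (monomial³ (suc (b ∸ 1)) c d)))
      (trans (PS₃.monomial-cong (suc a) (PS₂.Alg.·-suc∸1 b (λ k → PS₂.monomial k (monomial² c d))))
             (PS₃.monomial-· (suc a) (+ b) (monomial³ b c d)))))
    ∂ₛTerm : X * Y * δₛ m ≈ (+ c) · monomial⁴ (suc a) (suc b) (c ∸ 1) d
    ∂ₛTerm = trans (*-congˡ {X * Y} (∂ₛ-monomial⁴ a b c d)) (xy*-monomial⁴ (+ c) a b (c ∸ 1) d)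
    ∂ₜTerm : X * Y * δₜ m ≈ (+ d) · monomial⁴ (suc a) (suc b) c (d ∸ 1)
    ∂ₜTerm = trans (*-congˡ {X * Y} (∂ₜ-monomial⁴ a b c d)) (xy*-monomial⁴ (+ d) a b c (d ∸ 1))

  ∇-coefficients : ∀ P → Derivation.δ ∇ P ≈ ∂x P ⊕ₚ ∂y P ⊕ₚ ∂s P ⊕ₚ ∂t P
  ∇-coefficients P a b c d = ≡.refl

  ⊕≈+ : ∀ P Q → P ⊕ₚ Q ≈ P + Q
  ⊕≈+ P Q a b c d = ≡.refl

  step≈ : ∀ P → step P ≈ (S ⊕ₚ T) ⊛ P ⊕ₚ (X ⊛ Y) ⊛ (∂x P ⊕ₚ ∂y P ⊕ₚ ∂s P ⊕ₚ ∂t P)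
  step≈ P = sym (begin
    (S ⊕ₚ T) ⊛ P ⊕ₚ (X ⊛ Y) ⊛ ∇P  ≈⟨ ⊕≈+ ((S ⊕ₚ T) ⊛ P) ((X ⊛ Y) ⊛ ∇P) ⟩
    (S ⊕ₚ T) ⊛ P + (X ⊛ Y) ⊛ ∇P   ≈⟨ +-cong (⊛≈* (S ⊕ₚ T) P) (⊛≈* (X ⊛ Y) ∇P) ⟩
    (S ⊕ₚ T) * P + (X ⊛ Y) * ∇P   ≈⟨ +-cong (*-congʳ {P} (⊕≈+ S T)) (*-cong (⊛≈* X Y) (sym (∇-coefficients P))) ⟩
    (S + T) * P + X * Y * Derivation.δ ∇ P ≈⟨ sym (step-unfold P) ⟩
    step P ∎)
    where
    open ≈-Reasoning setoid
    ∇P = ∂x P ⊕ₚ ∂y P ⊕ₚ ∂s P ⊕ₚ ∂t P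

  ^ₚ≈^ : ∀ P k → P ^ₚ k ≈ P ^ k
  ^ₚ≈^ P zero    = mono≈monomial⁴ 0 0 0 0
  ^ₚ≈^ P (suc k) = trans (⊛≈* P (P ^ₚ k)) (*-congˡ {P} (^ₚ≈^ P k))

  cst⊛ : ∀ k P → cst k ⊛ P ≈ k · P
  cst⊛ k P = begin
    cst k ⊛ P      ≈⟨ ⊛≈* (cst k) P ⟩
    cst k * P      ≈⟨ *-congʳ {P} (λ a b c d → ≡.cong (k ℤ.*_) (mono≈monomial⁴ 0 0 0 0 a b c d)) ⟩
    (k · 1#) * P   ≈⟨ ·-*-assoc k 1# P ⟩
    k · (1# * P)   ≈⟨ ·-congˡ {k} (*-identityˡ P) ⟩
    k · P          ∎
    where open ≈-Reasoning setoid

  2xy≈ : cst (+ 2) ⊛ X ⊛ Y ≈ (+ 2) · (X * Y)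
  2xy≈ = begin
    cst (+ 2) ⊛ X ⊛ Y     ≈⟨ ⊛≈* (cst (+ 2) ⊛ X) Y ⟩
    (cst (+ 2) ⊛ X) * Y   ≈⟨ *-congʳ {Y} (cst⊛ (+ 2) X) ⟩
    ((+ 2) · X) * Y       ≈⟨ ·-*-assoc (+ 2) X Y ⟩
    (+ 2) · (X * Y)       ∎
    where open ≈-Reasoning setoid

module GammaExpansion where

  open import Data.Nat as ℕ using (ℕ; zero; suc; _∸_; _≤_; _<_; _<?_; _≤?_)
  import Data.Nat.Properties as ℕ
  open import Data.Nat.DivMod using (_/_; _%_; m≡m%n+[m/n]*n; m%n<n; m/n≤m)
  open import Data.Integer as ℤ using (ℤ; +_; _-_)
  import Data.Integer.Properties as ℤ
  open import Data.Integer.Solver using (module +-*-Solver)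
  open import Data.Sum using (_⊎_; inj₁; inj₂)
  open import Relation.Nullary using (yes; no)
  open import Relation.Binary.PropositionalEquality as ≡ using (_≡_)
  open import Defs using (γ)
  open ℤAlgebras
  import Relation.Binary.Reasoning.Setoid as ≈-Reasoning

  -- the coefficient n - i - 2j + 2 of γ n i (j - 1) in the recurrence for γ, with j + 1 in place of j
  κ : ℕ → ℕ → ℕ → ℤ
  κ n i j = (+ n - + i - + (2 ℕ.* suc j)) ℤ.+ + 2

  κ≡ : ∀ n i j r → n ≡ i ℕ.+ 2 ℕ.* j ℕ.+ r → κ n i j ≡ + r
  κ≡ n i j r n≡ = ≡.trans (≡.cong₂ (λ a b → (a - + i - b) ℤ.+ + 2) n≡ℤ 2j+2≡ℤ) (cancel (+ i) (+ (2 ℕ.* j)) (+ r))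
    where
    n≡ℤ : + n ≡ + i ℤ.+ + (2 ℕ.* j) ℤ.+ + r
    n≡ℤ = ≡.trans (≡.cong +_ n≡) (≡.trans (ℤ.pos-+ (i ℕ.+ 2 ℕ.* j) r) (≡.cong (ℤ._+ + r) (ℤ.pos-+ i (2 ℕ.* j))))
    2j+2≡ℤ : + (2 ℕ.* suc j) ≡ + 2 ℤ.+ + (2 ℕ.* j)
    2j+2≡ℤ = ≡.trans (≡.cong +_ (ℕ.*-suc 2 j)) (ℤ.pos-+ 2 (2 ℕ.* j))
    open +-*-Solver
    cancel : ∀ a t r → ((a ℤ.+ t ℤ.+ r) - a - (+ 2 ℤ.+ t)) ℤ.+ + 2 ≡ r
    cancel = solve 3 (λ a t r → ((a :+ t :+ r) :- a :- (con (+ 2) :+ t)) :+ con (+ 2) := r) ≡.refl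

  -- the one point outside the support of γ n where κ n i j matters, and there it vanishes
  κ-boundary : ∀ n i j → n ≡ i ℕ.+ 2 ℕ.* j → κ n i j ≡ + 0
  κ-boundary n i j n≡ = κ≡ n i j 0 (≡.trans n≡ (≡.sym (ℕ.+-identityʳ _)))

  γ-vanishes : ∀ n i j → n < i ℕ.+ 2 ℕ.* j → γ n i j ≡ + 0
  κγ-vanishes : ∀ n i j → n ≤ i ℕ.+ 2 ℕ.* j → κ n i j ℤ.* γ n i j ≡ + 0

  γ-vanishes zero    zero    zero    ()
  γ-vanishes zero    zero    (suc j) _ = ≡.refl
  γ-vanishes zero    (suc i) j       _ = ≡.refl
  γ-vanishes (suc n) zero    zero    _ = ≡.refl
  γ-vanishes (suc n) zero    (suc j) n<2j+2 =
    ≡.cong₂ ℤ._+_ (≡.cong₂ ℤ._+_ (≡.cong (+ 1 ℤ.*_) (γ-vanishes n 1 j n<2j+1))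
      (≡.trans (≡.cong (+ suc j ℤ.*_) (γ-vanishes n zero (suc j) (ℕ.<-trans (ℕ.n<1+n n) n<2j+2)))
               (ℤ.*-zeroʳ (+ suc j))))
      (κγ-vanishes n 0 j (ℕ.≤-pred n<2j+1))
    where
    n<2j+1 : n < 1 ℕ.+ 2 ℕ.* j
    n<2j+1 = ℕ.≤-pred (≡.subst (suc n <_) (ℕ.*-suc 2 j) n<2j+2)
  γ-vanishes (suc n) (suc i) zero    n<i rewrite γ-vanishes n i zero (ℕ.≤-pred n<i) = ≡.refl
  γ-vanishes (suc n) (suc i) (suc j) n<i+2j+2 =
    ≡.cong₂ ℤ._+_ (≡.cong₂ ℤ._+_ (≡.cong₂ ℤ._+_ (γ-vanishes n i (suc j) n<i+2j+2′)
      (≡.trans (≡.cong (+ suc (suc i) ℤ.*_) (γ-vanishes n (suc (suc i)) j (≡.subst (n <_) i+2j+2≡ n<i+2j+2′)))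
               (ℤ.*-zeroʳ (+ suc (suc i)))))
      (≡.trans (≡.cong (+ suc j ℤ.*_) (γ-vanishes n (suc i) (suc j) (ℕ.<-trans n<i+2j+2′ (ℕ.n<1+n _))))
               (ℤ.*-zeroʳ (+ suc j))))
      (κγ-vanishes n (suc i) j (ℕ.≤-pred (≡.subst (n <_) i+2j+2≡ n<i+2j+2′)))
    where
    n<i+2j+2′ : n < i ℕ.+ 2 ℕ.* suc j
    n<i+2j+2′ = ℕ.≤-pred n<i+2j+2
    i+2j+2≡ : i ℕ.+ 2 ℕ.* suc j ≡ suc (suc i ℕ.+ 2 ℕ.* j)
    i+2j+2≡ = ≡.trans (≡.cong (i ℕ.+_) (ℕ.*-suc 2 j)) (≡.trans (ℕ.+-suc i _) (≡.cong suc (ℕ.+-suc i _)))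

  κγ-vanishes n i j n≤ with n <? i ℕ.+ 2 ℕ.* j
  ... | yes n< = ≡.trans (≡.cong (κ n i j ℤ.*_) (γ-vanishes n i j n<)) (ℤ.*-zeroʳ (κ n i j))
  ... | no  n≮ = ≡.cong (ℤ._* γ n i j) (κ-boundary n i j (ℕ.≤-antisym n≤ (ℕ.≮⇒≥ n≮)))

  γ-support : ∀ n i j → i ℕ.+ 2 ℕ.* j ≤ n ⊎ γ n i j ≡ + 0
  γ-support n i j with i ℕ.+ 2 ℕ.* j ≤? n
  ... | yes i+2j≤n = inj₁ i+2j≤n
  ... | no  i+2j≰n = inj₂ (γ-vanishes n i j (ℕ.≰⇒> i+2j≰n))

  -- The four summands of the recurrence for γ (suc n) i j, named after the term of
  -- s + t + xy ∇ that produces them in the expansion.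
  γ[u] γ[∂u] γ[∂p] γ[∂q] : ℕ → ℕ → ℕ → ℤ
  γ[u]  n zero    j       = + 0
  γ[u]  n (suc i) j       = γ n i j
  γ[∂u] n i       zero    = + 0
  γ[∂u] n i       (suc j) = + suc i ℤ.* γ n (suc i) j
  γ[∂p] n i       j       = + j ℤ.* γ n i j
  γ[∂q] n i       zero    = + 0
  γ[∂q] n i       (suc j) = κ n i j ℤ.* γ n i j

  γ-suc : ∀ n i j → γ (suc n) i j ≡ γ[u] n i j ℤ.+ γ[∂u] n i j ℤ.+ γ[∂p] n i j ℤ.+ γ[∂q] n i j
  γ-suc n zero    zero    = ≡.refl
  γ-suc n zero    (suc j) =
    ≡.cong (λ z → z ℤ.+ + suc j ℤ.* γ n zero (suc j) ℤ.+ κ n 0 j ℤ.* γ n 0 j) (≡.sym (ℤ.+-identityˡ (+ 1 ℤ.* γ n 1 j)))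
  γ-suc n (suc i) zero    = ≡.trans (≡.sym (ℤ.+-identityʳ _))
    (≡.cong (λ z → z ℤ.+ + 0 ℤ.* γ n (suc i) zero ℤ.+ + 0) (≡.sym (ℤ.+-identityʳ (γ n i zero))))
  γ-suc n (suc i) (suc j) = ≡.refl

  /2<⇒<2* : ∀ m j → m / 2 < j → m < 2 ℕ.* j
  /2<⇒<2* m j m/2<j = begin-strict
    m                       ≡⟨ m≡m%n+[m/n]*n m 2 ⟩
    m % 2 ℕ.+ (m / 2) ℕ.* 2 <⟨ ℕ.+-monoˡ-< ((m / 2) ℕ.* 2) (m%n<n m 2) ⟩
    2 ℕ.+ (m / 2) ℕ.* 2     ≡⟨ ≡.cong (2 ℕ.+_) (ℕ.*-comm (m / 2) 2) ⟩
    2 ℕ.+ 2 ℕ.* (m / 2)     ≡⟨ ≡.sym (ℕ.*-suc 2 (m / 2)) ⟩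
    2 ℕ.* suc (m / 2)       ≤⟨ ℕ.*-monoʳ-≤ 2 m/2<j ⟩
    2 ℕ.* j                 ∎
    where open ℕ.≤-Reasoning

  module Expansion {R : ℤAlgebra} (D : Derivation R) (u q w : ℤAlgebra.Carrier R)
    (δu≈2 : ℤAlgebra._≈_ R (Derivation.δ D u) (ℤAlgebra._·_ R (+ 2) (ℤAlgebra.1# R)))
    (δq≈2 : ℤAlgebra._≈_ R (Derivation.δ D q) (ℤAlgebra._·_ R (+ 2) (ℤAlgebra.1# R)))
    (δw≈q : ℤAlgebra._≈_ R (Derivation.δ D w) q) where

    open ℤAlgebra R
    open Derivation D

    open StepOperator D u w
    open import Algebra.Solver.CommutativeMonoid *-commutativeMonoid using (solve; _⊕_; _⊜_)

    two p : Carrier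
    two = (+ 2) · 1#
    p   = (+ 2) · w

    two*w≈p : two * w ≈ p
    two*w≈p = sym (·≈·1#* (+ 2) w)

    δp≈two*q : δ p ≈ two * q
    δp≈two*q = trans (δ-· (+ 2) w) (trans (·-congˡ δw≈q) (·≈·1#* (+ 2) q))

    E : ℕ → ℕ → ℕ → Carrier
    E i j k = u ^ i * (p ^ j * q ^ k)

    u*E : ∀ i j k → u * E i j k ≈ E (suc i) j k
    u*E i j k = sym (*-assoc u (u ^ i) _)

    w*δu^i : ∀ i j k → w * (δ (u ^ i) * (p ^ j * q ^ k)) ≈ (+ i) · E (i ∸ 1) (suc j) k
    w*δu^i i j k = begin
      w * (δ (u ^ i) * W)                          ≈⟨ *-congˡ (*-congʳ (trans (δ-^ u i) (·-congˡ (*-congˡ δu≈2)))) ⟩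
      w * ((+ i) · (u ^ (i ∸ 1) * two) * W)        ≈⟨ *-congˡ (·-*-assoc (+ i) _ W) ⟩
      w * ((+ i) · ((u ^ (i ∸ 1) * two) * W))      ≈⟨ *-·-assoc (+ i) w _ ⟩
      (+ i) · (w * ((u ^ (i ∸ 1) * two) * W))      ≈⟨ ·-congˡ (solve 4 (λ w u′ t W → w ⊕ ((u′ ⊕ t) ⊕ W) ⊜ u′ ⊕ ((t ⊕ w) ⊕ W)) refl w (u ^ (i ∸ 1)) two W) ⟩
      (+ i) · (u ^ (i ∸ 1) * ((two * w) * W))      ≈⟨ ·-congˡ (*-congˡ (trans (*-congʳ two*w≈p) (sym (*-assoc p (p ^ j) (q ^ k))))) ⟩
      (+ i) · E (i ∸ 1) (suc j) k                  ∎
      where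
      open ≈-Reasoning setoid
      W = p ^ j * q ^ k

    w*δp^j : ∀ i j k → w * (u ^ i * (δ (p ^ j) * q ^ k)) ≈ (+ j) · E i j (suc k)
    w*δp^j i j k = begin
      w * (u ^ i * (δ (p ^ j) * q ^ k))                   ≈⟨ *-congˡ (*-congˡ (*-congʳ (trans (δ-^ p j) (·-congˡ (*-congˡ δp≈two*q))))) ⟩
      w * (u ^ i * ((+ j) · (p′ * (two * q)) * q ^ k))    ≈⟨ *-congˡ (trans (*-congˡ (·-*-assoc (+ j) _ (q ^ k))) (*-·-assoc (+ j) (u ^ i) _)) ⟩
      w * ((+ j) · (u ^ i * ((p′ * (two * q)) * q ^ k)))  ≈⟨ *-·-assoc (+ j) w _ ⟩
      (+ j) · (w * (u ^ i * ((p′ * (two * q)) * q ^ k)))  ≈⟨ ·-congˡ (solve 6 (λ w u′ p′ t q q′ → w ⊕ (u′ ⊕ ((p′ ⊕ (t ⊕ q)) ⊕ q′)) ⊜ u′ ⊕ (((t ⊕ w) ⊕ p′) ⊕ (q ⊕ q′))) refl w (u ^ i) p′ two q (q ^ k)) ⟩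
      (+ j) · (u ^ i * ((two * w) * p′ * (q * q ^ k)))     ≈⟨ ·-congˡ (*-congˡ (*-congʳ (*-congʳ two*w≈p))) ⟩
      (+ j) · E i (suc (j ∸ 1)) (suc k)                   ≈⟨ ·-suc∸1 j (λ j′ → E i j′ (suc k)) ⟩
      (+ j) · E i j (suc k)                               ∎
      where
      open ≈-Reasoning setoid
      p′ = p ^ (j ∸ 1)

    w*δq^k : ∀ i j k → w * (u ^ i * (p ^ j * δ (q ^ k))) ≈ (+ k) · E i (suc j) (k ∸ 1)
    w*δq^k i j k = begin
      w * (u ^ i * (p ^ j * δ (q ^ k)))                   ≈⟨ *-congˡ (*-congˡ (*-congˡ (trans (δ-^ q k) (·-congˡ (*-congˡ δq≈2))))) ⟩
      w * (u ^ i * (p ^ j * ((+ k) · (q′ * two))))        ≈⟨ *-congˡ (trans (*-congˡ (*-·-assoc (+ k) (p ^ j) _)) (*-·-assoc (+ k) (u ^ i) _)) ⟩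
      w * ((+ k) · (u ^ i * (p ^ j * (q′ * two))))        ≈⟨ *-·-assoc (+ k) w _ ⟩
      (+ k) · (w * (u ^ i * (p ^ j * (q′ * two))))        ≈⟨ ·-congˡ (solve 5 (λ w u′ p′ q′ t → w ⊕ (u′ ⊕ (p′ ⊕ (q′ ⊕ t))) ⊜ u′ ⊕ (((t ⊕ w) ⊕ p′) ⊕ q′)) refl w (u ^ i) (p ^ j) q′ two) ⟩
      (+ k) · (u ^ i * ((two * w) * p ^ j * q′))          ≈⟨ ·-congˡ (*-congˡ (*-congʳ (*-congʳ two*w≈p))) ⟩
      (+ k) · E i (suc j) (k ∸ 1)                         ∎
      where
      open ≈-Reasoning setoid
      q′ = q ^ (k ∸ 1)

    step-E : ∀ i j k → step (E i j k) ≈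
      E (suc i) j k + (+ i) · E (i ∸ 1) (suc j) k + (+ j) · E i j (suc k) + (+ k) · E i (suc j) (k ∸ 1)
    step-E i j k = begin
      u * E i j k + w * δ (E i j k)
        ≈⟨ +-congˡ (*-congˡ (trans (δ-* (u ^ i) _) (+-congˡ (*-congˡ (δ-* (p ^ j) (q ^ k)))))) ⟩
      u * E i j k + w * (δ (u ^ i) * (p ^ j * q ^ k) + u ^ i * (δ (p ^ j) * q ^ k + p ^ j * δ (q ^ k)))
        ≈⟨ +-congˡ (trans (distribˡ w _ _) (+-congˡ (trans (*-congˡ (distribˡ (u ^ i) _ _)) (distribˡ w _ _)))) ⟩
      u * E i j k + (w * (δ (u ^ i) * (p ^ j * q ^ k)) +
                     (w * (u ^ i * (δ (p ^ j) * q ^ k)) + w * (u ^ i * (p ^ j * δ (q ^ k)))))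
        ≈⟨ +-cong (u*E i j k) (+-cong (w*δu^i i j k) (+-cong (w*δp^j i j k) (w*δq^k i j k))) ⟩
      E (suc i) j k + ((+ i) · E (i ∸ 1) (suc j) k + ((+ j) · E i j (suc k) + (+ k) · E i (suc j) (k ∸ 1)))
        ≈⟨ trans (sym (+-assoc _ _ _)) (sym (+-assoc _ _ _)) ⟩
      E (suc i) j k + (+ i) · E (i ∸ 1) (suc j) k + (+ j) · E i j (suc k) + (+ k) · E i (suc j) (k ∸ 1) ∎
      where open ≈-Reasoning setoid

    qDeg : ℕ → ℕ → ℕ → ℕ
    qDeg n i j = n ∸ i ∸ 2 ℕ.* j

    term : ℕ → ℕ → ℕ → Carrier
    term n i j = γ n i j · E i j (qDeg n i j)

    expansion : ℕ → Carrier
    expansion n = sumTo n (λ i → sumTo ((n ∸ i) / 2) (term n i))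

    sumBox : ℕ → (ℕ → ℕ → Carrier) → Carrier
    sumBox M f = sumTo M (λ i → sumTo M (f i))

    sumBox-cong : ∀ M {f g} → (∀ i j → f i j ≈ g i j) → sumBox M f ≈ sumBox M g
    sumBox-cong M f≈g = sumTo-cong M (λ i → sumTo-cong M (f≈g i))

    sumBox-+ : ∀ M f g → sumBox M (λ i j → f i j + g i j) ≈ sumBox M f + sumBox M g
    sumBox-+ M f g = trans (sumTo-cong M (λ i → sumTo-+ M (f i) (g i))) (sumTo-+ M _ _)

    sumBox-+⁴ : ∀ M f g h l → sumBox M (λ i j → f i j + g i j + h i j + l i j) ≈
      sumBox M f + sumBox M g + sumBox M h + sumBox M l
    sumBox-+⁴ M f g h l = trans (sumBox-+ M _ l) (+-congʳ (trans (sumBox-+ M _ h) (+-congʳ (sumBox-+ M f g))))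

    sumTo-dropLast : ∀ n {f} → f (suc n) ≈ 0# → sumTo (suc n) f ≈ sumTo n f
    sumTo-dropLast n f≈0 = trans (+-congˡ f≈0) (+-identityʳ _)

    <+2*suc : ∀ n i → n < i ℕ.+ 2 ℕ.* suc n
    <+2*suc n i = ℕ.<-≤-trans (ℕ.n<1+n n) (ℕ.≤-trans (ℕ.m≤m+n (suc n) (suc n ℕ.+ 0)) (ℕ.m≤n+m (2 ℕ.* suc n) i))

    γ·-vanishes : ∀ n i j x → n < i ℕ.+ 2 ℕ.* j → γ n i j · x ≈ 0#
    γ·-vanishes n i j x n< = ·-≡0 x (γ-vanishes n i j n<)

    expansion≈sumBox : ∀ n M → n ≤ M → expansion n ≈ sumBox M (term n)
    expansion≈sumBox n M n≤M = trans (sumTo-cong≤ n columns) (sym (sumTo-truncate n rows M n≤M))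
      where
      columns : ∀ i → i ≤ n → sumTo ((n ∸ i) / 2) (term n i) ≈ sumTo M (term n i)
      columns i i≤n = sym (sumTo-truncate ((n ∸ i) / 2) beyond M
        (ℕ.≤-trans (m/n≤m (n ∸ i) 2) (ℕ.≤-trans (ℕ.m∸n≤m n i) n≤M)))
        where
        beyond : ∀ j → (n ∸ i) / 2 < j → term n i j ≈ 0#
        beyond j lt = γ·-vanishes n i j _
          (≡.subst (_< i ℕ.+ 2 ℕ.* j) (ℕ.m+[n∸m]≡n i≤n) (ℕ.+-monoʳ-< i (/2<⇒<2* (n ∸ i) j lt)))
      rows : ∀ i → n < i → sumTo M (term n i) ≈ 0#
      rows i n<i = sumTo-zero M (λ j → γ·-vanishes n i j _ (ℕ.<-≤-trans n<i (ℕ.m≤m+n i _)))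

    qDeg-suc : ∀ n i j → i ℕ.+ 2 ℕ.* j ≤ n → qDeg (suc n) i j ≡ suc (qDeg n i j)
    qDeg-suc n i j i+2j≤n = ≡.trans (ℕ.∸-+-assoc (suc n) i (2 ℕ.* j))
      (≡.trans (ℕ.+-∸-assoc 1 i+2j≤n) (≡.cong suc (≡.sym (ℕ.∸-+-assoc n i (2 ℕ.* j)))))

    qDeg-trade : ∀ n i j → qDeg (suc n) i (suc j) ≡ qDeg n (suc i) j
    qDeg-trade n i j = ≡.trans (ℕ.∸-+-assoc (suc n) i (2 ℕ.* suc j))
      (≡.trans (≡.cong (suc n ∸_) i+2j+2≡) (≡.sym (ℕ.∸-+-assoc n (suc i) (2 ℕ.* j))))
      where
      i+2j+2≡ : i ℕ.+ 2 ℕ.* suc j ≡ suc (suc i ℕ.+ 2 ℕ.* j)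
      i+2j+2≡ = ≡.trans (≡.cong (i ℕ.+_) (ℕ.*-suc 2 j)) (≡.trans (ℕ.+-suc i _) (≡.cong suc (ℕ.+-suc i _)))

    qDeg-lower : ∀ n i j → qDeg (suc n) i (suc j) ≡ qDeg n i j ∸ 1
    qDeg-lower n i j = ≡.trans (qDeg-trade n i j) (≡.trans (ℕ.∸-+-assoc n (suc i) (2 ℕ.* j))
      (≡.trans (≡.sym (ℕ.pred[m∸n]≡m∸[1+n] n (i ℕ.+ 2 ℕ.* j))) (≡.cong (_∸ 1) (≡.sym (ℕ.∸-+-assoc n i (2 ℕ.* j))))))

    stepPart[u] stepPart[∂u] stepPart[∂p] stepPart[∂q] : ℕ → ℕ → ℕ → Carrier
    stepPart[u]  n i j = γ n i j · E (suc i) j (qDeg n i j)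
    stepPart[∂u] n i j = γ n i j · ((+ i) · E (i ∸ 1) (suc j) (qDeg n i j))
    stepPart[∂p] n i j = γ n i j · ((+ j) · E i j (suc (qDeg n i j)))
    stepPart[∂q] n i j = γ n i j · ((+ qDeg n i j) · E i (suc j) (qDeg n i j ∸ 1))

    nextPart[u] nextPart[∂u] nextPart[∂p] nextPart[∂q] : ℕ → ℕ → ℕ → Carrier
    nextPart[u]  n i j = γ[u]  n i j · E i j (qDeg (suc n) i j)
    nextPart[∂u] n i j = γ[∂u] n i j · E i j (qDeg (suc n) i j)
    nextPart[∂p] n i j = γ[∂p] n i j · E i j (qDeg (suc n) i j)
    nextPart[∂q] n i j = γ[∂q] n i j · E i j (qDeg (suc n) i j)

    step-term : ∀ n i j → step (term n i j) ≈
      stepPart[u] n i j + stepPart[∂u] n i j + stepPart[∂p] n i j + stepPart[∂q] n i j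
    step-term n i j = trans (step-· (γ n i j) _) (trans (·-congˡ (step-E i j (qDeg n i j)))
      (trans (·-distribˡ _ _ _) (+-congʳ (trans (·-distribˡ _ _ _) (+-congʳ (·-distribˡ _ _ _))))))

    term-suc : ∀ n i j → term (suc n) i j ≈
      nextPart[u] n i j + nextPart[∂u] n i j + nextPart[∂p] n i j + nextPart[∂q] n i j
    term-suc n i j = trans (reflexive (≡.cong (_· E i j (qDeg (suc n) i j)) (γ-suc n i j)))
      (trans (·-distribʳ _ _ _) (+-congʳ (trans (·-distribʳ _ _ _) (+-congʳ (·-distribʳ _ _ _)))))

    sum[u] : ∀ n → sumBox (suc n) (stepPart[u] n) ≈ sumBox (suc n) (nextPart[u] n)
    sum[u] n = trans (sumTo-dropLast n (sumTo-zero (suc n) λ j →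
                        γ·-vanishes n (suc n) j _ (ℕ.≤-trans (ℕ.n<1+n n) (ℕ.m≤m+n _ _))))
                     (sym (sumTo-suc₀ n (sumTo-zero (suc n) (λ j → ·-zero _))))

    sum[∂u] : ∀ n → sumBox (suc n) (stepPart[∂u] n) ≈ sumBox (suc n) (nextPart[∂u] n)
    sum[∂u] n = begin
      sumTo (suc n) (λ i → sumTo (suc n) (stepPart[∂u] n i))
        ≈⟨ sumTo-suc₀ n (sumTo-zero (suc n) (λ j → trans (·-congˡ (·-zero _)) (·-zeroʳ _))) ⟩
      sumTo n (λ i → sumTo (suc n) (g i))
        ≈⟨ sumTo-cong n (λ i → sumTo-dropLast n (γ·-vanishes n (suc i) (suc n) _ (<+2*suc n (suc i)))) ⟩
      sumTo n (λ i → sumTo n (g i))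
        ≈⟨ sym (sumTo-dropLast n (sumTo-zero n (λ j → γ·-vanishes n (suc (suc n)) j _ (ℕ.<-≤-trans (ℕ.n<1+n n) (ℕ.≤-trans (ℕ.n≤1+n (suc n)) (ℕ.m≤m+n _ _)))))) ⟩
      sumTo (suc n) (λ i → sumTo n (g i))
        ≈⟨ sumTo-cong (suc n) (λ i → sumTo-cong n (λ j → sym (traded i j))) ⟩
      sumTo (suc n) (λ i → sumTo n (λ j → nextPart[∂u] n i (suc j)))
        ≈⟨ sumTo-cong (suc n) (λ i → sym (sumTo-suc₀ n (·-zero _))) ⟩
      sumTo (suc n) (λ i → sumTo (suc n) (nextPart[∂u] n i)) ∎
      where
      open ≈-Reasoning setoid
      g : ℕ → ℕ → Carrier
      g i j = stepPart[∂u] n (suc i) j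
      traded : ∀ i j → nextPart[∂u] n i (suc j) ≈ g i j
      traded i j = trans (·-comm (+ suc i) (γ n (suc i) j) _)
        (·-congˡ (·-congˡ (reflexive (≡.cong (E i (suc j)) (qDeg-trade n i j)))))

    sum[∂p] : ∀ n → sumBox (suc n) (stepPart[∂p] n) ≈ sumBox (suc n) (nextPart[∂p] n)
    sum[∂p] n = sumBox-cong (suc n) raised
      where
      raised : ∀ i j → stepPart[∂p] n i j ≈ nextPart[∂p] n i j
      raised i j with γ-support n i j
      ... | inj₁ i+2j≤n = sym (trans (·-comm (+ j) (γ n i j) _)
                                     (·-congˡ (·-congˡ (reflexive (≡.cong (E i j) (qDeg-suc n i j i+2j≤n))))))
      ... | inj₂ γ≡0   = trans (·-≡0 _ γ≡0) (sym (·-≡0 _ (≡.trans (≡.cong (+ j ℤ.*_) γ≡0) (ℤ.*-zeroʳ (+ j)))))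

    sum[∂q] : ∀ n → sumBox (suc n) (stepPart[∂q] n) ≈ sumBox (suc n) (nextPart[∂q] n)
    sum[∂q] n = trans (sumTo-cong (suc n) (λ i → sumTo-dropLast n
                        (γ·-vanishes n i (suc n) _ (<+2*suc n i))))
              (sumTo-cong (suc n) (λ i → trans (sumTo-cong n (lowered i)) (sym (sumTo-suc₀ n (·-zero _)))))
      where
      lowered : ∀ i j → stepPart[∂q] n i j ≈ nextPart[∂q] n i (suc j)
      lowered i j with γ-support n i j
      ... | inj₁ i+2j≤n = sym (trans (·-comm (κ n i j) (γ n i j) _) (·-congˡ (trans
              (reflexive (≡.cong (_· E i (suc j) (qDeg (suc n) i (suc j))) κ≡qDeg))
              (·-congˡ (reflexive (≡.cong (E i (suc j)) (qDeg-lower n i j)))))))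
        where
        κ≡qDeg : κ n i j ≡ + qDeg n i j
        κ≡qDeg = ≡.trans (κ≡ n i j (n ∸ (i ℕ.+ 2 ℕ.* j)) (≡.sym (ℕ.m+[n∸m]≡n i+2j≤n)))
                         (≡.cong +_ (≡.sym (ℕ.∸-+-assoc n i (2 ℕ.* j))))
      ... | inj₂ γ≡0   = trans (·-≡0 _ γ≡0)
              (sym (·-≡0 _ (≡.trans (≡.cong (κ n i j ℤ.*_) γ≡0) (ℤ.*-zeroʳ (κ n i j)))))

    step-expansion : ∀ n → step (expansion n) ≈ expansion (suc n)
    step-expansion n = begin
      step (expansion n)
        ≈⟨ step-cong (expansion≈sumBox n (suc n) (ℕ.n≤1+n n)) ⟩
      step (sumBox (suc n) (term n))
        ≈⟨ trans (step-sumTo (suc n) _) (sumTo-cong (suc n) (λ i → step-sumTo (suc n) (term n i))) ⟩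
      sumBox (suc n) (λ i j → step (term n i j))
        ≈⟨ trans (sumBox-cong (suc n) (step-term n)) (sumBox-+⁴ (suc n) _ _ _ _) ⟩
      sumBox (suc n) (stepPart[u] n) + sumBox (suc n) (stepPart[∂u] n) +
      sumBox (suc n) (stepPart[∂p] n) + sumBox (suc n) (stepPart[∂q] n)
        ≈⟨ +-cong (+-cong (+-cong (sum[u] n) (sum[∂u] n)) (sum[∂p] n)) (sum[∂q] n) ⟩
      sumBox (suc n) (nextPart[u] n) + sumBox (suc n) (nextPart[∂u] n) +
      sumBox (suc n) (nextPart[∂p] n) + sumBox (suc n) (nextPart[∂q] n)
        ≈⟨ sym (trans (sumBox-cong (suc n) (term-suc n)) (sumBox-+⁴ (suc n) _ _ _ _)) ⟩
      sumBox (suc n) (term (suc n))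
        ≈⟨ sym (expansion≈sumBox (suc n) (suc n) ℕ.≤-refl) ⟩
      expansion (suc n) ∎
      where open ≈-Reasoning setoid

    expansion-0 : expansion 0 ≈ 1#
    expansion-0 = trans (·-identity _) (trans (*-identityˡ _) (*-identityˡ 1#))

    expansion-unfold : ∀ n → expansion n ≈
      sumTo n (λ i → u ^ i * sumTo ((n ∸ i) / 2) (λ j → γ n i j · (p ^ j * q ^ qDeg n i j)))
    expansion-unfold n = sumTo-cong n (λ i →
      sym (*-sumTo-· ((n ∸ i) / 2) (u ^ i) (γ n i) (λ j → p ^ j * q ^ qDeg n i j)))

    -- the expansion is a polynomial in u, q and w
    expansion-invariant : ∀ {φ} → IsEndomorphism R φ → φ u ≈ u → φ q ≈ q → φ w ≈ w → ∀ n → φ (expansion n) ≈ expansion n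
    expansion-invariant {φ} φ-endo φu φq φw n =
      trans (φ-sumTo n _) (sumTo-cong n (λ i → trans (φ-sumTo ((n ∸ i) / 2) _) (sumTo-cong ((n ∸ i) / 2) (λ j → φ-term i j))))
      where
      open IsEndomorphism φ-endo
      φp : φ p ≈ p
      φp = trans (φ-· (+ 2) w) (·-congˡ φw)
      φ-term : ∀ i j → φ (term n i j) ≈ term n i j
      φ-term i j = trans (φ-· (γ n i j) _) (·-congˡ (trans (φ-* (u ^ i) _) (*-cong (trans (φ-^ u i) (^-cong i φu))
        (trans (φ-* (p ^ j) _) (*-cong (trans (φ-^ p j) (^-cong j φp)) (trans (φ-^ q (qDeg n i j)) (^-cong (qDeg n i j) φq)))))))

module Words where

  open import Data.Nat as ℕ using (ℕ; suc; _≤_; _≟_; z≤n; s≤s; _+_; _*_)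
  import Data.Nat.Properties as ℕ
  open import Data.Nat.Solver using (module +-*-Solver)
  open import Data.List using (List; []; _∷_; _++_; [_]; length; filter; map; foldr)
  import Data.List.Properties as List
  open import Data.List.Relation.Unary.All as All using (All; []; _∷_)
  open import Data.List.Relation.Unary.Any using (here; there)
  open import Data.List.Relation.Unary.AllPairs using ([]; _∷_)
  open import Data.List.Relation.Unary.Unique.Propositional using (Unique)
  open import Data.List.Membership.Propositional using (_∈_; _∉_)
  import Data.List.Membership.Propositional.Properties as ∈
  open import Data.Product using (_×_; _,_; proj₁; proj₂; ∃)
  open import Relation.Nullary using (¬_; Dec; yes; no; contradiction)
  open import Relation.Binary.PropositionalEquality using (_≡_; refl; sym; trans; cong; cong₂)
  open import Defs using (pairs; splitsAux) public

  sumℕ : {A : Set} → List A → (A → ℕ) → ℕ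
  sumℕ xs f = foldr (λ x acc → f x + acc) 0 xs

  𝟙 : {P : Set} → Dec P → ℕ
  𝟙 (yes _) = 1
  𝟙 (no  _) = 0

  𝟙-⇔ : {P Q : Set} → (P → Q) → (Q → P) → (p : Dec P) (q : Dec Q) → 𝟙 p ≡ 𝟙 q
  𝟙-⇔ P→Q Q→P (yes p) (yes q) = refl
  𝟙-⇔ P→Q Q→P (yes p) (no ¬q) = contradiction (P→Q p) ¬q
  𝟙-⇔ P→Q Q→P (no ¬p) (yes q) = contradiction (Q→P q) ¬p
  𝟙-⇔ P→Q Q→P (no ¬p) (no ¬q) = refl

  𝟙-yes : {P : Set} → P → (p : Dec P) → 𝟙 p ≡ 1
  𝟙-yes x (yes _) = refl
  𝟙-yes x (no ¬x) = contradiction x ¬x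

  𝟙-no : {P : Set} → ¬ P → (p : Dec P) → 𝟙 p ≡ 0
  𝟙-no ¬x (yes x) = contradiction x ¬x
  𝟙-no ¬x (no _)  = refl

  𝟙≤1 : {P : Set} (p : Dec P) → 𝟙 p ≤ 1
  𝟙≤1 (yes _) = s≤s z≤n
  𝟙≤1 (no _)  = z≤n

  length-filter : {A : Set} {P : A → Set} (P? : ∀ x → Dec (P x)) → ∀ xs →
    length (filter P? xs) ≡ sumℕ xs (λ x → 𝟙 (P? x))
  length-filter P? []       = refl
  length-filter P? (x ∷ xs) with P? x
  ... | yes _ = cong suc (length-filter P? xs)
  ... | no  _ = length-filter P? xs

  sumℕ-++ : {A : Set} (f : A → ℕ) → ∀ xs ys → sumℕ (xs ++ ys) f ≡ sumℕ xs f + sumℕ ys f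
  sumℕ-++ f []       ys = refl
  sumℕ-++ f (x ∷ xs) ys = trans (cong (f x +_) (sumℕ-++ f xs ys)) (sym (ℕ.+-assoc (f x) _ _))

  sumℕ-map : {A B : Set} (f : B → ℕ) (g : A → B) → ∀ xs → sumℕ (map g xs) f ≡ sumℕ xs (λ x → f (g x))
  sumℕ-map f g []       = refl
  sumℕ-map f g (x ∷ xs) = cong (f (g x) +_) (sumℕ-map f g xs)

  sumℕ-cong : {A : Set} {f g : A → ℕ} → ∀ xs → (∀ x → x ∈ xs → f x ≡ g x) → sumℕ xs f ≡ sumℕ xs g
  sumℕ-cong []       f≡g = refl
  sumℕ-cong (x ∷ xs) f≡g = cong₂ _+_ (f≡g x (here refl)) (sumℕ-cong xs (λ y y∈ → f≡g y (there y∈)))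

  sumℕ-mono : {A : Set} {f g : A → ℕ} → ∀ xs → (∀ x → x ∈ xs → f x ≤ g x) → sumℕ xs f ≤ sumℕ xs g
  sumℕ-mono []       f≤g = z≤n
  sumℕ-mono (x ∷ xs) f≤g = ℕ.+-mono-≤ (f≤g x (here refl)) (sumℕ-mono xs (λ y y∈ → f≤g y (there y∈)))

  sumℕ-+ : {A : Set} (f g : A → ℕ) → ∀ xs → sumℕ xs (λ x → f x + g x) ≡ sumℕ xs f + sumℕ xs g
  sumℕ-+ f g []       = refl
  sumℕ-+ f g (x ∷ xs) = trans (cong (f x + g x +_) (sumℕ-+ f g xs)) (interchange (f x) (g x) _ _)
    where
    open +-*-Solver
    interchange : ∀ a b c d → a + b + (c + d) ≡ a + c + (b + d)
    interchange = solve 4 (λ a b c d → a :+ b :+ (c :+ d) := a :+ c :+ (b :+ d)) refl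

  sumℕ-*ˡ : {A : Set} (k : ℕ) (f : A → ℕ) → ∀ xs → sumℕ xs (λ x → k * f x) ≡ k * sumℕ xs f
  sumℕ-*ˡ k f []       = sym (ℕ.*-zeroʳ k)
  sumℕ-*ˡ k f (x ∷ xs) = trans (cong (k * f x +_) (sumℕ-*ˡ k f xs)) (sym (ℕ.*-distribˡ-+ k _ _))

  sumℕ-*ʳ : {A : Set} (f : A → ℕ) (k : ℕ) → ∀ xs → sumℕ xs (λ x → f x * k) ≡ sumℕ xs f * k
  sumℕ-*ʳ f k []       = refl
  sumℕ-*ʳ f k (x ∷ xs) = trans (cong (f x * k +_) (sumℕ-*ʳ f k xs)) (sym (ℕ.*-distribʳ-+ k (f x) _))

  sumℕ-comm : {A B : Set} (F : A → B → ℕ) → ∀ xs ys →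
    sumℕ xs (λ x → sumℕ ys (F x)) ≡ sumℕ ys (λ y → sumℕ xs (λ x → F x y))
  sumℕ-comm F []       ys = sym (sumℕ-zero ys)
    where
    sumℕ-zero : ∀ ys → sumℕ ys (λ _ → 0) ≡ 0
    sumℕ-zero []       = refl
    sumℕ-zero (y ∷ ys) = sumℕ-zero ys
  sumℕ-comm F (x ∷ xs) ys = trans (cong (sumℕ ys (F x) +_) (sumℕ-comm F xs ys))
    (sym (sumℕ-+ (F x) (λ y → sumℕ xs (λ x′ → F x′ y)) ys))

  count : ℕ → List ℕ → ℕ
  count y xs = sumℕ xs (λ x → 𝟙 (x ≟ y))

  count-∉ : ∀ y xs → y ∉ xs → count y xs ≡ 0
  count-∉ y []       y∉ = refl
  count-∉ y (x ∷ xs) y∉ with x ≟ y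
  ... | yes refl = contradiction (here refl) y∉
  ... | no  _    = count-∉ y xs (λ y∈ → y∉ (there y∈))

  count-unique : ∀ y xs → Unique xs → count y xs ≤ 1
  count-unique y []       _         = z≤n
  count-unique y (x ∷ xs) (x∉ ∷ xs!) with x ≟ y
  ... | yes refl = ℕ.≤-reflexive (cong suc (count-∉ y xs (λ y∈ → All.lookup x∉ y∈ refl)))
  ... | no  _    = count-unique y xs xs!

  count-∈ : ∀ y xs → Unique xs → y ∈ xs → count y xs ≡ 1
  count-∈ y (x ∷ xs) (x∉ ∷ xs!) y∈ with x ≟ y
  ... | yes refl = cong suc (count-∉ y xs (λ y∈ → All.lookup x∉ y∈ refl))
  count-∈ y (x ∷ xs) (x∉ ∷ xs!) (here refl) | no x≢y = contradiction refl x≢y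
  count-∈ y (x ∷ xs) (x∉ ∷ xs!) (there y∈)  | no x≢y = count-∈ y xs xs! y∈

  unique-middle : ∀ xs {y : ℕ} ys → Unique (xs ++ y ∷ ys) → y ∉ xs × y ∉ ys
  unique-middle []       ys (y∉ ∷ _)   = (λ ()) , (λ y∈ → All.lookup y∉ y∈ refl)
  unique-middle (x ∷ xs) ys (x∉ ∷ xs!) =
    (λ { (here refl) → All.lookup x∉ (∈.∈-++⁺ʳ xs (here refl)) refl
       ; (there y∈)  → proj₁ (unique-middle xs ys xs!) y∈ }) ,
    proj₂ (unique-middle xs ys xs!)

  InRange : ℕ → ℕ → Set
  InRange n x = 1 ≤ x × x ≤ n

  -- head, with π(n+1) = 0 as in the definition of plrmin
  head₀ : List ℕ → ℕ
  head₀ []      = 0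
  head₀ (w ∷ _) = w

  tail₀ : List ℕ → List ℕ
  tail₀ []      = []
  tail₀ (_ ∷ B) = B ++ [ 0 ]

  ++[0]-head₀ : ∀ B → B ++ [ 0 ] ≡ head₀ B ∷ tail₀ B
  ++[0]-head₀ []      = refl
  ++[0]-head₀ (b ∷ B) = refl

  pairs-++ : ∀ xs (u : ℕ) rest → pairs (xs ++ u ∷ rest) ≡ pairs (xs ++ [ u ]) ++ pairs (u ∷ rest)
  pairs-++ []           u rest = refl
  pairs-++ (x ∷ [])     u rest = refl
  pairs-++ (x ∷ y ∷ xs) u rest = cong ((x , y) ∷_) (pairs-++ (y ∷ xs) u rest)

  pairs-fst∈ : ∀ xs {p} → p ∈ pairs xs → proj₁ p ∈ xs
  pairs-fst∈ (x ∷ y ∷ xs) (here refl) = here refl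
  pairs-fst∈ (x ∷ y ∷ xs) (there p∈)  = there (pairs-fst∈ (y ∷ xs) p∈)

  pairs-fst∈-init : ∀ xs (u : ℕ) {p} → p ∈ pairs (xs ++ [ u ]) → proj₁ p ∈ xs
  pairs-fst∈-init []           u ()
  pairs-fst∈-init (x ∷ [])     u (here refl) = here refl
  pairs-fst∈-init (x ∷ y ∷ xs) u (here refl) = here refl
  pairs-fst∈-init (x ∷ y ∷ xs) u (there p∈)  = there (pairs-fst∈-init (y ∷ xs) u p∈)

  countPairs : {R : ℕ × ℕ → Set} → (∀ p → Dec (R p)) → List ℕ → ℕ
  countPairs R? xs = sumℕ (pairs xs) (λ p → 𝟙 (R? p))

  countPairs-++ : {R : ℕ × ℕ → Set} (R? : ∀ p → Dec (R p)) → ∀ xs u rest →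
    countPairs R? (xs ++ u ∷ rest) ≡ countPairs R? (xs ++ [ u ]) + countPairs R? (u ∷ rest)
  countPairs-++ R? xs u rest =
    trans (cong (λ ps → sumℕ ps _) (pairs-++ xs u rest)) (sumℕ-++ _ (pairs (xs ++ [ u ])) _)

  nextPair : {R : ℕ × ℕ → Set} → (∀ p → Dec (R p)) → ℕ → List ℕ → ℕ
  nextPair R? u []      = 0
  nextPair R? u (w ∷ _) = 𝟙 (R? (u , w))

  countPairs-∷ : {R : ℕ × ℕ → Set} (R? : ∀ p → Dec (R p)) → ∀ u B →
    countPairs R? (u ∷ B) ≡ nextPair R? u B + countPairs R? B
  countPairs-∷ R? u []      = refl
  countPairs-∷ R? u (w ∷ B) = refl

  Split : Set
  Split = List ℕ × ℕ × List ℕ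

  letter : Split → ℕ
  letter (_ , v , _) = v

  suffix : Split → List ℕ
  suffix (_ , _ , q) = q

  extend : List ℕ → Split → Split
  extend ys (p , v , q) = p , v , q ++ ys

  insertAfter : ℕ → Split → List ℕ
  insertAfter N (A , u , B) = A ++ u ∷ N ∷ B

  prepend : List ℕ → Split → Split
  prepend xs (p , v , q) = xs ++ p , v , q

  splitsAux-prepend : ∀ acc pre xs → splitsAux (acc ++ pre) xs ≡ map (prepend acc) (splitsAux pre xs)
  splitsAux-prepend acc pre []       = refl
  splitsAux-prepend acc pre (x ∷ xs) = cong ((acc ++ pre , x , xs) ∷_)
    (trans (cong (λ a → splitsAux a xs) (List.++-assoc acc pre [ x ])) (splitsAux-prepend acc (pre ++ [ x ]) xs))

  splitsAux≡map-prepend : ∀ acc xs → splitsAux acc xs ≡ map (prepend acc) (splitsAux [] xs)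
  splitsAux≡map-prepend acc xs =
    trans (cong (λ a → splitsAux a xs) (sym (List.++-identityʳ acc))) (splitsAux-prepend acc [] xs)

  splitsAux-++ : ∀ acc xs ys →
    splitsAux acc (xs ++ ys) ≡ map (extend ys) (splitsAux acc xs) ++ splitsAux (acc ++ xs) ys
  splitsAux-++ acc []       ys = cong (λ a → splitsAux a ys) (sym (List.++-identityʳ acc))
  splitsAux-++ acc (x ∷ xs) ys = cong ((acc , x , xs ++ ys) ∷_)
    (trans (splitsAux-++ (acc ++ [ x ]) xs ys)
           (cong (λ a → map (extend ys) (splitsAux (acc ++ [ x ]) xs) ++ splitsAux a ys) (List.++-assoc acc [ x ] xs)))

  splitsAux-∈ : ∀ acc xs {s} → s ∈ splitsAux acc xs → ∃ λ p → (proj₁ s ≡ acc ++ p) × (xs ≡ p ++ letter s ∷ suffix s)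
  splitsAux-∈ acc (x ∷ xs) (here refl) = [] , sym (List.++-identityʳ acc) , refl
  splitsAux-∈ acc (x ∷ xs) (there s∈) with splitsAux-∈ (acc ++ [ x ]) xs s∈
  ... | p , s≡ , xs≡ = x ∷ p , trans s≡ (List.++-assoc acc [ x ] p) , cong (x ∷_) xs≡

  splits-∈ : ∀ xs {s} → s ∈ splitsAux [] xs → xs ≡ proj₁ s ++ letter s ∷ suffix s
  splits-∈ xs s∈ with splitsAux-∈ [] xs s∈
  ... | p , s≡ , xs≡ = trans xs≡ (cong (_++ _) (sym s≡))

  sumℕ-splits-letter : ∀ xs acc (f : ℕ → ℕ) → sumℕ (splitsAux acc xs) (λ s → f (letter s)) ≡ sumℕ xs f
  sumℕ-splits-letter []       acc f = refl
  sumℕ-splits-letter (x ∷ xs) acc f = cong (f x +_) (sumℕ-splits-letter xs (acc ++ [ x ]) f)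

  countPairs-splits : {R : ℕ × ℕ → Set} (R? : ∀ p → Dec (R p)) → ∀ xs acc →
    countPairs R? xs ≡ sumℕ (splitsAux acc xs) (λ s → nextPair R? (letter s) (suffix s))
  countPairs-splits R? []           acc = refl
  countPairs-splits R? (x ∷ [])     acc = refl
  countPairs-splits R? (x ∷ y ∷ xs) acc = cong (𝟙 (R? (x , y)) +_) (countPairs-splits R? (y ∷ xs) (acc ++ [ x ]))

  isEmpty : List ℕ → ℕ
  isEmpty []      = 1
  isEmpty (_ ∷ _) = 0

  sumℕ-splits-isEmpty : ∀ {y} xs acc → y ∈ xs → sumℕ (splitsAux acc xs) (λ s → isEmpty (suffix s)) ≡ 1
  sumℕ-splits-isEmpty (x ∷ [])     acc _ = refl
  sumℕ-splits-isEmpty (x ∷ y ∷ xs) acc _ = sumℕ-splits-isEmpty (y ∷ xs) (acc ++ [ x ]) (here refl)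

module Permutations where

  open import Data.Nat as ℕ using (ℕ; zero; suc; _≤_; _≟_; z≤n; s≤s)
  import Data.Nat.Properties as ℕ
  open import Data.List using (List; []; _∷_; _++_; [_]; length; filter; concatMap; map; upTo)
  import Data.List.Properties as List
  open import Data.List.Relation.Unary.All as All using (All; []; _∷_)
  import Data.List.Relation.Unary.All.Properties as All
  open import Data.List.Relation.Unary.Any using (here; there)
  open import Data.List.Relation.Unary.AllPairs using ([]; _∷_)
  open import Data.List.Relation.Unary.Unique.Propositional using (Unique)
  import Data.List.Relation.Unary.Unique.Propositional.Properties as Unique
  open import Data.List.Relation.Unary.Unique.DecPropositional _≟_ using (unique?)
  open import Data.List.Membership.Propositional using (_∈_; _∉_; find; lose)
  import Data.List.Membership.Propositional.Properties as ∈
  open import Data.List.Membership.DecPropositional _≟_ using (_∈?_)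
  open import Data.List.Relation.Binary.Permutation.Propositional using (_↭_)
  open import Data.List.Membership.Propositional.Properties.WithK using (unique∧set⇒bag)
  open import Data.List.Relation.Binary.BagAndSetEquality using (∼bag⇒↭)
  open import Data.Product using (_×_; _,_; proj₁; proj₂; ∃)
  open import Data.Sum using ([_,_]′)
  open import Function.Bundles using (mk⇔)
  open import Relation.Nullary using (¬_; yes; no; ¬?; contradiction)
  open import Relation.Binary.PropositionalEquality as ≡ using (_≡_; _≢_; refl; sym; trans; cong; cong₂)
  open import Defs using (words; perms)
  open Words

  ∈-words⁺ : ∀ n k w → length w ≡ k → All (InRange n) w → w ∈ words n k
  ∈-words⁺ n zero    []      refl [] = here refl
  ∈-words⁺ n (suc k) (suc a ∷ w) |w|≡ ((_ , a<n) ∷ w∈) =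
    ∈.∈-concatMap⁺ (λ w → map (λ a → suc a ∷ w) (upTo n))
      (lose (∈-words⁺ n k w (ℕ.suc-injective |w|≡) w∈) (∈.∈-map⁺ (λ a → suc a ∷ w) (∈.∈-upTo⁺ a<n)))

  ∈-words⁻ : ∀ n k w → w ∈ words n k → length w ≡ k × All (InRange n) w
  ∈-words⁻ n zero    .[] (here refl) = refl , []
  ∈-words⁻ n (suc k) w   w∈ with find (∈.∈-concatMap⁻ (λ w → map (λ a → suc a ∷ w) (upTo n)) {xs = words n k} w∈)
  ... | w′ , w′∈ , w∈′ with ∈.∈-map⁻ (λ a → suc a ∷ w′) w∈′
  ... | a , a∈ , refl with ∈-words⁻ n k w′ w′∈
  ... | |w′|≡ , w′-range = cong suc |w′|≡ , (s≤s z≤n , ∈.∈-upTo⁻ a∈) ∷ w′-range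

  ∈-perms⁺ : ∀ n w → Unique w → length w ≡ n → All (InRange n) w → w ∈ perms n
  ∈-perms⁺ n w w! |w|≡n w-range = ∈.∈-filter⁺ unique? (∈-words⁺ n n w |w|≡n w-range) w!

  ∈-perms⁻ : ∀ n w → w ∈ perms n → Unique w × length w ≡ n × All (InRange n) w
  ∈-perms⁻ n w w∈ with ∈.∈-filter⁻ unique? {xs = words n n} w∈
  ... | w∈words , w! = w! , ∈-words⁻ n n w w∈words

  InRange-shrink : ∀ n x → InRange (suc n) x → x ≢ suc n → InRange n x
  InRange-shrink n x (1≤x , x≤1+n) x≢1+n = 1≤x , ℕ.≤-pred (ℕ.≤∧≢⇒< x≤1+n x≢1+n)

  unique⇒length≤ : ∀ n w → Unique w → All (InRange n) w → length w ≤ n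
  unique⇒length≤ zero    []      _  _                    = z≤n
  unique⇒length≤ zero    (x ∷ w) _  ((1≤x , x≤0) ∷ _)    = contradiction (ℕ.≤-trans 1≤x x≤0) λ ()
  unique⇒length≤ (suc n) w       w! w-range = begin
    length w                                                   ≡⟨ length≡ w ⟩
    sumℕ w (λ x → 𝟙 (x ≟ suc n) ℕ.+ 𝟙 (¬? (x ≟ suc n)))       ≡⟨ sumℕ-+ _ _ w ⟩
    count (suc n) w ℕ.+ sumℕ w (λ x → 𝟙 (¬? (x ≟ suc n)))     ≡⟨ cong (count (suc n) w ℕ.+_) (sym (length-filter (λ x → ¬? (x ≟ suc n)) w)) ⟩
    count (suc n) w ℕ.+ length w′                              ≤⟨ ℕ.+-mono-≤ (count-unique (suc n) w w!)
                                                                   (unique⇒length≤ n w′ (Unique.filter⁺ _ w!) w′-range) ⟩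
    suc n                                                      ∎
    where
    open ℕ.≤-Reasoning
    w′ = filter (λ x → ¬? (x ≟ suc n)) w
    length≡ : ∀ xs → length xs ≡ sumℕ xs (λ x → 𝟙 (x ≟ suc n) ℕ.+ 𝟙 (¬? (x ≟ suc n)))
    length≡ []       = refl
    length≡ (x ∷ xs) with x ≟ suc n
    ... | yes _ = cong suc (length≡ xs)
    ... | no  _ = cong suc (length≡ xs)
    w′-range : All (InRange n) w′
    w′-range = All.zipWith (λ (shrink , x≢) → shrink x≢)
      (All.filter⁺ (λ x → ¬? (x ≟ suc n)) (All.map (λ {x} → InRange-shrink n x) w-range) ,
       All.all-filter (λ x → ¬? (x ≟ suc n)) w)

  insertions : ℕ → List ℕ → List (List ℕ)
  insertions N []       = (N ∷ []) ∷ []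
  insertions N (x ∷ xs) = (N ∷ x ∷ xs) ∷ map (x ∷_) (insertions N xs)

  insertAfter-∷ : ∀ N y acc xs →
    map (insertAfter N) (splitsAux (y ∷ acc) xs) ≡ map (y ∷_) (map (insertAfter N) (splitsAux acc xs))
  insertAfter-∷ N y acc []       = refl
  insertAfter-∷ N y acc (x ∷ xs) = cong ((y ∷ acc ++ x ∷ N ∷ xs) ∷_) (insertAfter-∷ N y (acc ++ [ x ]) xs)

  insertions≡ : ∀ N π → insertions N π ≡ (N ∷ π) ∷ map (insertAfter N) (splitsAux [] π)
  insertions≡ N []       = refl
  insertions≡ N (x ∷ xs) = cong ((N ∷ x ∷ xs) ∷_) (trans (cong (map (x ∷_)) (insertions≡ N xs))
    (cong ((x ∷ N ∷ xs) ∷_) (sym (insertAfter-∷ N x [] xs))))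

  ∈-insertions⁺ : ∀ N A B → A ++ N ∷ B ∈ insertions N (A ++ B)
  ∈-insertions⁺ N []      []      = here refl
  ∈-insertions⁺ N []      (b ∷ B) = here refl
  ∈-insertions⁺ N (a ∷ A) B       = there (∈.∈-map⁺ (a ∷_) (∈-insertions⁺ N A B))

  ∈-insertions⁻ : ∀ N π {σ} → σ ∈ insertions N π → ∃ λ A → ∃ λ B → π ≡ A ++ B × σ ≡ A ++ N ∷ B
  ∈-insertions⁻ N []       (here refl) = [] , [] , refl , refl
  ∈-insertions⁻ N (x ∷ xs) (here refl) = [] , x ∷ xs , refl , refl
  ∈-insertions⁻ N (x ∷ xs) (there σ∈) with ∈.∈-map⁻ (x ∷_) σ∈
  ... | σ′ , σ′∈ , refl with ∈-insertions⁻ N xs σ′∈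
  ... | A , B , xs≡ , σ′≡ = x ∷ A , B , cong (x ∷_) xs≡ , cong (x ∷_) σ′≡

  insertions-unique : ∀ N π → N ∉ π → Unique (insertions N π)
  insertions-unique N []       _   = [] ∷ []
  insertions-unique N (x ∷ xs) N∉ =
    All.tabulate front≢ ∷ Unique.map⁺ List.∷-injectiveʳ (insertions-unique N xs (λ N∈ → N∉ (there N∈)))
    where
    front≢ : ∀ {σ} → σ ∈ map (x ∷_) (insertions N xs) → N ∷ x ∷ xs ≢ σ
    front≢ σ∈ σ≡ with ∈.∈-map⁻ (x ∷_) σ∈
    ... | _ , _ , refl = N∉ (here (List.∷-injectiveˡ σ≡))

  delete : ℕ → List ℕ → List ℕ
  delete N = filter (λ a → ¬? (a ≟ N))

  delete-∉ : ∀ N xs → N ∉ xs → delete N xs ≡ xs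
  delete-∉ N xs N∉ = List.filter-all (λ a → ¬? (a ≟ N)) (All.tabulate (λ x∈ x≡N → N∉ (≡.subst (_∈ xs) x≡N x∈)))

  delete-insert : ∀ N A B → N ∉ A ++ B → delete N (A ++ N ∷ B) ≡ A ++ B
  delete-insert N A B N∉ = begin
    delete N (A ++ N ∷ B)         ≡⟨ List.filter-++ _ A (N ∷ B) ⟩
    delete N A ++ delete N (N ∷ B) ≡⟨ cong (delete N A ++_) (List.filter-reject (λ a → ¬? (a ≟ N)) (λ ¬N≡N → ¬N≡N refl)) ⟩
    delete N A ++ delete N B       ≡⟨ cong₂ _++_ (delete-∉ N A (λ N∈ → N∉ (∈.∈-++⁺ˡ N∈))) (delete-∉ N B (λ N∈ → N∉ (∈.∈-++⁺ʳ A N∈))) ⟩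
    A ++ B                         ∎
    where open ≡.≡-Reasoning

  insertions-disjoint : ∀ N π π′ {σ} → N ∉ π → N ∉ π′ → σ ∈ insertions N π → σ ∈ insertions N π′ → π ≡ π′
  insertions-disjoint N π π′ N∉π N∉π′ σ∈ σ∈′ with ∈-insertions⁻ N π σ∈ | ∈-insertions⁻ N π′ σ∈′
  ... | A , B , π≡ , σ≡ | A′ , B′ , π′≡ , σ≡′ =
    trans π≡ (trans (sym (delete-insert N A B (≡.subst (N ∉_) π≡ N∉π)))
    (trans (cong (delete N) (trans (sym σ≡) σ≡′)) (trans (delete-insert N A′ B′ (≡.subst (N ∉_) π′≡ N∉π′)) (sym π′≡))))

  unique-concatMap : {A B : Set} (f : A → List B) → ∀ xs → Unique xs → (∀ x → x ∈ xs → Unique (f x)) →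
    (∀ x y {z} → x ∈ xs → y ∈ xs → z ∈ f x → z ∈ f y → x ≡ y) → Unique (concatMap f xs)
  unique-concatMap f []       _          _      _        = []
  unique-concatMap f (x ∷ xs) (x∉ ∷ xs!) f-uniq disjoint = Unique.++⁺ (f-uniq x (here refl))
    (unique-concatMap f xs xs! (λ y y∈ → f-uniq y (there y∈)) (λ y y′ y∈ y′∈ → disjoint y y′ (there y∈) (there y′∈)))
    separate
    where
    separate : ∀ {z} → ¬ (z ∈ f x × z ∈ concatMap f xs)
    separate (z∈fx , z∈rest) with find (∈.∈-concatMap⁻ f {xs = xs} z∈rest)
    ... | y , y∈ , z∈fy = All.lookup x∉ y∈ (disjoint x y (here refl) (there y∈) z∈fx z∈fy)

  words-unique : ∀ n k → Unique (words n k)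
  words-unique n zero    = [] ∷ []
  words-unique n (suc k) = unique-concatMap extensions (words n k) (words-unique n k)
    (λ w _ → Unique.map⁺ (λ e → ℕ.suc-injective (List.∷-injectiveˡ e)) (Unique.upTo⁺ n)) disjoint
    where
    extensions : List ℕ → List (List ℕ)
    extensions w = map (λ a → suc a ∷ w) (upTo n)
    disjoint : ∀ w w′ {z} → w ∈ words n k → w′ ∈ words n k → z ∈ extensions w → z ∈ extensions w′ → w ≡ w′
    disjoint w w′ _ _ z∈ z∈′ with ∈.∈-map⁻ (λ a → suc a ∷ w) z∈ | ∈.∈-map⁻ (λ a → suc a ∷ w′) z∈′
    ... | a , _ , refl | b , _ , z≡ = List.∷-injectiveʳ z≡

  perms-unique : ∀ n → Unique (perms n)
  perms-unique n = Unique.filter⁺ unique? (words-unique n n)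

  suc∉perm : ∀ n π → All (InRange n) π → suc n ∉ π
  suc∉perm n π π-range 1+n∈ = ℕ.<-irrefl refl (proj₂ (All.lookup π-range 1+n∈))

  All-delete : ∀ {P : ℕ → Set} A {x : ℕ} B → All P (A ++ x ∷ B) → All P (A ++ B)
  All-delete []      B (_ ∷ B-all)  = B-all
  All-delete (a ∷ A) B (pa ∷ rest) = pa ∷ All-delete A B rest

  All-insert : ∀ {P : ℕ → Set} A B {x : ℕ} → All P (A ++ B) → P x → All P (A ++ x ∷ B)
  All-insert []      B AB-all      px = px ∷ AB-all
  All-insert (a ∷ A) B (pa ∷ rest) px = pa ∷ All-insert A B rest px

  length-insert : ∀ A {x : ℕ} B → length (A ++ x ∷ B) ≡ suc (length (A ++ B))
  length-insert []      B = refl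
  length-insert (a ∷ A) B = cong suc (length-insert A B)

  unique-delete : ∀ A {x : ℕ} B → Unique (A ++ x ∷ B) → Unique (A ++ B)
  unique-delete []      B (_ ∷ B!)      = B!
  unique-delete (a ∷ A) B (a∉ ∷ AxB!) = All-delete A B a∉ ∷ unique-delete A B AxB!

  unique-insert : ∀ A B {x : ℕ} → Unique (A ++ B) → x ∉ A → x ∉ B → Unique (A ++ x ∷ B)
  unique-insert []      B AB!          x∉A x∉B = All.tabulate (λ y∈ x≡y → x∉B (≡.subst (_∈ B) (sym x≡y) y∈)) ∷ AB!
  unique-insert (a ∷ A) B (a∉ ∷ AB!) x∉A x∉B =
    All-insert A B a∉ (λ a≡x → x∉A (here (sym a≡x))) ∷ unique-insert A B AB! (λ x∈ → x∉A (there x∈)) x∉B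

  suc∈ : ∀ n σ → Unique σ → length σ ≡ suc n → All (InRange (suc n)) σ → suc n ∈ σ
  suc∈ n σ σ! |σ|≡ σ-range with suc n ∈? σ
  ... | yes 1+n∈ = 1+n∈
  ... | no  1+n∉ = contradiction (ℕ.≤-trans (ℕ.≤-reflexive (sym |σ|≡)) (unique⇒length≤ n σ σ! shrunk)) (ℕ.<-irrefl refl)
    where
    shrunk : All (InRange n) σ
    shrunk = All.tabulate (λ {x} x∈ → InRange-shrink n x (All.lookup σ-range x∈) (λ x≡ → 1+n∉ (≡.subst (_∈ σ) x≡ x∈)))

  perms-suc⁻ : ∀ n σ → σ ∈ perms (suc n) → ∃ λ π → π ∈ perms n × σ ∈ insertions (suc n) π
  perms-suc⁻ n σ σ∈ with ∈-perms⁻ (suc n) σ σ∈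
  ... | σ! , |σ|≡ , σ-range with ∈.∈-∃++ (suc∈ n σ σ! |σ|≡ σ-range)
  ... | A , B , refl = A ++ B , ∈-perms⁺ n (A ++ B) (unique-delete A B σ!)
                         (ℕ.suc-injective (trans (sym (length-insert A B)) |σ|≡)) AB-range ,
                       ∈-insertions⁺ (suc n) A B
    where
    AB-range : All (InRange n) (A ++ B)
    AB-range = All.tabulate (λ {x} x∈ → InRange-shrink n x (All.lookup (All-delete A B σ-range) x∈)
      (λ x≡ → [ (λ x∈A → proj₁ (unique-middle A B σ!) (≡.subst (_∈ A) x≡ x∈A)) ,
                (λ x∈B → proj₂ (unique-middle A B σ!) (≡.subst (_∈ B) x≡ x∈B)) ]′ (∈.∈-++⁻ A x∈)))

  perms-suc⁺ : ∀ n π σ → π ∈ perms n → σ ∈ insertions (suc n) π → σ ∈ perms (suc n)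
  perms-suc⁺ n π σ π∈ σ∈ with ∈-perms⁻ n π π∈ | ∈-insertions⁻ (suc n) π σ∈
  ... | π! , |π|≡ , π-range | A , B , refl , refl =
    ∈-perms⁺ (suc n) (A ++ suc n ∷ B)
      (unique-insert A B π! (λ 1+n∈ → suc∉perm n (A ++ B) π-range (∈.∈-++⁺ˡ 1+n∈))
                            (λ 1+n∈ → suc∉perm n (A ++ B) π-range (∈.∈-++⁺ʳ A 1+n∈)))
      (trans (length-insert A B) (cong suc |π|≡))
      (All-insert A B (All.map (λ (1≤x , x≤n) → 1≤x , ℕ.m≤n⇒m≤1+n x≤n) π-range) (s≤s z≤n , ℕ.≤-refl))

  perms-suc↭ : ∀ n → perms (suc n) ↭ concatMap (insertions (suc n)) (perms n)
  perms-suc↭ n = ∼bag⇒↭ (unique∧set⇒bag (perms-unique (suc n))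
    (unique-concatMap (insertions (suc n)) (perms n) (perms-unique n)
      (λ π π∈ → insertions-unique (suc n) π (suc∉ π π∈))
      (λ π π′ π∈ π′∈ → insertions-disjoint (suc n) π π′ (suc∉ π π∈) (suc∉ π′ π′∈)))
    (mk⇔ (λ σ∈ → let π , π∈ , σ∈′ = perms-suc⁻ n _ σ∈ in ∈.∈-concatMap⁺ (insertions (suc n)) (lose π∈ σ∈′))
         (λ σ∈ → let π , π∈ , σ∈′ = find (∈.∈-concatMap⁻ (insertions (suc n)) {xs = perms n} σ∈)
                 in perms-suc⁺ n π _ π∈ σ∈′)))
    where
    suc∉ : ∀ π → π ∈ perms n → suc n ∉ π
    suc∉ π π∈ = suc∉perm n π (proj₂ (proj₂ (∈-perms⁻ n π π∈)))

module InsertingTheMaximum where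

  open import Data.Nat as ℕ using (ℕ; zero; suc; _<_; _≤_; _∸_; _≟_; _<?_; _≤?_; z≤n; s≤s; _+_; _*_)
  import Data.Nat.Properties as ℕ
  open import Data.Nat.Solver using (module +-*-Solver)
  open import Data.List using (List; []; _∷_; _++_; [_]; map)
  import Data.List.Properties as List
  open import Data.List.Relation.Unary.All as All using (All; []; _∷_)
  import Data.List.Relation.Unary.All.Properties as All
  open import Data.List.Relation.Unary.Any as Any using (Any; here; there)
  import Data.List.Relation.Unary.Any.Properties as Any
  open import Data.List.Relation.Unary.AllPairs using ([]; _∷_)
  open import Data.List.Relation.Unary.Unique.Propositional using (Unique)
  open import Data.List.Membership.Propositional using (_∈_; _∉_; find)
  import Data.List.Membership.Propositional.Properties as ∈
  open import Data.Product using (Σ; _×_; _,_; proj₁; proj₂)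
  open import Data.Sum using (_⊎_; inj₁; inj₂)
  open import Data.Empty using (⊥-elim)
  open import Relation.Nullary using (¬_; Dec; yes; no; ¬?)
  open import Relation.Nullary.Decidable using (_×-dec_)
  open import Relation.Binary.PropositionalEquality as ≡ using (_≡_; _≢_; refl; sym; trans; cong; cong₂; subst)
  open import Defs using (Proper; proper?; plrmin; des; sucs; basc)
  open Words

  -- the pair (π(k), π(k+1)) witnesses properness of the left-to-right minimum v
  Witness : ℕ → ℕ × ℕ → Set
  Witness v (x , y) = x ≡ v ∸ 1 × y < x

  witness-split : ∀ v q u rest → Any (Witness v) (pairs (q ++ u ∷ rest)) →
    Any (Witness v) (pairs (q ++ [ u ])) ⊎ Any (Witness v) (pairs (u ∷ rest))
  witness-split v q u rest w rewrite pairs-++ q u rest = Any.++⁻ (pairs (q ++ [ u ])) w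

  witness-inˡ : ∀ v q u rest → Any (Witness v) (pairs (q ++ [ u ])) → Any (Witness v) (pairs (q ++ u ∷ rest))
  witness-inˡ v q u rest w rewrite pairs-++ q u rest = Any.++⁺ˡ w

  witness-inʳ : ∀ v q u rest → Any (Witness v) (pairs (u ∷ rest)) → Any (Witness v) (pairs (q ++ u ∷ rest))
  witness-inʳ v q u rest w rewrite pairs-++ q u rest = Any.++⁺ʳ (pairs (q ++ [ u ])) w

  witness-∈ : ∀ v xs → Any (Witness v) (pairs xs) → v ∸ 1 ∈ xs
  witness-∈ v xs w with find w
  ... | p , p∈ , (p₁≡ , _) = subst (_∈ xs) p₁≡ (pairs-fst∈ xs p∈)

  witness-∈-init : ∀ v q u → Any (Witness v) (pairs (q ++ [ u ])) → v ∸ 1 ∈ q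
  witness-∈-init v q u w with find w
  ... | p , p∈ , (p₁≡ , _) = subst (_∈ q) p₁≡ (pairs-fst∈-init q u p∈)

  witness-positive : ∀ v xs → Any (Witness v) (pairs xs) → 0 < v ∸ 1
  witness-positive v xs w with find w
  ... | p , p∈ , (p₁≡ , p₂<p₁) = subst (0 <_) p₁≡ (ℕ.<-≤-trans (s≤s z≤n) p₂<p₁)

  proper : Split → ℕ
  proper s = 𝟙 (proper? s)

  plrmin≡ : ∀ π → plrmin π ≡ sumℕ (splitsAux [] π) proper
  plrmin≡ π = length-filter proper? (splitsAux [] π)

  properSucAt : ℕ → Split → ℕ
  properSucAt u s = 𝟙 (letter s ∸ 1 ≟ u) * proper s

  -- 1 if u + 1 is a proper left-to-right minimum of π, else 0
  properSuc : List ℕ → ℕ → ℕ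
  properSuc π u = sumℕ (splitsAux [] π) (properSucAt u)

  -- whether u is followed by a smaller letter (with π(n+1) = 0) and is not the maximum n
  descentAt : ℕ → ℕ → List ℕ → ℕ
  descentAt n u B = 𝟙 ((head₀ B <? u) ×-dec ¬? (u ≟ n))

  descent? : ∀ p → Dec (proj₂ p < proj₁ p)
  descent? p = proj₂ p <? proj₁ p

  succession? : ∀ p → Dec (proj₂ p ≡ suc (proj₁ p))
  succession? p = proj₂ p ≟ suc (proj₁ p)

  bigAscent? : ∀ p → Dec (suc (suc (proj₁ p)) ≤ proj₂ p)
  bigAscent? p = suc (suc (proj₁ p)) ≤? proj₂ p

  des≡ : ∀ π → des π ≡ countPairs descent? π
  des≡ π = length-filter descent? (pairs π)

  sucs≡ : ∀ π → sucs π ≡ countPairs succession? π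
  sucs≡ π = length-filter succession? (pairs π)

  basc≡ : ∀ π → basc π ≡ countPairs bigAscent? π
  basc≡ π = length-filter bigAscent? (pairs π)

  isNonEmpty : List ℕ → ℕ
  isNonEmpty []      = 0
  isNonEmpty (_ ∷ _) = 1

  ∈⇒isNonEmpty : ∀ {y : ℕ} {xs} → y ∈ xs → isNonEmpty xs ≡ 1
  ∈⇒isNonEmpty (here _)  = refl
  ∈⇒isNonEmpty (there _) = refl

  next-descent : ∀ u B → head₀ B < u →
    nextPair succession? u B ≡ 0 × nextPair bigAscent? u B ≡ 0 × nextPair descent? u B ≡ isNonEmpty B
  next-descent u []      hd<u = refl , refl , refl
  next-descent u (w ∷ B) w<u  =
    𝟙-no (λ w≡ → ℕ.<-asym w<u (ℕ.≤-reflexive (sym w≡))) (succession? _) ,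
    𝟙-no (λ 2+u≤w → ℕ.<-asym w<u (ℕ.≤-trans (ℕ.n≤1+n _) 2+u≤w)) (bigAscent? _) ,
    𝟙-yes w<u (descent? _)

  next-succession : ∀ u B → head₀ B ≡ suc u →
    nextPair succession? u B ≡ 1 × nextPair bigAscent? u B ≡ 0 × nextPair descent? u B ≡ 0 × isNonEmpty B ≡ 1
  next-succession u []      ()
  next-succession u (w ∷ B) w≡ =
    𝟙-yes w≡ (succession? _) ,
    𝟙-no (λ 2+u≤w → ℕ.<-irrefl refl (ℕ.≤-trans 2+u≤w (ℕ.≤-reflexive w≡))) (bigAscent? _) ,
    𝟙-no (λ w<u → ℕ.<-asym (subst (_< u) w≡ w<u) (ℕ.n<1+n u)) (descent? _) ,
    refl

  next-bigAscent : ∀ u B → 1 ≤ u → u ∉ B → ¬ head₀ B < u → head₀ B ≢ suc u →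
    nextPair succession? u B ≡ 0 × nextPair bigAscent? u B ≡ 1 × nextPair descent? u B ≡ 0 × isNonEmpty B ≡ 1
  next-bigAscent u []      1≤u u∉ hd≮u _   = ⊥-elim (hd≮u 1≤u)
  next-bigAscent u (w ∷ B) 1≤u u∉ w≮u w≢ =
    𝟙-no w≢ (succession? _) , 𝟙-yes 2+u≤w (bigAscent? _) , 𝟙-no w≮u (descent? _) , refl
    where
    2+u≤w : suc (suc u) ≤ w
    2+u≤w = ℕ.≤∧≢⇒< (ℕ.≤∧≢⇒< (ℕ.≮⇒≥ w≮u) (λ u≡w → u∉ (here u≡w))) (λ 1+u≡w → w≢ (sym 1+u≡w))

  next-top : ∀ n B → All (_≤ n) B →
    nextPair succession? (suc n) B ≡ 0 × nextPair bigAscent? (suc n) B ≡ 0 × nextPair descent? (suc n) B ≡ isNonEmpty B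
  next-top n []      _          = refl , refl , refl
  next-top n (w ∷ B) (w≤n ∷ _) =
    𝟙-no (λ w≡ → ℕ.<-irrefl w≡ (s≤s (ℕ.m≤n⇒m≤1+n w≤n))) (succession? (suc n , w)) ,
    𝟙-no (λ 2+n≤w → ℕ.<-irrefl refl (ℕ.≤-trans 2+n≤w (ℕ.m≤n⇒m≤1+n (ℕ.m≤n⇒m≤1+n w≤n)))) (bigAscent? (suc n , w)) ,
    𝟙-yes (s≤s w≤n) (descent? (suc n , w))

  max-descent : ∀ u B → 1 ≤ u → u ∉ B → All (_≤ u) B → head₀ B < u
  max-descent u []      1≤u _  _          = 1≤u
  max-descent u (w ∷ B) 1≤u u∉ (w≤u ∷ _) = ℕ.≤∧≢⇒< w≤u (λ w≡u → u∉ (here (sym w≡u)))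

  data Kind : Set where
    top succession bigAscent witnessDescent plainDescent : Kind

  δₖ : Kind → Kind → ℕ
  δₖ top            top            = 1
  δₖ succession     succession     = 1
  δₖ bigAscent      bigAscent      = 1
  δₖ witnessDescent witnessDescent = 1
  δₖ plainDescent   plainDescent   = 1
  δₖ _              _              = 0

  Exponents : Set
  Exponents = ℕ × ℕ × ℕ × ℕ

  exponents : List ℕ → Exponents
  exponents π = basc π , des π ∸ plrmin π , sucs π , plrmin π

  effect : Kind → Exponents → Exponents
  effect top            (a , b , c , d) = a     , b     , suc c , d
  effect succession     (a , b , c , d) = suc a , suc b , c ∸ 1 , d
  effect bigAscent      (a , b , c , d) = a     , suc b , c     , d
  effect witnessDescent (a , b , c , d) = suc a , suc b , c     , d ∸ 1
  effect plainDescent   (a , b , c , d) = suc a , b     , c     , d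

  -- the number of slots of each kind contributed by the position s of π
  weight : ℕ → List ℕ → Split → Kind → ℕ
  weight n π s top            = 𝟙 (letter s ≟ n)
  weight n π s succession     = nextPair succession? (letter s) (suffix s)
  weight n π s bigAscent      = nextPair bigAscent? (letter s) (suffix s)
  weight n π s witnessDescent = properSuc π (letter s)
  weight n π s plainDescent   = descentAt n (letter s) (suffix s) ∸ properSuc π (letter s)

  exponents≡ : ∀ {a a′ b b′ c c′ d d′} → a ≡ a′ → b ≡ b′ → c ≡ c′ → d ≡ d′ →
    _≡_ {A = Exponents} (a , b , c , d) (a′ , b′ , c′ , d′)
  exponents≡ refl refl refl refl = refl

  module Insertion (n : ℕ) (A : List ℕ) (u : ℕ) (B : List ℕ)
    (π! : Unique (A ++ u ∷ B)) (π-range : All (InRange n) (A ++ u ∷ B)) where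

    N : ℕ
    N = suc n

    σ π : List ℕ
    σ = A ++ u ∷ N ∷ B
    π = A ++ u ∷ B

    u-range : InRange n u
    u-range = All.lookup π-range (∈.∈-++⁺ʳ A (here refl))

    u∉A : u ∉ A
    u∉A = proj₁ (unique-middle A B π!)

    u∉B : u ∉ B
    u∉B = proj₂ (unique-middle A B π!)

    A-range : ∀ {x} → x ∈ A → InRange n x
    A-range x∈ = All.lookup π-range (∈.∈-++⁺ˡ x∈)

    B-range : ∀ {x} → x ∈ B → InRange n x
    B-range x∈ = All.lookup π-range (∈.∈-++⁺ʳ A (there x∈))

    B≤n : All (_≤ n) B
    B≤n = All.tabulate (λ x∈ → proj₂ (B-range x∈))

    u<N : u < N
    u<N = s≤s (proj₂ u-range)

    -- a position of A: its properness changes only if u was its witness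
    module AtPrefix (p : List ℕ) (v : ℕ) (q : List ℕ) (A≡ : A ≡ p ++ v ∷ q) where

      v-range : InRange n v
      v-range = A-range (subst (v ∈_) (sym A≡) (∈.∈-++⁺ʳ p (here refl)))

      u∉q : u ∉ q
      u∉q u∈ = u∉A (subst (u ∈_) (sym A≡) (∈.∈-++⁺ʳ p (there u∈)))

      after-σ : (q ++ u ∷ N ∷ B) ++ [ 0 ] ≡ q ++ u ∷ N ∷ head₀ B ∷ tail₀ B
      after-σ = trans (List.++-assoc q (u ∷ N ∷ B) [ 0 ]) (cong (λ z → q ++ u ∷ N ∷ z) (++[0]-head₀ B))

      after-π : (q ++ u ∷ B) ++ [ 0 ] ≡ q ++ u ∷ head₀ B ∷ tail₀ B
      after-π = trans (List.++-assoc q (u ∷ B) [ 0 ]) (cong (λ z → q ++ u ∷ z) (++[0]-head₀ B))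

      witness-before-u : Any (Witness v) (pairs (q ++ [ u ])) → v ∸ 1 ≢ u
      witness-before-u w v∸1≡u = u∉q (subst (_∈ q) v∸1≡u (witness-∈-init v q u w))

      witness-after-u : Any (Witness v) (pairs (head₀ B ∷ tail₀ B)) → v ∸ 1 ≢ u
      witness-after-u w v∸1≡u with ∈.∈-++⁻ B (subst (_ ∈_) (sym (++[0]-head₀ B)) (witness-∈ v _ w))
      ... | inj₁ ∈B         = u∉B (subst (_∈ B) v∸1≡u ∈B)
      ... | inj₂ (here v∸1≡0) = ℕ.<-irrefl (sym v∸1≡0) (witness-positive v _ w)

      -- neither (u , N) nor (N , head₀ B) can witness v
      witness-σ : Any (Witness v) (pairs (q ++ u ∷ N ∷ head₀ B ∷ tail₀ B)) →
        Any (Witness v) (pairs (q ++ [ u ])) ⊎ Any (Witness v) (pairs (head₀ B ∷ tail₀ B))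
      witness-σ w with witness-split v q u _ w
      ... | inj₁ w₁                         = inj₁ w₁
      ... | inj₂ (here (_ , N<u))           = ⊥-elim (ℕ.<-asym N<u u<N)
      ... | inj₂ (there (here (N≡v∸1 , _))) =
        ⊥-elim (ℕ.<-irrefl (sym N≡v∸1) (s≤s (ℕ.≤-trans (ℕ.m∸n≤m v 1) (proj₂ v-range))))
      ... | inj₂ (there (there w₂))         = inj₂ w₂

      witness-π : Any (Witness v) (pairs (q ++ u ∷ head₀ B ∷ tail₀ B)) →
        Any (Witness v) (pairs (q ++ [ u ])) ⊎ Witness v (u , head₀ B) ⊎ Any (Witness v) (pairs (head₀ B ∷ tail₀ B))
      witness-π w with witness-split v q u _ w
      ... | inj₁ w₁          = inj₁ w₁
      ... | inj₂ (here w₀)   = inj₂ (inj₁ w₀)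
      ... | inj₂ (there w₂)  = inj₂ (inj₂ w₂)

      Properσ Properπ : Set
      Properσ = Proper (p , v , q ++ u ∷ N ∷ B)
      Properπ = Proper (p , v , q ++ u ∷ B)

      unfold-σ : Properσ → Any (Witness v) (pairs (q ++ u ∷ N ∷ head₀ B ∷ tail₀ B))
      unfold-σ (_ , _ , w) = subst (λ z → Any (Witness v) (pairs z)) after-σ w

      unfold-π : Properπ → Any (Witness v) (pairs (q ++ u ∷ head₀ B ∷ tail₀ B))
      unfold-π (_ , _ , w) = subst (λ z → Any (Witness v) (pairs z)) after-π w

      σ⇒π : Properσ → Properπ
      σ⇒π P@(v<p , v≢1 , _) = v<p , v≢1 , subst (λ z → Any (Witness v) (pairs z)) (sym after-π) (join (witness-σ (unfold-σ P)))
        where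
        join : _ → Any (Witness v) (pairs (q ++ u ∷ head₀ B ∷ tail₀ B))
        join (inj₁ w₁) = witness-inˡ v q u _ w₁
        join (inj₂ w₂) = witness-inʳ v q u _ (there w₂)

      σ⇒≢ : Properσ → v ∸ 1 ≢ u
      σ⇒≢ P with witness-σ (unfold-σ P)
      ... | inj₁ w₁ = witness-before-u w₁
      ... | inj₂ w₂ = witness-after-u w₂

      π⇒σ : Properπ → v ∸ 1 ≢ u → Properσ
      π⇒σ P@(v<p , v≢1 , _) v∸1≢u with witness-π (unfold-π P)
      ... | inj₁ w₁               = v<p , v≢1 , subst (λ z → Any (Witness v) (pairs z)) (sym after-σ) (witness-inˡ v q u _ w₁)
      ... | inj₂ (inj₁ (u≡ , _))  = ⊥-elim (v∸1≢u (sym u≡))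
      ... | inj₂ (inj₂ w₂)        = v<p , v≢1 , subst (λ z → Any (Witness v) (pairs z)) (sym after-σ) (witness-inʳ v q u _ (there (there w₂)))

      π⇒descent : Properπ → v ∸ 1 ≡ u → head₀ B < u
      π⇒descent P v∸1≡u with witness-π (unfold-π P)
      ... | inj₁ w₁              = ⊥-elim (witness-before-u w₁ v∸1≡u)
      ... | inj₂ (inj₁ (_ , hd<u)) = hd<u
      ... | inj₂ (inj₂ w₂)       = ⊥-elim (witness-after-u w₂ v∸1≡u)

      u<n : v ∸ 1 ≡ u → u < n
      u<n v∸1≡u = ℕ.<-≤-trans (subst (_< v) v∸1≡u (pred< v (proj₁ v-range))) (proj₂ v-range)
        where
        pred< : ∀ v → 1 ≤ v → v ∸ 1 < v
        pred< (suc v) _ = ℕ.≤-refl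

      proper-insert : proper (p , v , q ++ u ∷ N ∷ B) + properSucAt u (p , v , q ++ u ∷ B) ≡ proper (p , v , q ++ u ∷ B)
      proper-insert with proper? (p , v , q ++ u ∷ B) | proper? (p , v , q ++ u ∷ N ∷ B) | v ∸ 1 ≟ u
      ... | yes Pπ | yes Pσ | yes v∸1≡u = ⊥-elim (σ⇒≢ Pσ v∸1≡u)
      ... | yes Pπ | no ¬Pσ | yes v∸1≡u = refl
      ... | yes Pπ | yes Pσ | no  v∸1≢u = refl
      ... | yes Pπ | no ¬Pσ | no  v∸1≢u = ⊥-elim (¬Pσ (π⇒σ Pπ v∸1≢u))
      ... | no ¬Pπ | yes Pσ | _         = ⊥-elim (¬Pπ (σ⇒π Pσ))
      ... | no ¬Pπ | no ¬Pσ | yes _     = refl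
      ... | no ¬Pπ | no ¬Pσ | no  _     = refl

      properSucAt≤ : properSucAt u (p , v , q ++ u ∷ B) ≤ descentAt n u B * 𝟙 (v ≟ suc u)
      properSucAt≤ with v ∸ 1 ≟ u | proper? (p , v , q ++ u ∷ B)
      ... | no  _       | _      = z≤n
      ... | yes _       | no _   = z≤n
      ... | yes v∸1≡u   | yes Pπ = ℕ.≤-reflexive (sym (cong₂ _*_
        (𝟙-yes (π⇒descent Pπ v∸1≡u , λ u≡n → ℕ.<-irrefl u≡n (u<n v∸1≡u)) ((head₀ B <? u) ×-dec ¬? (u ≟ n)))
        (𝟙-yes (v≡ v (proj₁ v-range) v∸1≡u) (v ≟ suc u))))
        where
        v≡ : ∀ v → 1 ≤ v → v ∸ 1 ≡ u → v ≡ suc u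
        v≡ (suc v) _ v≡u = cong suc v≡u

    splits-σ : splitsAux [] σ ≡ map (extend (u ∷ N ∷ B)) (splitsAux [] A) ++
      (A , u , N ∷ B) ∷ (A ++ [ u ] , N , B) ∷ splitsAux ((A ++ [ u ]) ++ [ N ]) B
    splits-σ = splitsAux-++ [] A (u ∷ N ∷ B)

    splits-π : splitsAux [] π ≡ map (extend (u ∷ B)) (splitsAux [] A) ++ (A , u , B) ∷ splitsAux (A ++ [ u ]) B
    splits-π = splitsAux-++ [] A (u ∷ B)

    prefixσ prefixπ : List Split
    prefixσ = map (extend (u ∷ N ∷ B)) (splitsAux [] A)
    prefixπ = map (extend (u ∷ B)) (splitsAux [] A)

    proper-prefix : sumℕ prefixσ proper + sumℕ prefixπ (properSucAt u) ≡ sumℕ prefixπ proper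
    proper-prefix = begin
      sumℕ prefixσ proper + sumℕ prefixπ (properSucAt u)
        ≡⟨ cong₂ _+_ (sumℕ-map proper _ (splitsAux [] A)) (sumℕ-map (properSucAt u) _ (splitsAux [] A)) ⟩
      sumℕ (splitsAux [] A) (λ s → proper (extend (u ∷ N ∷ B) s)) + sumℕ (splitsAux [] A) (λ s → properSucAt u (extend (u ∷ B) s))
        ≡⟨ sym (sumℕ-+ _ _ (splitsAux [] A)) ⟩
      sumℕ (splitsAux [] A) (λ s → proper (extend (u ∷ N ∷ B) s) + properSucAt u (extend (u ∷ B) s))
        ≡⟨ sumℕ-cong (splitsAux [] A) (λ { (p , v , q) s∈ → AtPrefix.proper-insert p v q (splits-∈ A s∈) }) ⟩
      sumℕ (splitsAux [] A) (λ s → proper (extend (u ∷ B) s))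
        ≡⟨ sym (sumℕ-map proper _ (splitsAux [] A)) ⟩
      sumℕ prefixπ proper ∎
      where open ≡.≡-Reasoning

    -- the witness pairs after u are those of B ++ [ 0 ], with (N , head₀ B) in front in σ
    proper-u : proper (A , u , N ∷ B) ≡ proper (A , u , B)
    proper-u = 𝟙-⇔ drop add (proper? (A , u , N ∷ B)) (proper? (A , u , B))
      where
      drop : Proper (A , u , N ∷ B) → Proper (A , u , B)
      drop (u<A , u≢1 , w) = u<A , u≢1 , subst (λ z → Any (Witness u) (pairs z)) (sym (++[0]-head₀ B))
        (tail-witness (subst (λ z → Any (Witness u) (pairs (N ∷ z))) (++[0]-head₀ B) w))
        where
        tail-witness : Any (Witness u) (pairs (N ∷ head₀ B ∷ tail₀ B)) → Any (Witness u) (pairs (head₀ B ∷ tail₀ B))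
        tail-witness (here (N≡ , _)) = ⊥-elim (ℕ.<-irrefl (sym N≡) (s≤s (ℕ.≤-trans (ℕ.m∸n≤m u 1) (proj₂ u-range))))
        tail-witness (there w)       = w
      add : Proper (A , u , B) → Proper (A , u , N ∷ B)
      add (u<A , u≢1 , w) = u<A , u≢1 , subst (λ z → Any (Witness u) (pairs (N ∷ z))) (sym (++[0]-head₀ B))
        (there (subst (λ z → Any (Witness u) (pairs z)) (++[0]-head₀ B) w))

    proper-N : proper (A ++ [ u ] , N , B) ≡ 0
    proper-N = 𝟙-no (λ (N<Au , _) → ℕ.<-asym (All.lookup N<Au (∈.∈-++⁺ʳ A (here refl))) u<N) (proper? _)

    proper-suffix : sumℕ (splitsAux ((A ++ [ u ]) ++ [ N ]) B) proper ≡ sumℕ (splitsAux (A ++ [ u ]) B) proper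
    proper-suffix = begin
      sumℕ (splitsAux ((A ++ [ u ]) ++ [ N ]) B) proper
        ≡⟨ trans (cong (λ ss → sumℕ ss proper) (splitsAux≡map-prepend _ B)) (sumℕ-map proper _ (splitsAux [] B)) ⟩
      sumℕ (splitsAux [] B) (λ s → proper (prepend ((A ++ [ u ]) ++ [ N ]) s))
        ≡⟨ sumℕ-cong (splitsAux [] B) (λ { (p , v , q) s∈ → 𝟙-⇔ (without-N p v) (with-N p v (splits-∈ B s∈)) (proper? _) (proper? _) }) ⟩
      sumℕ (splitsAux [] B) (λ s → proper (prepend (A ++ [ u ]) s))
        ≡⟨ sym (trans (cong (λ ss → sumℕ ss proper) (splitsAux≡map-prepend _ B)) (sumℕ-map proper _ (splitsAux [] B))) ⟩
      sumℕ (splitsAux (A ++ [ u ]) B) proper ∎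
      where
      open ≡.≡-Reasoning
      without-N : ∀ p v {q} → Proper (((A ++ [ u ]) ++ [ N ]) ++ p , v , q) → Proper ((A ++ [ u ]) ++ p , v , q)
      without-N p v (v<pre , rest) = All.++⁺ (All.++⁻ˡ (A ++ [ u ]) (All.++⁻ˡ ((A ++ [ u ]) ++ [ N ]) v<pre))
                                              (All.++⁻ʳ ((A ++ [ u ]) ++ [ N ]) v<pre) , rest
      with-N : ∀ p v {q} → B ≡ p ++ v ∷ q → Proper ((A ++ [ u ]) ++ p , v , q) → Proper (((A ++ [ u ]) ++ [ N ]) ++ p , v , q)
      with-N p v B≡ (v<pre , rest) =
        All.++⁺ (All.++⁺ (All.++⁻ˡ (A ++ [ u ]) v<pre) (v<N ∷ [])) (All.++⁻ʳ (A ++ [ u ]) v<pre) , rest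
        where
        v<N : v < N
        v<N = s≤s (proj₂ (B-range (subst (v ∈_) (sym B≡) (∈.∈-++⁺ʳ p (here refl)))))

    properSucAt-u : properSucAt u (A , u , B) ≡ 0
    properSucAt-u = cong (_* proper (A , u , B)) (𝟙-no (pred≢ (proj₁ u-range)) (u ∸ 1 ≟ u))
      where
      pred≢ : ∀ {u} → 1 ≤ u → u ∸ 1 ≢ u
      pred≢ {suc u} _ u≡ = ℕ.<-irrefl u≡ ℕ.≤-refl

    -- a letter v = u + 1 after u is not a left-to-right minimum
    properSucAt-suffix : sumℕ (splitsAux (A ++ [ u ]) B) (properSucAt u) ≡ 0
    properSucAt-suffix = trans (cong (λ ss → sumℕ ss (properSucAt u)) (splitsAux≡map-prepend _ B))
      (trans (sumℕ-map (properSucAt u) _ (splitsAux [] B)) (sumℕ-zero (splitsAux [] B) vanish))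
      where
      sumℕ-zero : ∀ ss {f : Split → ℕ} → (∀ s → f s ≡ 0) → sumℕ ss f ≡ 0
      sumℕ-zero []       f≡0 = refl
      sumℕ-zero (s ∷ ss) f≡0 = cong₂ _+_ (f≡0 s) (sumℕ-zero ss f≡0)
      vanish : ∀ s → properSucAt u (prepend (A ++ [ u ]) s) ≡ 0
      vanish (p , v , q) with v ∸ 1 ≟ u | proper? ((A ++ [ u ]) ++ p , v , q)
      ... | no  _     | _               = refl
      ... | yes _     | no  _           = refl
      ... | yes v∸1≡u | yes (v<pre , _) = ⊥-elim (ℕ.<-irrefl refl (ℕ.<-≤-trans
            (All.lookup v<pre (∈.∈-++⁺ˡ (∈.∈-++⁺ʳ A (here refl)))) (ℕ.≤-trans (ℕ.≤-reflexive (sym v∸1≡u)) (ℕ.m∸n≤m v 1))))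

    properSuc-prefix : properSuc π u ≡ sumℕ prefixπ (properSucAt u)
    properSuc-prefix = trans (cong (λ ss → sumℕ ss (properSucAt u)) splits-π)
      (trans (sumℕ-++ (properSucAt u) prefixπ _)
      (trans (cong (sumℕ prefixπ (properSucAt u) +_) (cong₂ _+_ properSucAt-u properSucAt-suffix)) (ℕ.+-identityʳ _)))

    plrmin-insert : plrmin σ + properSuc π u ≡ plrmin π
    plrmin-insert = begin
      plrmin σ + properSuc π u
        ≡⟨ cong₂ _+_ (trans (plrmin≡ σ) (trans (cong (λ ss → sumℕ ss proper) splits-σ) (sumℕ-++ proper prefixσ _)))
                     properSuc-prefix ⟩
      Σσ + (proper (A , u , N ∷ B) + (proper (A ++ [ u ] , N , B) + sumℕ (splitsAux ((A ++ [ u ]) ++ [ N ]) B) proper)) + Σδ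
        ≡⟨ cong (λ z → Σσ + z + Σδ) (cong₂ _+_ proper-u (cong₂ _+_ proper-N proper-suffix)) ⟩
      Σσ + rest + Σδ
        ≡⟨ trans (ℕ.+-assoc Σσ rest Σδ) (trans (cong (Σσ +_) (ℕ.+-comm rest Σδ)) (sym (ℕ.+-assoc Σσ Σδ rest))) ⟩
      Σσ + Σδ + rest
        ≡⟨ cong (_+ rest) proper-prefix ⟩
      sumℕ prefixπ proper + rest
        ≡⟨ sym (trans (plrmin≡ π) (trans (cong (λ ss → sumℕ ss proper) splits-π) (sumℕ-++ proper prefixπ _))) ⟩
      plrmin π ∎
      where
      open ≡.≡-Reasoning
      Σσ = sumℕ prefixσ proper
      Σδ = sumℕ prefixπ (properSucAt u)
      rest = proper (A , u , B) + sumℕ (splitsAux (A ++ [ u ]) B) proper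

    properSuc≤descentAt : properSuc π u ≤ descentAt n u B
    properSuc≤descentAt = begin
      properSuc π u
        ≡⟨ trans properSuc-prefix (sumℕ-map (properSucAt u) _ (splitsAux [] A)) ⟩
      sumℕ (splitsAux [] A) (λ s → properSucAt u (extend (u ∷ B) s))
        ≤⟨ sumℕ-mono (splitsAux [] A) (λ { (p , v , q) s∈ → AtPrefix.properSucAt≤ p v q (splits-∈ A s∈) }) ⟩
      sumℕ (splitsAux [] A) (λ s → descentAt n u B * 𝟙 (letter s ≟ suc u))
        ≡⟨ trans (sumℕ-*ˡ (descentAt n u B) _ (splitsAux [] A))
                 (cong (descentAt n u B *_) (sumℕ-splits-letter A [] (λ x → 𝟙 (x ≟ suc u)))) ⟩
      descentAt n u B * count (suc u) A
        ≤⟨ ℕ.*-monoʳ-≤ (descentAt n u B) (count-unique (suc u) A (A! A π!)) ⟩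
      descentAt n u B * 1
        ≡⟨ ℕ.*-identityʳ _ ⟩
      descentAt n u B ∎
      where
      open ℕ.≤-Reasoning
      A! : ∀ A → Unique (A ++ u ∷ B) → Unique A
      A! []      _           = []
      A! (x ∷ A) (x∉ ∷ AuB!) = All.++⁻ˡ A x∉ ∷ A! A AuB!

    -- the pair (u , head₀ B) of π becomes (u , N) , (N , head₀ B) in σ
    pairs-insert : {R : ℕ × ℕ → Set} (R? : ∀ p → Dec (R p)) →
      countPairs R? σ + nextPair R? u B ≡ countPairs R? π + (𝟙 (R? (u , N)) + nextPair R? N B)
    pairs-insert R? = begin
      countPairs R? σ + nextPair R? u B
        ≡⟨ cong (_+ nextPair R? u B) (trans (countPairs-++ R? A u (N ∷ B))
             (cong (λ z → countPairs R? (A ++ [ u ]) + (𝟙 (R? (u , N)) + z)) (countPairs-∷ R? N B))) ⟩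
      countPairs R? (A ++ [ u ]) + (𝟙 (R? (u , N)) + (nextPair R? N B + countPairs R? B)) + nextPair R? u B
        ≡⟨ rearrange (countPairs R? (A ++ [ u ])) (𝟙 (R? (u , N))) (nextPair R? N B) (countPairs R? B) (nextPair R? u B) ⟩
      countPairs R? (A ++ [ u ]) + (nextPair R? u B + countPairs R? B) + (𝟙 (R? (u , N)) + nextPair R? N B)
        ≡⟨ cong (_+ (𝟙 (R? (u , N)) + nextPair R? N B)) (sym (trans (countPairs-++ R? A u B)
             (cong (countPairs R? (A ++ [ u ]) +_) (countPairs-∷ R? u B)))) ⟩
      countPairs R? π + (𝟙 (R? (u , N)) + nextPair R? N B) ∎
      where
      open ≡.≡-Reasoning
      open +-*-Solver
      rearrange : ∀ x r m t l → x + (r + (m + t)) + l ≡ x + (l + t) + (r + m)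
      rearrange = solve 5 (λ x r m t l → x :+ (r :+ (m :+ t)) :+ l := x :+ (l :+ t) :+ (r :+ m)) refl

    des-insert : des σ + nextPair descent? u B ≡ des π + isNonEmpty B
    des-insert = trans (cong (_+ _) (des≡ σ)) (trans (pairs-insert descent?) (cong₂ _+_ (sym (des≡ π))
      (cong₂ _+_ (𝟙-no (ℕ.<-asym u<N) (descent? (u , N))) (proj₂ (proj₂ (next-top n B B≤n))))))

    sucs-insert : sucs σ + nextPair succession? u B ≡ sucs π + 𝟙 (u ≟ n)
    sucs-insert = trans (cong (_+ _) (sucs≡ σ)) (trans (pairs-insert succession?) (cong₂ _+_ (sym (sucs≡ π))
      (trans (cong₂ _+_ (𝟙-⇔ (λ N≡ → ℕ.suc-injective (sym N≡)) (λ u≡n → cong suc (sym u≡n)) (succession? (u , N)) (u ≟ n))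
                        (proj₁ (next-top n B B≤n)))
             (ℕ.+-identityʳ _))))

    basc-insert : basc σ + nextPair bigAscent? u B + 𝟙 (u ≟ n) ≡ basc π + 1
    basc-insert = trans (cong (λ z → z + nextPair bigAscent? u B + 𝟙 (u ≟ n)) (basc≡ σ))
      (trans (cong (_+ 𝟙 (u ≟ n)) (pairs-insert bigAscent?))
      (trans (ℕ.+-assoc (countPairs bigAscent? π) _ _)
      (cong₂ _+_ (sym (basc≡ π)) (trans (cong (_+ 𝟙 (u ≟ n))
        (trans (cong (𝟙 (bigAscent? (u , N)) +_) (proj₁ (proj₂ (next-top n B B≤n)))) (ℕ.+-identityʳ _))) big+top))))
      where
      big+top : 𝟙 (bigAscent? (u , N)) + 𝟙 (u ≟ n) ≡ 1
      big+top with u ≟ n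
      ... | yes u≡n = cong (_+ 1) (𝟙-no (λ 2+u≤N → ℕ.<-irrefl u≡n (ℕ.≤-pred 2+u≤N)) (bigAscent? (u , N)))
      ... | no  u≢n = cong (_+ 0) (𝟙-yes (s≤s (ℕ.≤∧≢⇒< (proj₂ u-range) u≢n)) (bigAscent? (u , N)))

    properSuc≢1⇒≡0 : properSuc π u ≢ 1 → properSuc π u ≡ 0
    properSuc≢1⇒≡0 ps≢1 with properSuc π u | ℕ.≤-trans properSuc≤descentAt (𝟙≤1 ((head₀ B <? u) ×-dec ¬? (u ≟ n)))
    ... | zero        | _      = refl
    ... | suc zero    | _      = ⊥-elim (ps≢1 refl)
    ... | suc (suc _) | s≤s ()

    properSuc≡0 : descentAt n u B ≡ 0 → properSuc π u ≡ 0
    properSuc≡0 d≡0 = ℕ.n≤0⇒n≡0 (ℕ.≤-trans properSuc≤descentAt (ℕ.≤-reflexive d≡0))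

    plrmin-same : properSuc π u ≡ 0 → plrmin σ ≡ plrmin π
    plrmin-same ps≡0 = trans (sym (ℕ.+-identityʳ _)) (trans (cong (plrmin σ +_) (sym ps≡0)) plrmin-insert)

    des-same : head₀ B < u → des σ ≡ des π
    des-same hd<u = ℕ.+-cancelʳ-≡ (isNonEmpty B) _ _
      (trans (cong (des σ +_) (sym (proj₂ (proj₂ (next-descent u B hd<u))))) des-insert)

    des-suc : nextPair descent? u B ≡ 0 → isNonEmpty B ≡ 1 → des σ ≡ suc (des π)
    des-suc d≡0 ne≡1 = trans (sym (ℕ.+-identityʳ _)) (trans (cong (des σ +_) (sym d≡0))
      (trans des-insert (trans (cong (des π +_) ne≡1) (ℕ.+-comm (des π) 1))))

    sucs-same : nextPair succession? u B ≡ 0 → u ≢ n → sucs σ ≡ sucs π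
    sucs-same s≡0 u≢n = trans (sym (ℕ.+-identityʳ _)) (trans (cong (sucs σ +_) (sym s≡0))
      (trans sucs-insert (trans (cong (sucs π +_) (𝟙-no u≢n (u ≟ n))) (ℕ.+-identityʳ _))))

    basc-suc : nextPair bigAscent? u B ≡ 0 → u ≢ n → basc σ ≡ suc (basc π)
    basc-suc b≡0 u≢n = trans (sym zeros) (trans basc-insert (ℕ.+-comm (basc π) 1))
      where
      zeros : basc σ + nextPair bigAscent? u B + 𝟙 (u ≟ n) ≡ basc σ
      zeros = trans (cong₂ (λ x y → basc σ + x + y) b≡0 (𝟙-no u≢n (u ≟ n))) (trans (ℕ.+-identityʳ _) (ℕ.+-identityʳ _))

    sucs-suc : nextPair succession? u B ≡ 0 → u ≡ n → sucs σ ≡ suc (sucs π)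
    sucs-suc s≡0 u≡n = trans (sym (ℕ.+-identityʳ _)) (trans (cong (sucs σ +_) (sym s≡0))
      (trans sucs-insert (trans (cong (sucs π +_) (𝟙-yes u≡n (u ≟ n))) (ℕ.+-comm (sucs π) 1))))

    sucs-pred : nextPair succession? u B ≡ 1 → u ≢ n → sucs σ ≡ sucs π ∸ 1
    sucs-pred s≡1 u≢n = trans (sym (ℕ.m+n∸n≡m (sucs σ) 1)) (cong (_∸ 1) (trans (cong (sucs σ +_) (sym s≡1))
      (trans sucs-insert (trans (cong (sucs π +_) (𝟙-no u≢n (u ≟ n))) (ℕ.+-identityʳ _)))))

    basc-same : nextPair bigAscent? u B + 𝟙 (u ≟ n) ≡ 1 → basc σ ≡ basc π
    basc-same b+t≡1 = ℕ.+-cancelʳ-≡ 1 _ _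
      (trans (trans (cong (basc σ +_) (sym b+t≡1)) (sym (ℕ.+-assoc (basc σ) _ _))) basc-insert)

    ≢top⇒descentAt : u ≢ n → head₀ B < u → descentAt n u B ≡ 1
    ≢top⇒descentAt u≢n hd<u = 𝟙-yes (hd<u , u≢n) ((head₀ B <? u) ×-dec ¬? (u ≟ n))

    ≮⇒descentAt : ¬ head₀ B < u → descentAt n u B ≡ 0
    ≮⇒descentAt hd≮u = 𝟙-no (λ (hd<u , _) → hd≮u hd<u) ((head₀ B <? u) ×-dec ¬? (u ≟ n))

    Classification : Set
    Classification = Σ Kind λ k → exponents σ ≡ effect k (exponents π) × ∀ k′ → weight n π (A , u , B) k′ ≡ δₖ k k′

    unit-weights : ∀ {k} → 𝟙 (u ≟ n) ≡ δₖ k top → nextPair succession? u B ≡ δₖ k succession →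
      nextPair bigAscent? u B ≡ δₖ k bigAscent → properSuc π u ≡ δₖ k witnessDescent →
      descentAt n u B ∸ properSuc π u ≡ δₖ k plainDescent → ∀ k′ → weight n π (A , u , B) k′ ≡ δₖ k k′
    unit-weights w₁ w₂ w₃ w₄ w₅ top            = w₁
    unit-weights w₁ w₂ w₃ w₄ w₅ succession     = w₂
    unit-weights w₁ w₂ w₃ w₄ w₅ bigAscent      = w₃
    unit-weights w₁ w₂ w₃ w₄ w₅ witnessDescent = w₄
    unit-weights w₁ w₂ w₃ w₄ w₅ plainDescent   = w₅

    module _ (plrmin≤des : plrmin π ≤ des π) where

      y-suc : des σ ≡ suc (des π) → properSuc π u ≡ 0 → des σ ∸ plrmin σ ≡ suc (des π ∸ plrmin π)
      y-suc des≡ ps≡0 = trans (cong₂ _∸_ des≡ (plrmin-same ps≡0)) (ℕ.+-∸-assoc 1 plrmin≤des)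

      classify-top : u ≡ n → Classification
      classify-top u≡n = top ,
        exponents≡ (basc-same (cong₂ _+_ (proj₁ (proj₂ next)) (𝟙-yes u≡n (u ≟ n))))
                   (cong₂ _∸_ (des-same hd<u) (plrmin-same ps≡0)) (sucs-suc (proj₁ next) u≡n) (plrmin-same ps≡0) ,
        unit-weights (𝟙-yes u≡n (u ≟ n)) (proj₁ next) (proj₁ (proj₂ next)) ps≡0 (cong₂ _∸_ d≡0 ps≡0)
        where
        hd<u : head₀ B < u
        hd<u = max-descent u B (proj₁ u-range) u∉B (subst (λ m → All (_≤ m) B) (sym u≡n) B≤n)
        next = next-descent u B hd<u
        d≡0 : descentAt n u B ≡ 0
        d≡0 = 𝟙-no (λ (_ , u≢n) → u≢n u≡n) ((head₀ B <? u) ×-dec ¬? (u ≟ n))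
        ps≡0 = properSuc≡0 d≡0

      -- u is the witness of the proper left-to-right minimum u + 1, which the insertion destroys
      classify-witnessDescent : u ≢ n → head₀ B < u → properSuc π u ≡ 1 → Classification
      classify-witnessDescent u≢n hd<u ps≡1 = witnessDescent ,
        exponents≡ (basc-suc (proj₁ (proj₂ next)) u≢n) y≡ (sucs-same (proj₁ next) u≢n) (cong (_∸ 1) 1+plrmin) ,
        unit-weights (𝟙-no u≢n (u ≟ n)) (proj₁ next) (proj₁ (proj₂ next)) ps≡1
                     (cong₂ _∸_ (≢top⇒descentAt u≢n hd<u) ps≡1)
        where
        next = next-descent u B hd<u
        1+plrmin : suc (plrmin σ) ≡ plrmin π
        1+plrmin = trans (ℕ.+-comm 1 (plrmin σ)) (trans (cong (plrmin σ +_) (sym ps≡1)) plrmin-insert)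
        y≡ : des σ ∸ plrmin σ ≡ suc (des π ∸ plrmin π)
        y≡ = trans (cong (_∸ plrmin σ) (des-same hd<u))
          (trans (ℕ.+-∸-assoc 1 (ℕ.≤-trans (ℕ.≤-reflexive 1+plrmin) plrmin≤des))
                 (cong (λ m → suc (des π ∸ m)) 1+plrmin))

      classify-plainDescent : u ≢ n → head₀ B < u → properSuc π u ≡ 0 → Classification
      classify-plainDescent u≢n hd<u ps≡0 = plainDescent ,
        exponents≡ (basc-suc (proj₁ (proj₂ next)) u≢n) (cong₂ _∸_ (des-same hd<u) (plrmin-same ps≡0))
                   (sucs-same (proj₁ next) u≢n) (plrmin-same ps≡0) ,
        unit-weights (𝟙-no u≢n (u ≟ n)) (proj₁ next) (proj₁ (proj₂ next)) ps≡0
                     (cong₂ _∸_ (≢top⇒descentAt u≢n hd<u) ps≡0)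
        where next = next-descent u B hd<u

      classify-succession : u ≢ n → head₀ B ≡ suc u → Classification
      classify-succession u≢n hd≡ = succession ,
        exponents≡ (basc-suc (proj₁ (proj₂ next)) u≢n)
                   (y-suc (des-suc (proj₁ (proj₂ (proj₂ next))) (proj₂ (proj₂ (proj₂ next)))) ps≡0)
                   (sucs-pred (proj₁ next) u≢n) (plrmin-same ps≡0) ,
        unit-weights (𝟙-no u≢n (u ≟ n)) (proj₁ next) (proj₁ (proj₂ next)) ps≡0 (cong₂ _∸_ d≡0 ps≡0)
        where
        next = next-succession u B hd≡
        d≡0 = ≮⇒descentAt (λ hd<u → ℕ.<-asym (subst (_< u) hd≡ hd<u) (ℕ.n<1+n u))
        ps≡0 = properSuc≡0 d≡0

      classify-bigAscent : u ≢ n → ¬ head₀ B < u → head₀ B ≢ suc u → Classification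
      classify-bigAscent u≢n hd≮u hd≢ = bigAscent ,
        exponents≡ (basc-same (cong₂ _+_ (proj₁ (proj₂ next)) (𝟙-no u≢n (u ≟ n))))
                   (y-suc (des-suc (proj₁ (proj₂ (proj₂ next))) (proj₂ (proj₂ (proj₂ next)))) ps≡0)
                   (sucs-same (proj₁ next) u≢n) (plrmin-same ps≡0) ,
        unit-weights (𝟙-no u≢n (u ≟ n)) (proj₁ next) (proj₁ (proj₂ next)) ps≡0 (cong₂ _∸_ (≮⇒descentAt hd≮u) ps≡0)
        where
        next = next-bigAscent u B (proj₁ u-range) u∉B hd≮u hd≢
        ps≡0 = properSuc≡0 (≮⇒descentAt hd≮u)

      classify : Classification
      classify with u ≟ n | head₀ B <? u | head₀ B ≟ suc u
      ... | yes u≡n | _        | _        = classify-top u≡n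
      ... | no  u≢n | yes hd<u | _        with properSuc π u ≟ 1
      ...   | yes ps≡1 = classify-witnessDescent u≢n hd<u ps≡1
      ...   | no  ps≢1 = classify-plainDescent u≢n hd<u (properSuc≢1⇒≡0 ps≢1)
      classify | no u≢n | no hd≮u | yes hd≡ = classify-succession u≢n hd≡
      classify | no u≢n | no hd≮u | no hd≢  = classify-bigAscent u≢n hd≮u hd≢

    descentAt+top : descentAt n u B + 𝟙 (u ≟ n) ≡ 𝟙 (head₀ B <? u)
    descentAt+top with u ≟ n | head₀ B <? u
    ... | yes u≡n | yes _    = refl
    ... | yes u≡n | no  hd≮u = ⊥-elim (hd≮u (max-descent u B (proj₁ u-range) u∉B (subst (λ m → All (_≤ m) B) (sym u≡n) B≤n)))
    ... | no  _   | yes _    = refl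
    ... | no  _   | no  _    = refl

  record PositionFacts (n : ℕ) (π : List ℕ) (s : Split) : Set where
    field
      letter-positive : 1 ≤ letter s
      properSuc≤      : properSuc π (letter s) ≤ descentAt n (letter s) (suffix s)
      descentAt+top′  : descentAt n (letter s) (suffix s) + 𝟙 (letter s ≟ n) ≡ 𝟙 (head₀ (suffix s) <? letter s)
      classification  : plrmin π ≤ des π → Σ Kind λ k →
        exponents (insertAfter (suc n) s) ≡ effect k (exponents π) × ∀ k′ → weight n π s k′ ≡ δₖ k k′

  positionFacts : ∀ n π → Unique π → All (InRange n) π → ∀ s → s ∈ splitsAux [] π → PositionFacts n π s
  positionFacts n π π! π-range (A , u , B) s∈ = subst (λ p → PositionFacts n p (A , u , B)) (sym π≡) facts
    where
    π≡ : π ≡ A ++ u ∷ B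
    π≡ = splits-∈ π s∈
    open Insertion n A u B (subst Unique π≡ π!) (subst (All (InRange n)) π≡ π-range)
    facts : PositionFacts n (A ++ u ∷ B) (A , u , B)
    facts = record
      { letter-positive = proj₁ u-range
      ; properSuc≤      = properSuc≤descentAt
      ; descentAt+top′  = descentAt+top
      ; classification  = classify
      }

  module Counting (n : ℕ) (π : List ℕ) (π! : Unique π) (π-range : All (InRange n) π) (n∈π : n ∈ π) where

    positions : List Split
    positions = splitsAux [] π

    module Facts {s} (s∈ : s ∈ positions) = PositionFacts (positionFacts n π π! π-range s s∈)
    open Facts public

    total : Kind → ℕ
    total k = sumℕ positions (λ s → weight n π s k)

    total-top : total top ≡ 1
    total-top = trans (sumℕ-splits-letter π [] (λ x → 𝟙 (x ≟ n))) (count-∈ n π π! n∈π)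

    total-succession : total succession ≡ sucs π
    total-succession = trans (sym (countPairs-splits succession? π [])) (sym (sucs≡ π))

    total-bigAscent : total bigAscent ≡ basc π
    total-bigAscent = trans (sym (countPairs-splits bigAscent? π [])) (sym (basc≡ π))

    -- each proper left-to-right minimum v is counted once, at the position of v - 1
    total-witnessDescent : total witnessDescent ≡ plrmin π
    total-witnessDescent = begin
      sumℕ positions (λ t → sumℕ positions (λ s → 𝟙 (letter s ∸ 1 ≟ letter t) * proper s))
        ≡⟨ sumℕ-comm (λ t s → 𝟙 (letter s ∸ 1 ≟ letter t) * proper s) positions positions ⟩
      sumℕ positions (λ s → sumℕ positions (λ t → 𝟙 (letter s ∸ 1 ≟ letter t) * proper s))
        ≡⟨ sumℕ-cong positions (λ s s∈ → trans (sumℕ-*ʳ _ (proper s) positions)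
             (trans (cong (_* proper s) (trans (sumℕ-splits-letter π [] (λ x → 𝟙 (letter s ∸ 1 ≟ x)))
                                               (sumℕ-cong π (λ x _ → 𝟙-⇔ sym sym _ _))))
                    (counted-once s s∈))) ⟩
      sumℕ positions proper
        ≡⟨ sym (plrmin≡ π) ⟩
      plrmin π ∎
      where
      open ≡.≡-Reasoning
      counted-once : ∀ s → s ∈ positions → count (letter s ∸ 1) π * proper s ≡ proper s
      counted-once (p , v , q) s∈ with proper? (p , v , q)
      ... | no  _             = ℕ.*-zeroʳ (count (v ∸ 1) π)
      ... | yes (_ , _ , w)   = cong (_* 1) (count-∈ (v ∸ 1) π π! v∸1∈π)
        where
        v∸1∈q : v ∸ 1 ∈ q
        v∸1∈q with ∈.∈-++⁻ q (witness-∈ v (q ++ [ 0 ]) w)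
        ... | inj₁ ∈q          = ∈q
        ... | inj₂ (here v∸1≡0) = ⊥-elim (ℕ.<-irrefl (sym v∸1≡0) (witness-positive v _ w))
        v∸1∈π : v ∸ 1 ∈ π
        v∸1∈π = subst (v ∸ 1 ∈_) (sym (splits-∈ π s∈)) (∈.∈-++⁺ʳ p (there v∸1∈q))

    descentOrLast-count : sumℕ positions (λ s → 𝟙 (head₀ (suffix s) <? letter s)) ≡ des π + 1
    descentOrLast-count = trans (sumℕ-cong positions (λ s s∈ → split (letter s) (suffix s) (letter-positive s∈)))
      (trans (sumℕ-+ _ _ positions) (cong₂ _+_ (trans (sym (countPairs-splits descent? π [])) (sym (des≡ π))) last))
      where
      split : ∀ u B → 1 ≤ u → 𝟙 (head₀ B <? u) ≡ nextPair descent? u B + isEmpty B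
      split u []      1≤u = 𝟙-yes 1≤u (0 <? u)
      split u (w ∷ B) _   = sym (ℕ.+-identityʳ _)
      last : sumℕ positions (λ s → isEmpty (suffix s)) ≡ 1
      last = sumℕ-splits-isEmpty π [] n∈π

    descentAt-count : sumℕ positions (λ s → descentAt n (letter s) (suffix s)) ≡ des π
    descentAt-count = ℕ.+-cancelʳ-≡ 1 _ _
      (trans (cong (sumℕ positions (λ s → descentAt n (letter s) (suffix s)) +_) (sym total-top))
      (trans (sym (sumℕ-+ _ _ positions)) (trans (sumℕ-cong positions (λ s s∈ → descentAt+top′ s∈)) descentOrLast-count)))

    plrmin≤des : plrmin π ≤ des π
    plrmin≤des = ℕ.≤-trans (ℕ.≤-reflexive (sym total-witnessDescent))
      (ℕ.≤-trans (sumℕ-mono positions (λ s s∈ → properSuc≤ s∈)) (ℕ.≤-reflexive descentAt-count))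

    total-plainDescent : total plainDescent ≡ des π ∸ plrmin π
    total-plainDescent = trans (sym (ℕ.m+n∸n≡m (total plainDescent) (plrmin π))) (cong (_∸ plrmin π)
      (trans (cong (total plainDescent +_) (sym total-witnessDescent))
      (trans (sym (sumℕ-+ _ _ positions))
      (trans (sumℕ-cong positions (λ s s∈ → ℕ.m∸n+n≡m (properSuc≤ s∈))) descentAt-count))))


    -- inserting N = n + 1 in front adds the descent (N , π(1)) and the proper minimum N
    module _ (1≤n : 1 ≤ n) where

      N : ℕ
      N = suc n

      front : ∀ {R : ℕ × ℕ → Set} (R? : ∀ p → Dec (R p)) → countPairs R? (N ∷ π) ≡ nextPair R? N π + countPairs R? π
      front R? = countPairs-∷ R? N π

      N-next : nextPair succession? N π ≡ 0 × nextPair bigAscent? N π ≡ 0 × nextPair descent? N π ≡ isNonEmpty π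
      N-next = next-top n π (All.map proj₂ π-range)

      proper-front : Proper ([] , N , π)
      proper-front with ∈.∈-∃++ n∈π
      ... | A , B , π≡ = [] , N≢1 , subst (λ p → Any (Witness N) (pairs (p ++ [ 0 ]))) (sym π≡) witness
        where
        N≢1 : N ≢ 1
        N≢1 N≡1 = ℕ.<-irrefl (sym (ℕ.suc-injective N≡1)) 1≤n
        AnB! : Unique (A ++ n ∷ B)
        AnB! = subst Unique π≡ π!
        B≤n : All (_≤ n) B
        B≤n = All.map proj₂ (All.tail (All.++⁻ʳ A (subst (All (InRange n)) π≡ π-range)))
        witness : Any (Witness N) (pairs ((A ++ n ∷ B) ++ [ 0 ]))
        witness = subst (λ z → Any (Witness N) (pairs z))
          (sym (trans (List.++-assoc A (n ∷ B) [ 0 ]) (cong (λ z → A ++ n ∷ z) (++[0]-head₀ B))))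
          (witness-inʳ N A n _ (here (refl , max-descent n B 1≤n (proj₂ (unique-middle A B AnB!)) B≤n)))

      plrmin-front : plrmin (N ∷ π) ≡ suc (plrmin π)
      plrmin-front = trans (plrmin≡ (N ∷ π)) (trans (cong₂ _+_ (𝟙-yes proper-front (proper? _)) rest)
                           (cong suc (sym (plrmin≡ π))))
        where
        rest : sumℕ (splitsAux [ N ] π) proper ≡ sumℕ positions proper
        rest = trans (cong (λ ss → sumℕ ss proper) (splitsAux≡map-prepend [ N ] π))
          (trans (sumℕ-map proper _ positions) (sumℕ-cong positions (λ { (p , v , q) s∈ →
            𝟙-⇔ (λ { ((_ ∷ v<p) , rest) → v<p , rest })
                (λ { (v<p , rest) → (s≤s (proj₂ (All.lookup π-range (subst (v ∈_) (sym (splits-∈ π s∈)) (∈.∈-++⁺ʳ p (here refl))))) ∷ v<p) , rest })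
                (proper? _) (proper? _) })))

      exponents-front : exponents (N ∷ π) ≡ (basc π , des π ∸ plrmin π , sucs π , suc (plrmin π))
      exponents-front = exponents≡ basc≡′ (cong₂ _∸_ des≡′ plrmin-front) sucs≡′ plrmin-front
        where
        des≡′ : des (N ∷ π) ≡ suc (des π)
        des≡′ = trans (des≡ (N ∷ π)) (trans (front descent?)
          (cong₂ _+_ (trans (proj₂ (proj₂ N-next)) (∈⇒isNonEmpty n∈π)) (sym (des≡ π))))
        sucs≡′ : sucs (N ∷ π) ≡ sucs π
        sucs≡′ = trans (sucs≡ (N ∷ π)) (trans (front succession?) (cong₂ _+_ (proj₁ N-next) (sym (sucs≡ π))))
        basc≡′ : basc (N ∷ π) ≡ basc π
        basc≡′ = trans (basc≡ (N ∷ π)) (trans (front bigAscent?) (cong₂ _+_ (proj₁ (proj₂ N-next)) (sym (basc≡ π))))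

module Recurrence where

  open import Data.Nat using (ℕ; suc; _≤_; _∸_)
  open import Data.Integer as ℤ using (+_)
  import Data.Integer.Properties as ℤ
  open import Data.List using (List; []; _∷_; map)
  open import Data.List.Membership.Propositional using (_∈_)
  open import Data.Product using (_,_; proj₁; proj₂)
  open import Relation.Binary.PropositionalEquality as ≡ using (_≡_)
  open import Defs using (Poly; A; mono; perms; basc; des; sucs; plrmin; _⊛_; ∂x; ∂y; ∂s; ∂t; X; Y; S; T)
    renaming (_⊕_ to _⊕ₚ_)
  open ℤAlgebras
  open Words
  open Permutations
  open InsertingTheMaximum
  open FourVariableSeries
  import Relation.Binary.Reasoning.Setoid as ≈-Reasoning

  module KindSums (R : ℤAlgebra) where
    open ℤAlgebra R
    open import Algebra.Solver.CommutativeMonoid +-commutativeMonoid using (solve; _⊕_; _⊜_; id)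

    Σₖ : (Kind → Carrier) → Carrier
    Σₖ F = F top + F succession + F bigAscent + F witnessDescent + F plainDescent

    Σₖ-cong : ∀ {F G} → (∀ k → F k ≈ G k) → Σₖ F ≈ Σₖ G
    Σₖ-cong F≈G = +-cong (+-cong (+-cong (+-cong (F≈G top) (F≈G succession)) (F≈G bigAscent)) (F≈G witnessDescent))
                         (F≈G plainDescent)

    Σₖ-+ : ∀ F G → Σₖ (λ k → F k + G k) ≈ Σₖ F + Σₖ G
    Σₖ-+ F G = solve 10 (λ a b c d e a′ b′ c′ d′ e′ →
        ((((a ⊕ a′) ⊕ (b ⊕ b′)) ⊕ (c ⊕ c′)) ⊕ (d ⊕ d′)) ⊕ (e ⊕ e′) ⊜
        ((((a ⊕ b) ⊕ c) ⊕ d) ⊕ e) ⊕ ((((a′ ⊕ b′) ⊕ c′) ⊕ d′) ⊕ e′))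
      refl (F top) (F succession) (F bigAscent) (F witnessDescent) (F plainDescent)
           (G top) (G succession) (G bigAscent) (G witnessDescent) (G plainDescent)

    Σₖ-δₖ : ∀ k (F : Kind → Carrier) → Σₖ (λ k′ → (+ δₖ k k′) · F k′) ≈ F k
    Σₖ-δₖ top F = trans (+-cong (+-cong (+-cong (+-cong (·-identity _) (·-zero _)) (·-zero _)) (·-zero _)) (·-zero _))
      (solve 1 (λ x → ((((x ⊕ id) ⊕ id) ⊕ id) ⊕ id) ⊜ x) refl (F top))
    Σₖ-δₖ succession F = trans (+-cong (+-cong (+-cong (+-cong (·-zero _) (·-identity _)) (·-zero _)) (·-zero _)) (·-zero _))
      (solve 1 (λ x → ((((id ⊕ x) ⊕ id) ⊕ id) ⊕ id) ⊜ x) refl (F succession))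
    Σₖ-δₖ bigAscent F = trans (+-cong (+-cong (+-cong (+-cong (·-zero _) (·-zero _)) (·-identity _)) (·-zero _)) (·-zero _))
      (solve 1 (λ x → ((((id ⊕ id) ⊕ x) ⊕ id) ⊕ id) ⊜ x) refl (F bigAscent))
    Σₖ-δₖ witnessDescent F = trans (+-cong (+-cong (+-cong (+-cong (·-zero _) (·-zero _)) (·-zero _)) (·-identity _)) (·-zero _))
      (solve 1 (λ x → ((((id ⊕ id) ⊕ id) ⊕ x) ⊕ id) ⊜ x) refl (F witnessDescent))
    Σₖ-δₖ plainDescent F = trans (+-cong (+-cong (+-cong (+-cong (·-zero _) (·-zero _)) (·-zero _)) (·-zero _)) (·-identity _))
      (solve 1 (λ x → ((((id ⊕ id) ⊕ id) ⊕ id) ⊕ x) ⊜ x) refl (F plainDescent))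

    -- the slot counts 1, c, a, d, b, reordered as in step-monomial⁴
    Σₖ-reorder : ∀ t (M : Kind → Carrier) a b c d →
      t + ((+ 1) · M top + (+ c) · M succession + (+ a) · M bigAscent + (+ d) · M witnessDescent + (+ b) · M plainDescent) ≈
      (M top + t) + ((+ a) · M bigAscent + (+ b) · M plainDescent + (+ c) · M succession + (+ d) · M witnessDescent)
    Σₖ-reorder t M a b c d = trans (+-congˡ (+-congʳ (+-congʳ (+-congʳ (+-congʳ (·-identity (M top)))))))
      (solve 6 (λ mₜ mₛ m₁ m₂ m₃ m₄ → mₜ ⊕ ((((mₛ ⊕ m₃) ⊕ m₁) ⊕ m₄) ⊕ m₂) ⊜ (mₛ ⊕ mₜ) ⊕ (((m₁ ⊕ m₂) ⊕ m₃) ⊕ m₄)) refl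
        t (M top) ((+ a) · M bigAscent) ((+ b) · M plainDescent) ((+ c) · M succession) ((+ d) · M witnessDescent))

    sumList-Σₖ : {X : Set} (w : X → Kind → ℕ) (M : Kind → Carrier) → ∀ xs →
      sumList xs (λ x → Σₖ (λ k → (+ w x k) · M k)) ≈ Σₖ (λ k → (+ sumℕ xs (λ x → w x k)) · M k)
    sumList-Σₖ w M []       = sym (trans (Σₖ-cong (λ k → ·-zero (M k))) (solve 0 (((((id ⊕ id) ⊕ id) ⊕ id) ⊕ id) ⊜ id) refl))
    sumList-Σₖ w M (x ∷ xs) = trans (+-congˡ (sumList-Σₖ w M xs))
      (trans (sym (Σₖ-+ (λ k → (+ w x k) · M k) (λ k → (+ sumℕ xs (λ x → w x k)) · M k)))
      (Σₖ-cong (λ k → trans (sym (·-distribʳ (+ w x k) (+ sumℕ xs (λ x → w x k)) (M k)))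
                            (reflexive (≡.cong (_· M k) (≡.sym (ℤ.pos-+ (w x k) (sumℕ xs (λ x → w x k)))))))))

  open ℤ⟦x,y,s,t⟧ using (_≈_; _+_; _·_; refl; sym; trans; reflexive; +-cong; +-congˡ; +-congʳ; ·-identity; setoid;
    sumList; sumList-cong; sumList-map; sumList-↭; sumList-concatMap)
  open KindSums ℤ⟦x,y,s,t⟧

  term : List ℕ → Poly
  term π = mono (basc π) (des π ∸ plrmin π) (sucs π) (plrmin π)

  monomialOf : Exponents → Poly
  monomialOf (a , b , c , d) = monomial⁴ a b c d

  term≈ : ∀ π → term π ≈ monomialOf (exponents π)
  term≈ π = mono≈monomial⁴ (basc π) (des π ∸ plrmin π) (sucs π) (plrmin π)

  insertions-step : ∀ n π → 1 ≤ n → π ∈ perms n → sumList (insertions (suc n) π) term ≈ step (term π)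
  insertions-step (suc n′) π 1≤n π∈ = begin
    sumList (insertions N π) term
      ≡⟨ ≡.cong (λ σs → sumList σs term) (insertions≡ N π) ⟩
    term (N ∷ π) + sumList (map (insertAfter N) positions) term
      ≈⟨ +-cong (trans (term≈ (N ∷ π)) (reflexive (≡.cong monomialOf (exponents-front 1≤n))))
                (trans (sumList-map term (insertAfter N) positions) (sumList-cong positions per-position)) ⟩
    monomial⁴ a b c (suc d) + sumList positions (λ s → Σₖ (λ k → (+ weight n π s k) · M k))
      ≈⟨ +-congˡ {monomial⁴ a b c (suc d)}
           (trans (sumList-Σₖ (weight n π) M positions) (Σₖ-cong (λ k → reflexive (≡.cong (λ m → (+ m) · M k) (totals k))))) ⟩
    monomial⁴ a b c (suc d) + ((+ 1) · M top + (+ c) · M succession + (+ a) · M bigAscent +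
                               (+ d) · M witnessDescent + (+ b) · M plainDescent)
      ≈⟨ Σₖ-reorder (monomial⁴ a b c (suc d)) M a b c d ⟩
    (M top + monomial⁴ a b c (suc d)) + ((+ a) · M bigAscent + (+ b) · M plainDescent + (+ c) · M succession + (+ d) · M witnessDescent)
      ≈⟨ sym (step-monomial⁴ a b c d) ⟩
    step (monomial⁴ a b c d)
      ≈⟨ step-cong (sym (term≈ π)) ⟩
    step (term π) ∎
    where
    open ≈-Reasoning setoid
    n = suc n′
    N = suc n
    π-facts = ∈-perms⁻ n π π∈
    open Counting n π (proj₁ π-facts) (proj₂ (proj₂ π-facts)) (suc∈ n′ π (proj₁ π-facts) (proj₁ (proj₂ π-facts)) (proj₂ (proj₂ π-facts))) hiding (N)
    a = basc π
    b = des π ∸ plrmin π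
    c = sucs π
    d = plrmin π
    M : Kind → Poly
    M k = monomialOf (effect k (exponents π))
    per-position : ∀ s → s ∈ positions → term (insertAfter N s) ≈ Σₖ (λ k → (+ weight n π s k) · M k)
    per-position s s∈ = trans (term≈ (insertAfter N s)) (trans (reflexive (≡.cong monomialOf σ-exponents))
      (trans (sym (Σₖ-δₖ k M)) (Σₖ-cong (λ k′ → reflexive (≡.cong (λ m → (+ m) · M k′) (≡.sym (weights k′)))))))
      where
      k = proj₁ (classification s∈ plrmin≤des)
      σ-exponents = proj₁ (proj₂ (classification s∈ plrmin≤des))
      weights = proj₂ (proj₂ (classification s∈ plrmin≤des))
    expected : Kind → ℕ
    expected top            = 1
    expected succession     = c
    expected bigAscent      = a
    expected witnessDescent = d
    expected plainDescent   = b
    totals : ∀ k → total k ≡ expected k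
    totals top            = total-top
    totals succession     = total-succession
    totals bigAscent      = total-bigAscent
    totals witnessDescent = total-witnessDescent
    totals plainDescent   = total-plainDescent

  A-suc≈step : ∀ n → 1 ≤ n → A (suc n) ≈ step (A n)
  A-suc≈step n 1≤n = begin
    sumList (perms (suc n)) term
      ≈⟨ sumList-↭ term (perms-suc↭ n) ⟩
    sumList (concatMap (insertions (suc n)) (perms n)) term
      ≈⟨ sumList-concatMap term (insertions (suc n)) (perms n) ⟩
    sumList (perms n) (λ π → sumList (insertions (suc n) π) term)
      ≈⟨ sumList-cong (perms n) (λ π π∈ → insertions-step n π 1≤n π∈) ⟩
    sumList (perms n) (λ π → step (term π))
      ≈⟨ sym (step-sumList term (perms n)) ⟩
    step (sumList (perms n) term) ∎
    where
    open ≈-Reasoning setoid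
    open import Data.List using (concatMap)

  A-recurrence : ∀ n → 1 ≤ n → A (suc n) ≈ (S ⊕ₚ T) ⊛ A n ⊕ₚ (X ⊛ Y) ⊛ (∂x (A n) ⊕ₚ ∂y (A n) ⊕ₚ ∂s (A n) ⊕ₚ ∂t (A n))
  A-recurrence n 1≤n = begin
    A (suc n)  ≈⟨ A-suc≈step n 1≤n ⟩
    step (A n) ≈⟨ step≈ (A n) ⟩
    (S ⊕ₚ T) ⊛ A n ⊕ₚ (X ⊛ Y) ⊛ (∂x (A n) ⊕ₚ ∂y (A n) ⊕ₚ ∂s (A n) ⊕ₚ ∂t (A n)) ∎
    where open ≈-Reasoning setoid

module ExpansionOfA where

  open import Data.Nat as ℕ using (ℕ; zero; suc; _∸_; _/_; s≤s; z≤n)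
  open import Data.Integer using (+_)
  open import Defs using (A; γ; _⊛_; mono; cst; _^ₚ_; ΣP; X; Y; S; T) renaming (_⊕_ to _⊕ₚ_)
  open ℤAlgebras
  open FourVariableSeries
  open GammaExpansion
  open Recurrence using (A-suc≈step)
  import Relation.Binary.Reasoning.Setoid as ≈-Reasoning

  module UnitWeights (R : ℤAlgebra) where
    open ℤAlgebra R

    +-·-zeroʳ : ∀ x y → x + (+ 0) · y ≈ x
    +-·-zeroʳ x y = trans (+-congˡ (·-zero y)) (+-identityʳ x)

    +-·-zeroˡ : ∀ x y → (+ 0) · y + x ≈ x
    +-·-zeroˡ x y = trans (+-congʳ (·-zero y)) (+-identityˡ x)

    unit₁ : ∀ x y z w → (+ 1) · x + (+ 0) · y + (+ 0) · z + (+ 0) · w ≈ x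
    unit₁ x y z w = trans (+-·-zeroʳ _ w) (trans (+-·-zeroʳ _ z) (trans (+-·-zeroʳ _ y) (·-identity x)))

    unit₂ : ∀ x y z w → (+ 0) · x + (+ 1) · y + (+ 0) · z + (+ 0) · w ≈ y
    unit₂ x y z w = trans (+-·-zeroʳ _ w) (trans (+-·-zeroʳ _ z) (trans (+-·-zeroˡ _ x) (·-identity y)))

    unit₃ : ∀ x y z w → (+ 0) · x + (+ 0) · y + (+ 1) · z + (+ 0) · w ≈ z
    unit₃ x y z w = trans (+-·-zeroʳ _ w) (trans (+-congʳ (+-·-zeroʳ _ y)) (trans (+-·-zeroˡ _ x) (·-identity z)))

    unit₄ : ∀ x y z w → (+ 0) · x + (+ 0) · y + (+ 0) · z + (+ 1) · w ≈ w
    unit₄ x y z w = trans (+-congʳ (trans (+-·-zeroʳ _ z) (+-·-zeroʳ _ y))) (trans (+-·-zeroˡ _ x) (·-identity w))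

  open ℤ⟦x,y,s,t⟧ using (_≈_; _+_; _*_; _·_; 1#; _^_; sym; trans; +-cong; +-comm; *-cong; *-congʳ; *-congˡ;
    +-identityʳ; *-identityˡ; *-identityʳ; x+x≈2·x; setoid; sumTo; sumTo-cong; ·-*-assoc; ·-congˡ; ^-cong; *-sumTo-·)
  open Derivation ∇ using (δ; δ-cong; δ-+; δ-*)

  ∇-monomial⁴ : ∀ a b c d → δ (monomial⁴ a b c d) ≈
    (+ a) · monomial⁴ (a ∸ 1) b c d + (+ b) · monomial⁴ a (b ∸ 1) c d +
    (+ c) · monomial⁴ a b (c ∸ 1) d + (+ d) · monomial⁴ a b c (d ∸ 1)
  ∇-monomial⁴ a b c d =
    +-cong (+-cong (+-cong (∂ₓ-monomial⁴ a b c d) (∂ᵧ-monomial⁴ a b c d)) (∂ₛ-monomial⁴ a b c d)) (∂ₜ-monomial⁴ a b c d)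

  open UnitWeights ℤ⟦x,y,s,t⟧

  ∇-x : δ X ≈ 1#
  ∇-x = begin
    δ X                       ≈⟨ δ-cong {X} {monomial⁴ 1 0 0 0} (mono≈monomial⁴ 1 0 0 0) ⟩
    δ (monomial⁴ 1 0 0 0)     ≈⟨ ∇-monomial⁴ 1 0 0 0 ⟩
    (+ 1) · monomial⁴ 0 0 0 0 + (+ 0) · monomial⁴ 1 0 0 0 + (+ 0) · monomial⁴ 1 0 0 0 + (+ 0) · monomial⁴ 1 0 0 0
                              ≈⟨ unit₁ (monomial⁴ 0 0 0 0) (monomial⁴ 1 0 0 0) (monomial⁴ 1 0 0 0) (monomial⁴ 1 0 0 0) ⟩
    1#                        ∎
    where open ≈-Reasoning setoid

  ∇-y : δ Y ≈ 1#
  ∇-y = begin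
    δ Y                       ≈⟨ δ-cong {Y} {monomial⁴ 0 1 0 0} (mono≈monomial⁴ 0 1 0 0) ⟩
    δ (monomial⁴ 0 1 0 0)     ≈⟨ ∇-monomial⁴ 0 1 0 0 ⟩
    (+ 0) · monomial⁴ 0 1 0 0 + (+ 1) · monomial⁴ 0 0 0 0 + (+ 0) · monomial⁴ 0 1 0 0 + (+ 0) · monomial⁴ 0 1 0 0
                              ≈⟨ unit₂ (monomial⁴ 0 1 0 0) (monomial⁴ 0 0 0 0) (monomial⁴ 0 1 0 0) (monomial⁴ 0 1 0 0) ⟩
    1#                        ∎
    where open ≈-Reasoning setoid

  ∇-s : δ S ≈ 1#
  ∇-s = begin
    δ S                       ≈⟨ δ-cong {S} {monomial⁴ 0 0 1 0} (mono≈monomial⁴ 0 0 1 0) ⟩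
    δ (monomial⁴ 0 0 1 0)     ≈⟨ ∇-monomial⁴ 0 0 1 0 ⟩
    (+ 0) · monomial⁴ 0 0 1 0 + (+ 0) · monomial⁴ 0 0 1 0 + (+ 1) · monomial⁴ 0 0 0 0 + (+ 0) · monomial⁴ 0 0 1 0
                              ≈⟨ unit₃ (monomial⁴ 0 0 1 0) (monomial⁴ 0 0 1 0) (monomial⁴ 0 0 0 0) (monomial⁴ 0 0 1 0) ⟩
    1#                        ∎
    where open ≈-Reasoning setoid

  ∇-t : δ T ≈ 1#
  ∇-t = begin
    δ T                       ≈⟨ δ-cong {T} {monomial⁴ 0 0 0 1} (mono≈monomial⁴ 0 0 0 1) ⟩
    δ (monomial⁴ 0 0 0 1)     ≈⟨ ∇-monomial⁴ 0 0 0 1 ⟩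
    (+ 0) · monomial⁴ 0 0 0 1 + (+ 0) · monomial⁴ 0 0 0 1 + (+ 0) · monomial⁴ 0 0 0 1 + (+ 1) · monomial⁴ 0 0 0 0
                              ≈⟨ unit₄ (monomial⁴ 0 0 0 1) (monomial⁴ 0 0 0 1) (monomial⁴ 0 0 0 1) (monomial⁴ 0 0 0 0) ⟩
    1#                        ∎
    where open ≈-Reasoning setoid

  δ-u : δ (S + T) ≈ (+ 2) · 1#
  δ-u = trans (δ-+ S T) (trans (+-cong ∇-s ∇-t) (x+x≈2·x 1#))

  δ-q : δ (X + Y) ≈ (+ 2) · 1#
  δ-q = trans (δ-+ X Y) (trans (+-cong ∇-x ∇-y) (x+x≈2·x 1#))

  δ-w : δ (X * Y) ≈ X + Y
  δ-w = trans (δ-* X Y) (trans (+-cong (trans (*-congʳ {Y} ∇-x) (*-identityˡ Y)) (trans (*-congˡ {X} ∇-y) (*-identityʳ X)))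
    (+-comm Y X))

  open Expansion ∇ (S + T) (X + Y) (X * Y) δ-u δ-q δ-w public
    using (p; qDeg; expansion; expansion-0; expansion-unfold; step-expansion; expansion-invariant)

  A≈expansion : ∀ n → A (suc n) ≈ expansion n
  A≈expansion zero    = trans (trans (+-identityʳ (mono 0 0 0 0)) (mono≈monomial⁴ 0 0 0 0)) (sym expansion-0)
  A≈expansion (suc n) = trans (A-suc≈step (suc n) (s≤s z≤n)) (trans (step-cong (A≈expansion n)) (step-expansion n))

  expansion≈formula : ∀ n → expansion n ≈
    ΣP n (λ i → ((S ⊕ₚ T) ^ₚ i) ⊛ ΣP ((n ∸ i) / 2) (λ j →
      cst (γ n i j) ⊛ ((cst (+ 2) ⊛ X ⊛ Y) ^ₚ j) ⊛ ((X ⊕ₚ Y) ^ₚ (n ∸ i ∸ 2 ℕ.* j))))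
  expansion≈formula n = begin
    expansion n
      ≈⟨ expansion-unfold n ⟩
    sumTo n (λ i → (S + T) ^ i * sumTo ((n ∸ i) / 2) (λ j → γ n i j · (p ^ j * (X + Y) ^ qDeg n i j)))
      ≈⟨ sumTo-cong n
           {λ i → (S + T) ^ i * sumTo ((n ∸ i) / 2) (λ j → γ n i j · (p ^ j * (X + Y) ^ qDeg n i j))}
           {λ i → ((S ⊕ₚ T) ^ₚ i) ⊛ ΣP ((n ∸ i) / 2) (λ j →
                    cst (γ n i j) ⊛ ((cst (+ 2) ⊛ X ⊛ Y) ^ₚ j) ⊛ ((X ⊕ₚ Y) ^ₚ (n ∸ i ∸ 2 ℕ.* j)))}
           outer≈ ⟩
    sumTo n (λ i → ((S ⊕ₚ T) ^ₚ i) ⊛ ΣP ((n ∸ i) / 2) (λ j →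
      cst (γ n i j) ⊛ ((cst (+ 2) ⊛ X ⊛ Y) ^ₚ j) ⊛ ((X ⊕ₚ Y) ^ₚ (n ∸ i ∸ 2 ℕ.* j))))
      ≈⟨ ΣP≈sumTo n (λ i → ((S ⊕ₚ T) ^ₚ i) ⊛ ΣP ((n ∸ i) / 2) (λ j →
           cst (γ n i j) ⊛ ((cst (+ 2) ⊛ X ⊛ Y) ^ₚ j) ⊛ ((X ⊕ₚ Y) ^ₚ (n ∸ i ∸ 2 ℕ.* j)))) ⟨
    ΣP n (λ i → ((S ⊕ₚ T) ^ₚ i) ⊛ ΣP ((n ∸ i) / 2) (λ j →
      cst (γ n i j) ⊛ ((cst (+ 2) ⊛ X ⊛ Y) ^ₚ j) ⊛ ((X ⊕ₚ Y) ^ₚ (n ∸ i ∸ 2 ℕ.* j)))) ∎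
    where
    open ≈-Reasoning setoid
    inner≈ : ∀ i j → cst (γ n i j) ⊛ ((cst (+ 2) ⊛ X ⊛ Y) ^ₚ j) ⊛ ((X ⊕ₚ Y) ^ₚ (n ∸ i ∸ 2 ℕ.* j)) ≈
                     γ n i j · (p ^ j * (X + Y) ^ qDeg n i j)
    inner≈ i j = begin
      cst (γ n i j) ⊛ ((cst (+ 2) ⊛ X ⊛ Y) ^ₚ j) ⊛ ((X ⊕ₚ Y) ^ₚ (n ∸ i ∸ 2 ℕ.* j))
        ≈⟨ ⊛≈* (cst (γ n i j) ⊛ ((cst (+ 2) ⊛ X ⊛ Y) ^ₚ j)) ((X ⊕ₚ Y) ^ₚ (n ∸ i ∸ 2 ℕ.* j)) ⟩
      cst (γ n i j) ⊛ ((cst (+ 2) ⊛ X ⊛ Y) ^ₚ j) * (X ⊕ₚ Y) ^ₚ (n ∸ i ∸ 2 ℕ.* j)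
        ≈⟨ *-cong {cst (γ n i j) ⊛ ((cst (+ 2) ⊛ X ⊛ Y) ^ₚ j)} {γ n i j · p ^ j}
                  {(X ⊕ₚ Y) ^ₚ (n ∸ i ∸ 2 ℕ.* j)} {(X + Y) ^ qDeg n i j}
             (trans (cst⊛ (γ n i j) ((cst (+ 2) ⊛ X ⊛ Y) ^ₚ j))
                    (·-congˡ {γ n i j} (trans (^ₚ≈^ (cst (+ 2) ⊛ X ⊛ Y) j) (^-cong j 2xy≈))))
             (trans (^ₚ≈^ (X ⊕ₚ Y) (qDeg n i j)) (^-cong (qDeg n i j) (⊕≈+ X Y))) ⟩
      (γ n i j · p ^ j) * (X + Y) ^ qDeg n i j
        ≈⟨ ·-*-assoc (γ n i j) (p ^ j) ((X + Y) ^ qDeg n i j) ⟩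
      γ n i j · (p ^ j * (X + Y) ^ qDeg n i j) ∎
    outer≈ : ∀ i → (S + T) ^ i * sumTo ((n ∸ i) / 2) (λ j → γ n i j · (p ^ j * (X + Y) ^ qDeg n i j)) ≈
                   ((S ⊕ₚ T) ^ₚ i) ⊛ ΣP ((n ∸ i) / 2) (λ j →
                     cst (γ n i j) ⊛ ((cst (+ 2) ⊛ X ⊛ Y) ^ₚ j) ⊛ ((X ⊕ₚ Y) ^ₚ (n ∸ i ∸ 2 ℕ.* j)))
    outer≈ i = begin
      (S + T) ^ i * sumTo m (λ j → γ n i j · (p ^ j * (X + Y) ^ qDeg n i j))
        ≈⟨ *-cong {(S ⊕ₚ T) ^ₚ i} {(S + T) ^ i} {ΣP m F} {sumTo m (λ j → γ n i j · (p ^ j * (X + Y) ^ qDeg n i j))}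
             (trans (^ₚ≈^ (S ⊕ₚ T) i) (^-cong i (⊕≈+ S T)))
             (trans (ΣP≈sumTo m F) (sumTo-cong m {F} {λ j → γ n i j · (p ^ j * (X + Y) ^ qDeg n i j)} (inner≈ i))) ⟨
      (S ⊕ₚ T) ^ₚ i * ΣP m F
        ≈⟨ ⊛≈* ((S ⊕ₚ T) ^ₚ i) (ΣP m F) ⟨
      ((S ⊕ₚ T) ^ₚ i) ⊛ ΣP m F ∎
      where
      m = (n ∸ i) / 2
      F = λ j → cst (γ n i j) ⊛ ((cst (+ 2) ⊛ X ⊛ Y) ^ₚ j) ⊛ ((X ⊕ₚ Y) ^ₚ (n ∸ i ∸ 2 ℕ.* j))

  A≈formula : ∀ n → A (suc n) ≈
    ΣP n (λ i → ((S ⊕ₚ T) ^ₚ i) ⊛ ΣP ((n ∸ i) / 2) (λ j →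
      cst (γ n i j) ⊛ ((cst (+ 2) ⊛ X ⊛ Y) ^ₚ j) ⊛ ((X ⊕ₚ Y) ^ₚ (n ∸ i ∸ 2 ℕ.* j))))
  A≈formula n = trans (A≈expansion n) (expansion≈formula n)

module Symmetry where

  open import Data.Nat using (suc; _≟_)
  open import Data.Integer as ℤ using (+_)
  open import Data.Sum using (_⊎_; inj₁; inj₂)
  open import Relation.Nullary using (yes; no; contradiction)
  open import Relation.Binary.PropositionalEquality as ≡ using (_≡_; _≢_)
  open import Defs using (Poly; A; sumTo; _⊛_; mono; swapst; swapxy; X; Y; S; T)
  open ℤAlgebras
  open FourVariableSeries
  open ExpansionOfA using (A≈expansion; expansion; expansion-invariant)
  import Relation.Binary.Reasoning.Setoid as ≈-Reasoning

  open ℤ⟦x,y,s,t⟧ using (_≈_; _+_; _*_; _·_; 1#; refl; sym; trans; +-cong; +-comm; *-comm; *-cong; setoid)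

  mono-diag : ∀ a b c d → mono a b c d a b c d ≡ + 1
  mono-diag a b c d with a ≟ a | b ≟ b | c ≟ c | d ≟ d
  ... | yes _ | yes _ | yes _ | yes _ = ≡.refl
  ... | no a≢a | _     | _     | _     = contradiction ≡.refl a≢a
  ... | yes _  | no b≢b | _    | _     = contradiction ≡.refl b≢b
  ... | yes _  | yes _ | no c≢c | _    = contradiction ≡.refl c≢c
  ... | yes _  | yes _ | yes _ | no d≢d = contradiction ≡.refl d≢d

  mono-off : ∀ a b c d p q r u → a ≢ p ⊎ b ≢ q ⊎ c ≢ r ⊎ d ≢ u → mono a b c d p q r u ≡ + 0
  mono-off a b c d p q r u off with a ≟ p | b ≟ q | c ≟ r | d ≟ u
  ... | yes a≡p | yes b≡q | yes c≡r | yes d≡u = contradiction off λ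
    { (inj₁ a≢p) → a≢p a≡p ; (inj₂ (inj₁ b≢q)) → b≢q b≡q ; (inj₂ (inj₂ (inj₁ c≢r))) → c≢r c≡r ; (inj₂ (inj₂ (inj₂ d≢u))) → d≢u d≡u }
  ... | no _  | _     | _     | _     = ≡.refl
  ... | yes _ | no _  | _     | _     = ≡.refl
  ... | yes _ | yes _ | no _  | _     = ≡.refl
  ... | yes _ | yes _ | yes _ | no _  = ≡.refl

  swapst-mono : ∀ a b c d → swapst (mono a b c d) ≈ mono a b d c
  swapst-mono a b c d = sym (mono-unique a b d c (swapst (mono a b c d)) (mono-diag a b c d) λ p q r u off →
    mono-off a b c d p q u r (reorder off))
    where
    reorder : ∀ {A B C D : Set} → A ⊎ B ⊎ C ⊎ D → A ⊎ B ⊎ D ⊎ C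
    reorder (inj₁ x)               = inj₁ x
    reorder (inj₂ (inj₁ x))        = inj₂ (inj₁ x)
    reorder (inj₂ (inj₂ (inj₁ x))) = inj₂ (inj₂ (inj₂ x))
    reorder (inj₂ (inj₂ (inj₂ x))) = inj₂ (inj₂ (inj₁ x))

  swapxy-mono : ∀ a b c d → swapxy (mono a b c d) ≈ mono b a c d
  swapxy-mono a b c d = sym (mono-unique b a c d (swapxy (mono a b c d)) (mono-diag a b c d) λ p q r u off →
    mono-off a b c d q p r u (reorder off))
    where
    reorder : ∀ {A B C D : Set} → A ⊎ B ⊎ C ⊎ D → B ⊎ A ⊎ C ⊎ D
    reorder (inj₁ x)        = inj₂ (inj₁ x)
    reorder (inj₂ (inj₁ x)) = inj₁ x
    reorder (inj₂ (inj₂ x)) = inj₂ (inj₂ x)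

  sumTo-comm≡ : ∀ m n F → sumTo m (λ i → sumTo n (F i)) ≡ sumTo n (λ j → sumTo m (λ i → F i j))
  sumTo-comm≡ m n F = ≡.trans (≡.sym (≡.trans (sumTo-ℤ m _) (sumTo-cong≡ m (λ i → sumTo-ℤ n (F i)))))
    (≡.trans (ℤAlgebra.sumTo-comm ℤ-algebra m n F) (≡.trans (sumTo-ℤ n _) (sumTo-cong≡ n (λ j → sumTo-ℤ m _))))

  swapst-⊛ : ∀ P Q → swapst (P ⊛ Q) ≈ swapst P ⊛ swapst Q
  swapst-⊛ P Q a b c d = sumTo-cong≡ a (λ a₁ → sumTo-cong≡ b (λ b₁ → sumTo-comm≡ d c _))

  swapxy-⊛ : ∀ P Q → swapxy (P ⊛ Q) ≈ swapxy P ⊛ swapxy Q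
  swapxy-⊛ P Q a b c d = sumTo-comm≡ b a _

  ⊛-endomorphism : ∀ {φ : Poly → Poly} → (∀ {P Q} → P ≈ Q → φ P ≈ φ Q) → (∀ P Q → φ (P ⊛ Q) ≈ φ P ⊛ φ Q) →
    φ (mono 0 0 0 0) ≈ mono 0 0 0 0 → (∀ P Q → φ (P + Q) ≈ φ P + φ Q) → (∀ k P → φ (k · P) ≈ k · φ P) →
    IsEndomorphism ℤ⟦x,y,s,t⟧ φ
  ⊛-endomorphism {φ} φ-cong φ-⊛ φ-1 φ-+ φ-· = record
    { φ-cong = φ-cong
    ; φ-+    = φ-+
    ; φ-*    = λ P Q → begin
        φ (P * Q)       ≈⟨ φ-cong {P ⊛ Q} {P * Q} (⊛≈* P Q) ⟨
        φ (P ⊛ Q)       ≈⟨ φ-⊛ P Q ⟩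
        φ P ⊛ φ Q       ≈⟨ ⊛≈* (φ P) (φ Q) ⟩
        φ P * φ Q       ∎
    ; φ-·    = φ-·
    ; φ-1#   = begin
        φ 1#            ≈⟨ φ-cong {mono 0 0 0 0} {1#} (mono≈monomial⁴ 0 0 0 0) ⟨
        φ (mono 0 0 0 0) ≈⟨ φ-1 ⟩
        mono 0 0 0 0    ≈⟨ mono≈monomial⁴ 0 0 0 0 ⟩
        1#              ∎
    }
    where open ≈-Reasoning setoid

  swapst-endomorphism : IsEndomorphism ℤ⟦x,y,s,t⟧ swapst
  swapst-endomorphism = ⊛-endomorphism (λ P≈Q a b c d → P≈Q a b d c) swapst-⊛ (swapst-mono 0 0 0 0)
    (λ P Q a b c d → ≡.refl) (λ k P a b c d → ≡.refl)

  swapxy-endomorphism : IsEndomorphism ℤ⟦x,y,s,t⟧ swapxy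
  swapxy-endomorphism = ⊛-endomorphism (λ P≈Q a b c d → P≈Q b a c d) swapxy-⊛ (swapxy-mono 0 0 0 0)
    (λ P Q a b c d → ≡.refl) (λ k P a b c d → ≡.refl)

  swapst-s+t : swapst (S + T) ≈ S + T
  swapst-s+t = begin
    swapst (S + T)        ≈⟨ +-cong (swapst-mono 0 0 1 0) (swapst-mono 0 0 0 1) ⟩
    T + S                 ≈⟨ +-comm T S ⟩
    S + T                 ∎
    where open ≈-Reasoning setoid

  swapst-x+y : swapst (X + Y) ≈ X + Y
  swapst-x+y = +-cong (swapst-mono 1 0 0 0) (swapst-mono 0 1 0 0)

  swapst-xy : swapst (X * Y) ≈ X * Y
  swapst-xy = begin
    swapst (X * Y)         ≈⟨ IsEndomorphism.φ-* swapst-endomorphism X Y ⟩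
    swapst X * swapst Y    ≈⟨ *-cong (swapst-mono 1 0 0 0) (swapst-mono 0 1 0 0) ⟩
    X * Y                  ∎
    where open ≈-Reasoning setoid

  swapxy-s+t : swapxy (S + T) ≈ S + T
  swapxy-s+t = +-cong (swapxy-mono 0 0 1 0) (swapxy-mono 0 0 0 1)

  swapxy-x+y : swapxy (X + Y) ≈ X + Y
  swapxy-x+y = begin
    swapxy (X + Y)        ≈⟨ +-cong (swapxy-mono 1 0 0 0) (swapxy-mono 0 1 0 0) ⟩
    Y + X                 ≈⟨ +-comm Y X ⟩
    X + Y                 ∎
    where open ≈-Reasoning setoid

  swapxy-xy : swapxy (X * Y) ≈ X * Y
  swapxy-xy = begin
    swapxy (X * Y)         ≈⟨ IsEndomorphism.φ-* swapxy-endomorphism X Y ⟩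
    swapxy X * swapxy Y    ≈⟨ *-cong (swapxy-mono 1 0 0 0) (swapxy-mono 0 1 0 0) ⟩
    Y * X                  ≈⟨ *-comm Y X ⟩
    X * Y                  ∎
    where open ≈-Reasoning setoid

  A-invariant : ∀ {φ} → IsEndomorphism ℤ⟦x,y,s,t⟧ φ → φ (S + T) ≈ S + T → φ (X + Y) ≈ X + Y → φ (X * Y) ≈ X * Y →
    ∀ n → φ (A (suc n)) ≈ A (suc n)
  A-invariant {φ} φ-endo φu φq φw n = begin
    φ (A (suc n))   ≈⟨ IsEndomorphism.φ-cong φ-endo {A (suc n)} {expansion n} (A≈expansion n) ⟩
    φ (expansion n) ≈⟨ expansion-invariant φ-endo φu φq φw n ⟩
    expansion n     ≈⟨ A≈expansion n ⟨
    A (suc n)       ∎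
    where open ≈-Reasoning setoid

  swapst-A : ∀ n → swapst (A (suc n)) ≈ A (suc n)
  swapst-A = A-invariant swapst-endomorphism swapst-s+t swapst-x+y swapst-xy

  swapxy-A : ∀ n → swapxy (A (suc n)) ≈ A (suc n)
  swapxy-A = A-invariant swapxy-endomorphism swapxy-s+t swapxy-x+y swapxy-xy

open import Defs
open import Data.Nat using (ℕ; suc; _∸_; _≤_; _/_; _*_)
open import Data.Integer using (+_)
open import Data.Product using (_×_; _,_)
open Recurrence using (A-recurrence)
open ExpansionOfA using (A≈formula)
open Symmetry using (swapst-A; swapxy-A)

theorem3p13 :
    (∀ (n : ℕ) → 1 ≤ n →
      A (suc n) ≈ (S ⊕ T) ⊛ A n ⊕ (X ⊛ Y) ⊛ (∂x (A n) ⊕ ∂y (A n) ⊕ ∂s (A n) ⊕ ∂t (A n)))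
    × (∀ (n : ℕ) →
      A (suc n) ≈ ΣP n (λ i → ((S ⊕ T) ^ₚ i) ⊛ ΣP ((n ∸ i) / 2) (λ j →
        cst (γ n i j) ⊛ ((cst (+ 2) ⊛ X ⊛ Y) ^ₚ j) ⊛ ((X ⊕ Y) ^ₚ (n ∸ i ∸ 2 * j)))))
    × (∀ (n : ℕ) → swapst (A (suc n)) ≈ A (suc n))
    × (∀ (n : ℕ) → swapxy (A (suc n)) ≈ A (suc n))
theorem3p13 = A-recurrence , A≈formula , swapst-A , swapxy-A
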